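{- Let $\phi$ and $\psi$ be two $\mathbf{FO}^2$ sentences (function-free first-order sentences using at most two logical variables), equipped with real-valued weightings $(w,\overline{w})$ and $(w',\overline{w}')$ respectively, and let $G_{\phi}$ and $G_{\psi}$ be their respective cell graphs (computed with these weightings). If $G_{\phi}$ is isomorphic to $G_{\psi}$, then $$\mathsf{WFOMC}(\phi,n,w,\overline{w})=\mathsf{WFOMC}(\psi,n,w',\overline{w}')$$ for every domain size $n\in\mathbb{N}$.
   Context: Semantics: Herbrand semantics over a finite domain $\Delta$ of size $n$; $\mathsf{HB}$ is the set of all ground atoms; a possible world $\omega$ is a subset of $\mathsf{HB}$ (its elements true, all others false). A weighting is a pair of maps $w,\overline{w}:\mathcal{P}\to\mathbb{R}$ from the predicates of the language (positive and negative weight). Weighted first-order model counting: $\mathsf{WFOMC}(\phi,n,w,\overline{w})=\sum_{\omega\subseteq \mathsf{HB},\ \omega\models\phi}\prod_{l\in\omega}w(\mathrm{pred}(l))\prod_{l\in\mathsf{HB}\setminus\omega}\overline{w}(\mathrm{pred}(l))$, where $\mathrm{pred}(l)$ is the predicate of atom $l$. $\mathsf{WMC}$ denotes the analogous weighted model count of a ground (propositional) formula, summing over truth assignments to its ground atoms. Cell graphs are defined for a universally quantified sentence $\forall x\forall y\,\phi(x,y)$ with $\phi(x,y)$ quantifier-free; an $\mathbf{FO}^2$ sentence with existential quantifiers is first brought to this form by the standard WFOMC-preserving Skolemization, which introduces fresh Skolem predicates $Sk$ with $w(Sk)=1$, $\overline{w}(Sk)=-1$, and its cell graph is that of the resulting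 universal sentence. A cell of $\phi$ is a maximal consistent conjunction of literals formed from the atoms of $\phi$ using only a single variable (i.e. from the unary atoms $P(x)$ and reflexive atoms $R(x,x)$); let $C_1,\dots,C_p$ be the cells. Put $\psi_{ij}(x,y)=\phi(x,y)\wedge\phi(y,x)\wedge C_i(x)\wedge C_j(y)$ and $\psi_k(x)=\phi(x,x)\wedge C_k(x)$, and for distinct domain elements $A,B$ define $r_{ij}=\mathsf{WMC}(\psi_{ij}(A,B),w_*,\overline{w}_*)$ and $w_k=\mathsf{WMC}(\psi_k(A),w,\overline{w})$, where $(w_*,\overline{w}_*)$ agrees with $(w,\overline{w})$ except that all atoms occurring in the conditioned cells (the unary and reflexive atoms on $A$ and $B$) get weight $1$ (both positive and negative). The cell graph $G_\phi$ is the complete graph on vertex set $\{1,\dots,p\}$ (with loops) in which vertex $i$ is labelled $w_i$ and the edge $\{i,j\}$ (including loops $i=j$) is labelled $r_{ij}$ (note $r_{ij}=r_{ji}$). Two cell graphs $G,G'$ with vertex labels $w_i$, $w'_i$ and edge labels $r_{ij}$, $r'_{ij}$ are isomorphic if there is a bijection $f:V(G)\to V(G')$ such that $w'_i=w_{f(i)}$ and $r'_{ij}=r_{f(i),f(j)}$ for all $i,j$. -}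

module Defs where

import Level
open import Data.Nat as ℕ using (ℕ; zero; suc; _+_; NonZero)
open import Data.Fin as Fin using (Fin; zero; suc; splitAt; _↑ˡ_; _↑ʳ_)
open import Data.Bool as Bool using (Bool; true; false; if_then_else_; _∧_; _∨_; not)
open import Data.Vec as Vec using (Vec; tabulate; _++_)
open import Data.Vec.Properties using (≡-dec)
open import Data.List as List using (List; []; _∷_)
open import Data.Maybe using (Maybe; just; nothing)
open import Data.Sum using ([_,_])
open import Data.Product using (Σ; _×_; _,_; proj₁; proj₂)
open import Data.Product.Properties as ×P using ()
open import Relation.Nullary.Decidable using (⌊_⌋)
open import Relation.Binary.PropositionalEquality using (_≡_)
open import Algebra.Bundles using (CommutativeRing)
open import Function.Bundles using (_↔_; Inverse)

data Var : Set where
  vx vy : Var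

other : Var → Var
other vx = vy
other vy = vx

_==ᵛ_ : Var → Var → Bool
vx ==ᵛ vx = true
vy ==ᵛ vy = true
_  ==ᵛ _  = false

infixr 6 _∧'_
infixr 5 _∨'_

data Fm (u b : ℕ) : Set where
  atom₁ : Fin u → Var → Fm u b
  atom₂ : Fin b → Var → Var → Fm u b
  ¬'_   : Fm u b → Fm u b
  _∧'_  : Fm u b → Fm u b → Fm u b
  _∨'_  : Fm u b → Fm u b → Fm u b
  ∀'    : Var → Fm u b → Fm u b
  ∃'    : Var → Fm u b → Fm u b

_⇒'_ : ∀ {u b} → Fm u b → Fm u b → Fm u b
φ ⇒' ψ = (¬' φ) ∨' ψ

free : ∀ {u b} → Fm u b → Var → Bool
free (atom₁ _ v) z = v ==ᵛ z
free (atom₂ _ v w) z = (v ==ᵛ z) ∨ (w ==ᵛ z)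
free (¬' φ) z = free φ z
free (φ ∧' ψ) z = free φ z ∨ free ψ z
free (φ ∨' ψ) z = free φ z ∨ free ψ z
free (∀' v φ) z = free φ z ∧ not (v ==ᵛ z)
free (∃' v φ) z = free φ z ∧ not (v ==ᵛ z)

Sentence : ∀ {u b} → Fm u b → Set
Sentence φ = (free φ vx ≡ false) × (free φ vy ≡ false)

quantifierFree : ∀ {u b} → Fm u b → Bool
quantifierFree (atom₁ _ _) = true
quantifierFree (atom₂ _ _ _) = true
quantifierFree (¬' φ) = quantifierFree φ
quantifierFree (φ ∧' ψ) = quantifierFree φ ∧ quantifierFree ψ
quantifierFree (φ ∨' ψ) = quantifierFree φ ∧ quantifierFree ψ
quantifierFree (∀' _ _) = false
quantifierFree (∃' _ _) = false

record World (u b n : ℕ) : Set where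
  constructor world
  field
    unary  : Fin u → Fin n → Bool
    binary : Fin b → Fin n → Fin n → Bool
open World public

Env : ℕ → Set
Env n = Var → Fin n

_[_↦_] : ∀ {n} → Env n → Var → Fin n → Env n
(ρ [ v ↦ a ]) z = if v ==ᵛ z then a else ρ z

allFin : ∀ n → (Fin n → Bool) → Bool
allFin zero    f = true
allFin (suc n) f = f zero ∧ allFin n (λ i → f (suc i))

anyFin : ∀ n → (Fin n → Bool) → Bool
anyFin zero    f = false
anyFin (suc n) f = f zero ∨ anyFin n (λ i → f (suc i))

eval : ∀ {u b n} → World u b n → Env n → Fm u b → Bool
eval ω ρ (atom₁ p v) = unary ω p (ρ v)
eval ω ρ (atom₂ r v w) = binary ω r (ρ v) (ρ w)
eval ω ρ (¬' φ) = not (eval ω ρ φ)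
eval ω ρ (φ ∧' ψ) = eval ω ρ φ ∧ eval ω ρ ψ
eval ω ρ (φ ∨' ψ) = eval ω ρ φ ∨ eval ω ρ ψ
eval {n = n} ω ρ (∀' v φ) = allFin n (λ a → eval ω (ρ [ v ↦ a ]) φ)
eval {n = n} ω ρ (∃' v φ) = anyFin n (λ a → eval ω (ρ [ v ↦ a ]) φ)

-- a distinguished element of a nonempty domain (used only to supply an
-- environment; irrelevant for sentences)
elem₀ : ∀ n → .{{NonZero n}} → Fin n
elem₀ (suc n) = zero

-- Cells: assignments to the unary atoms P(x) and reflexive atoms R(x,x).

Cell : ℕ → ℕ → Set
Cell u b = Vec Bool u × Vec Bool b

cellOf : ∀ {u b n} → World u b n → Fin n → Cell u b
cellOf ω i = tabulate (λ p → unary ω p i) , tabulate (λ r → binary ω r i i)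

_≟ᶜ_ : ∀ {u b} → (c d : Cell u b) → Bool
c ≟ᶜ d = ⌊ ×P.≡-dec (≡-dec Bool._≟_) (≡-dec Bool._≟_) c d ⌋

-- Every quantified subformula Q v χ gets a fresh unary predicate A
-- (weights 1,1) with A(w) ↔ Q v χ (w the other variable), and every
-- resulting ∀w∃v θ conjunct a fresh Skolem predicate S (weights 1,-1)
-- replacing it by ∀w∀v (S(w) ∨ ¬θ).

rename : ∀ {u u' b} → (Fin u → Fin u') → Fm u b → Fm u' b
rename f (atom₁ p v) = atom₁ (f p) v
rename f (atom₂ r v w) = atom₂ r v w
rename f (¬' φ) = ¬' rename f φ
rename f (φ ∧' ψ) = rename f φ ∧' rename f ψ
rename f (φ ∨' ψ) = rename f φ ∨' rename f ψ
rename f (∀' v φ) = ∀' v (rename f φ)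
rename f (∃' v φ) = ∃' v (rename f φ)

nq : ∀ {u b} → Fm u b → ℕ
nq (atom₁ _ _) = 0
nq (atom₂ _ _ _) = 0
nq (¬' φ) = nq φ
nq (φ ∧' ψ) = nq φ + nq ψ
nq (φ ∨' ψ) = nq φ + nq ψ
nq (∀' _ φ) = suc (nq φ)
nq (∃' _ φ) = suc (nq φ)

embL : ∀ u m k → Fin (u + m) → Fin (u + (m + k))
embL u m k i = [ (λ p → p ↑ˡ (m + k)) , (λ j → u ↑ʳ (j ↑ˡ k)) ] (splitAt u i)

embR : ∀ u m k → Fin (u + k) → Fin (u + (m + k))
embR u m k i = [ (λ p → p ↑ˡ (m + k)) , (λ j → u ↑ʳ (m ↑ʳ j)) ] (splitAt u i)

embS : ∀ u m → Fin (u + m) → Fin (u + suc m)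
embS u m i = [ (λ p → p ↑ˡ suc m) , (λ j → u ↑ʳ suc j) ] (splitAt u i)

newA : ∀ u m → Fin (u + suc m)
newA u m = u ↑ʳ zero

tr : ∀ {u b} → (φ : Fm u b) → Fm (u + nq φ) b
tr {u} (atom₁ p v) = atom₁ (p ↑ˡ 0) v
tr (atom₂ r v w) = atom₂ r v w
tr (¬' φ) = ¬' tr φ
tr {u} (φ ∧' ψ) = rename (embL u (nq φ) (nq ψ)) (tr φ) ∧' rename (embR u (nq φ) (nq ψ)) (tr ψ)
tr {u} (φ ∨' ψ) = rename (embL u (nq φ) (nq ψ)) (tr φ) ∨' rename (embR u (nq φ) (nq ψ)) (tr ψ)
tr {u} (∀' v φ) = atom₁ (newA u (nq φ)) (other v)
tr {u} (∃' v φ) = atom₁ (newA u (nq φ)) (other v)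

-- universally quantified (∀x∀y) defining constraints
univDefs : ∀ {u b} → (φ : Fm u b) → List (Fm (u + nq φ) b)
univDefs (atom₁ _ _) = []
univDefs (atom₂ _ _ _) = []
univDefs (¬' φ) = univDefs φ
univDefs {u} (φ ∧' ψ) = List.map (rename (embL u (nq φ) (nq ψ))) (univDefs φ)
                 List.++ List.map (rename (embR u (nq φ) (nq ψ))) (univDefs ψ)
univDefs {u} (φ ∨' ψ) = List.map (rename (embL u (nq φ) (nq ψ))) (univDefs φ)
                 List.++ List.map (rename (embR u (nq φ) (nq ψ))) (univDefs ψ)
univDefs {u} (∀' v φ) =
  (atom₁ (newA u (nq φ)) (other v) ⇒' rename (embS u (nq φ)) (tr φ))
  ∷ List.map (rename (embS u (nq φ))) (univDefs φ)
univDefs {u} (∃' v φ) =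
  (rename (embS u (nq φ)) (tr φ) ⇒' atom₁ (newA u (nq φ)) (other v))
  ∷ List.map (rename (embS u (nq φ))) (univDefs φ)

-- ∀w∃v θ(w,v) constraints, recorded as (w , θ); exactly one per quantifier
exDefs : ∀ {u b} → (φ : Fm u b) → Vec (Var × Fm (u + nq φ) b) (nq φ)
exDefs (atom₁ _ _) = Vec.[]
exDefs (atom₂ _ _ _) = Vec.[]
exDefs (¬' φ) = exDefs φ
exDefs {u} (φ ∧' ψ) =
  Vec.map (λ (w , θ) → w , rename (embL u (nq φ) (nq ψ)) θ) (exDefs φ)
  ++ Vec.map (λ (w , θ) → w , rename (embR u (nq φ) (nq ψ)) θ) (exDefs ψ)
exDefs {u} (φ ∨' ψ) =
  Vec.map (λ (w , θ) → w , rename (embL u (nq φ) (nq ψ)) θ) (exDefs φ)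
  ++ Vec.map (λ (w , θ) → w , rename (embR u (nq φ) (nq ψ)) θ) (exDefs ψ)
exDefs {u} (∀' v φ) =
  (other v , (atom₁ (newA u (nq φ)) (other v) ∨' (¬' rename (embS u (nq φ)) (tr φ))))
  Vec.∷ Vec.map (λ (w , θ) → w , rename (embS u (nq φ)) θ) (exDefs φ)
exDefs {u} (∃' v φ) =
  (other v , (atom₁ (newA u (nq φ)) (other v) ⇒' rename (embS u (nq φ)) (tr φ)))
  Vec.∷ Vec.map (λ (w , θ) → w , rename (embS u (nq φ)) θ) (exDefs φ)

-- number of unary predicates after Skolemization: original + A's + S's
skU : ∀ {u b} → Fm u b → ℕ
skU {u} φ = (u + nq φ) + nq φ

-- the quantifier-free matrix M of the Skolemized sentence ∀x∀y M
skMatrix : ∀ {u b} → (φ : Fm u b) → Fm (skU φ) b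
skMatrix {u} φ =
  List.foldr _∧'_ (up (tr φ))
    (List.map up (univDefs φ)
     List.++ Vec.toList (Vec.zipWith skol (Vec.allFin (nq φ)) (exDefs φ)))
  where
    up : _ → _
    up = rename (λ i → i ↑ˡ nq φ)
    skol : Fin (nq φ) → Var × Fm (u + nq φ) _ → Fm (skU φ) _
    skol i (w , θ) = atom₁ ((u + nq φ) ↑ʳ i) w ∨' (¬' up θ)

universalMatrix : ∀ {u b} → Fm u b → Maybe (Fm u b)
universalMatrix (∀' vx (∀' vy M)) = if quantifierFree M then just M else nothing
universalMatrix _ = nothing

-- Weights, WMC, WFOMC and cell graphs, over a commutative ring
-- (the paper's weights are real numbers; ℝ is one such ring).

module Weighted {c ℓ} (R : CommutativeRing c ℓ) where
  open CommutativeRing R using (Carrier; _≈_; 0#; 1#; -_) renaming (_+_ to _⊕_; _*_ to _⊗_)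

  record Weighting (u b : ℕ) : Set c where
    field
      w₁ w̄₁ : Fin u → Carrier
      w₂ w̄₂ : Fin b → Carrier
  open Weighting public

  sumFin : ∀ m → (Fin m → Carrier) → Carrier
  sumFin zero    f = 0#
  sumFin (suc m) f = f zero ⊕ sumFin m (λ i → f (suc i))

  prodFin : ∀ m → (Fin m → Carrier) → Carrier
  prodFin zero    f = 1#
  prodFin (suc m) f = f zero ⊗ prodFin m (λ i → f (suc i))

  sumBool : (Bool → Carrier) → Carrier
  sumBool f = f true ⊕ f false

  sumFun : ∀ {A : Set} m → ((A → Carrier) → Carrier) → ((Fin m → A) → Carrier) → Carrier
  sumFun zero    sA f = f (λ ())
  sumFun (suc m) sA f = sA (λ a → sumFun m sA (λ g → f (λ { zero → a ; (suc i) → g i })))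

  sumWorlds : ∀ u b n → (World u b n → Carrier) → Carrier
  sumWorlds u b n f =
    sumFun u (sumFun n sumBool) (λ U →
    sumFun b (sumFun n (sumFun n sumBool)) (λ B → f (world U B)))

  ⟦_⟧ : Bool → Carrier
  ⟦ true ⟧  = 1#
  ⟦ false ⟧ = 0#

  lit : Bool → Carrier → Carrier → Carrier
  lit true  a _ = a
  lit false _ a = a

  weight : ∀ {u b n} → Weighting u b → World u b n → Carrier
  weight {u} {b} {n} W ω =
    prodFin u (λ p → prodFin n (λ i → lit (unary ω p i) (w₁ W p) (w̄₁ W p)))
    ⊗ prodFin b (λ r → prodFin n (λ i → prodFin n (λ j →
        lit (binary ω r i j) (w₂ W r) (w̄₂ W r))))

  -- the weighting (w*, w̄*): atoms of the conditioned cells (unary atoms and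
  -- reflexive binary atoms) get weight 1, the others keep (w , w̄)
  weight* : ∀ {u b n} → Weighting u b → World u b n → Carrier
  weight* {u} {b} {n} W ω =
    prodFin u (λ p → prodFin n (λ i → 1#))
    ⊗ prodFin b (λ r → prodFin n (λ i → prodFin n (λ j →
        if ⌊ i Fin.≟ j ⌋ then 1#
        else lit (binary ω r i j) (w₂ W r) (w̄₂ W r))))

  WFOMC : ∀ {u b} → Fm u b → (n : ℕ) → .{{NonZero n}} → Weighting u b → Carrier
  WFOMC {u} {b} φ n W =
    sumWorlds u b n (λ ω → ⟦ eval ω (λ _ → elem₀ n) φ ⟧ ⊗ weight W ω)

  record CellGraph : Set c where
    field
      cu cb  : ℕ
      vlabel : Cell cu cb → Carrier
      elabel : Cell cu cb → Cell cu cb → Carrier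
  open CellGraph public

  -- domain elements A = 0 and B = 1
  ρAA : Env 1
  ρAA _ = zero

  ρAB ρBA : Env 2
  ρAB vx = zero
  ρAB vy = suc zero
  ρBA vx = suc zero
  ρBA vy = zero

  -- cell graph of ∀x∀y φ(x,y), φ quantifier-free
  cellGraphᵘ : ∀ {u b} → Fm u b → Weighting u b → CellGraph
  cellGraphᵘ {u} {b} φ W = record
    { cu = u ; cb = b
    ; vlabel = λ k → sumWorlds u b 1 (λ ω →
        ⟦ eval ω ρAA φ ∧ (cellOf ω zero ≟ᶜ k) ⟧ ⊗ weight W ω)
    ; elabel = λ i j → sumWorlds u b 2 (λ ω →
        ⟦ eval ω ρAB φ ∧ eval ω ρBA φ
          ∧ (cellOf ω zero ≟ᶜ i) ∧ (cellOf ω (suc zero) ≟ᶜ j) ⟧ ⊗ weight* W ω)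
    }

  skWeighting : ∀ {u b} → (φ : Fm u b) → Weighting u b → Weighting (skU φ) b
  skWeighting {u} φ W = record
    { w₁  = λ i → [ (λ i' → [ w₁ W , (λ _ → 1#) ] (splitAt u i')) , (λ _ → 1#) ]
                    (splitAt (u + nq φ) i)
    ; w̄₁ = λ i → [ (λ i' → [ w̄₁ W , (λ _ → 1#) ] (splitAt u i')) , (λ _ → - 1#) ]
                    (splitAt (u + nq φ) i)
    ; w₂  = w₂ W
    ; w̄₂ = w̄₂ W
    }

  cellGraph : ∀ {u b} → Fm u b → Weighting u b → CellGraph
  cellGraph φ W with universalMatrix φ
  ... | just M  = cellGraphᵘ M W
  ... | nothing = cellGraphᵘ (skMatrix φ) (skWeighting φ W)

  Isomorphic : CellGraph → CellGraph → Set ℓ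
  Isomorphic G G' =
    Σ (Cell (cu G') (cb G') ↔ Cell (cu G) (cb G)) λ f →
      ((i : Cell (cu G') (cb G')) → vlabel G' i ≈ vlabel G (Inverse.to f i))
      × ((i j : Cell (cu G') (cb G')) →
           elabel G' i j ≈ elabel G (Inverse.to f i) (Inverse.to f j))

-- For a universal sentence ∀x∀y M (M quantifier-free) build the worlds on Fin (n + 1) from a world on Fin n
-- and a new element: the new element contributes its cell, its links to each old element and nothing else, and
-- both the constraint M and the weight factor accordingly. By induction
--   WFOMC = Σ_{c : Fin n → cells} Π_i w_{c i} Π_{i<j} r_{c i, c j},
-- an expression in the labelled cell graph alone, so it is invariant under cell-graph isomorphism (reindex each
-- sum over cells along the bijection).
--
-- Any other sentence is first Skolemized. The auxiliary predicate introduced for a quantified subformula is forced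
-- by its Scott constraints to be that subformula's truth value, so summing it out selects one interpretation; a
-- Skolem predicate s with weights (1, −1) contributes Σ_s [s ∨ ¬θ] (±1) = [θ has a witness]. Hence Skolemization
-- preserves WFOMC.

module Submission where

open import Defs
open import Level using (Level; _⊔_) renaming (suc to lsuc; zero to lzero)
open import Data.Nat using (ℕ; NonZero)
import Data.Nat as ℕ
open import Data.Fin as Fin using (Fin; zero; suc)
open import Data.Bool as Bool using (Bool; true; false; _∧_; _∨_; not; if_then_else_)
open import Data.Product using (Σ; _×_; _,_; proj₁; proj₂)
open import Data.Unit using (⊤; tt)
open import Relation.Binary.PropositionalEquality as P using (_≡_)
open import Algebra.Bundles using (CommutativeRing)
open import Function.Bundles using (_↔_; Inverse)
import Data.Vec.Properties as VP
open import Data.Maybe using (just; nothing)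
import Data.Bool.Properties as BP
open import Data.List as List using (List) renaming ([] to []ₗ; _∷_ to _∷ₗ_)
import Data.Fin.Properties as FP
open import Data.Sum using (inj₁; inj₂; [_,_]′; [_,_])
import Data.Product.Properties as ×P
open import Relation.Nullary using (Dec; yes; no)
open import Relation.Nullary.Decidable using (⌊_⌋)
open import Data.Empty using (⊥-elim)
import Algebra.Solver.CommutativeMonoid
open import Data.Vec as Vec using (Vec; tabulate; lookup; _∷_; [])

∧-intro : ∀ {x y} → x ≡ true → y ≡ true → (x ∧ y) ≡ true
∧-intro P.refl P.refl = P.refl

∧-elimˡ : ∀ x {y} → (x ∧ y) ≡ true → x ≡ true
∧-elimˡ true _ = P.refl
∧-elimˡ false ()

∧-elimʳ : ∀ x {y} → (x ∧ y) ≡ true → y ≡ true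
∧-elimʳ true p = p
∧-elimʳ false ()

∧-interchange : ∀ a b c d → (a ∧ b) ∧ (c ∧ d) ≡ (a ∧ c) ∧ (b ∧ d)
∧-interchange true true c d = P.refl
∧-interchange true false c d = P.sym (BP.∧-zeroʳ c)
∧-interchange false b c d = P.refl

∨-true-r : ∀ x {y} → y ≡ true → x ∨ y ≡ true
∨-true-r true _ = P.refl
∨-true-r false e = e

not-true : ∀ {x} → not x ≡ true → x ≡ false
not-true {false} _ = P.refl

Bool-ext : ∀ {x y : Bool} → (x ≡ true → y ≡ true) → (y ≡ true → x ≡ true) → x ≡ y
Bool-ext {true} {true} f g = P.refl
Bool-ext {true} {false} f g = P.sym (f P.refl)
Bool-ext {false} {true} f g = g P.refl
Bool-ext {false} {false} f g = P.refl

beq : Bool → Bool → Bool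
beq true true = true
beq false false = true
beq _ _ = false

beq-≡ : ∀ {x y} → beq x y ≡ true → x ≡ y
beq-≡ {true} {true} _ = P.refl
beq-≡ {false} {false} _ = P.refl
beq-≡ {true} {false} ()
beq-≡ {false} {true} ()

≡-beq : ∀ {x y} → x ≡ y → beq x y ≡ true
≡-beq {true} P.refl = P.refl
≡-beq {false} P.refl = P.refl

dec-true : ∀ {Q : Set} (d : Dec Q) → ⌊ d ⌋ ≡ true → Q
dec-true (yes q) _ = q
dec-true (no _) ()

true-dec : ∀ {Q : Set} (d : Dec Q) → Q → ⌊ d ⌋ ≡ true
true-dec (yes q) _ = P.refl
true-dec (no nq) q = ⊥-elim (nq q)

allFin-intro : ∀ n {f : Fin n → Bool} → (∀ i → f i ≡ true) → allFin n f ≡ true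
allFin-intro ℕ.zero p = P.refl
allFin-intro (ℕ.suc n) p = ∧-intro (p zero) (allFin-intro n (λ i → p (suc i)))

allFin-elim : ∀ n {f : Fin n → Bool} → allFin n f ≡ true → ∀ i → f i ≡ true
allFin-elim (ℕ.suc n) {f} p zero = ∧-elimˡ (f zero) p
allFin-elim (ℕ.suc n) {f} p (suc i) = allFin-elim n (∧-elimʳ (f zero) p) i

allFin-cong : ∀ n {f g : Fin n → Bool} → (∀ i → f i ≡ g i) → allFin n f ≡ allFin n g
allFin-cong ℕ.zero p = P.refl
allFin-cong (ℕ.suc n) p = P.cong₂ _∧_ (p zero) (allFin-cong n (λ i → p (suc i)))

allFin-∧ : ∀ n (f g : Fin n → Bool) → allFin n (λ i → f i ∧ g i) ≡ allFin n f ∧ allFin n g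
allFin-∧ n f g = Bool-ext
  (λ e → ∧-intro (allFin-intro n (λ i → ∧-elimˡ _ (allFin-elim n e i))) (allFin-intro n (λ i → ∧-elimʳ _ (allFin-elim n e i))))
  (λ e → allFin-intro n (λ i → ∧-intro (allFin-elim n (∧-elimˡ _ e) i) (allFin-elim n (∧-elimʳ _ e) i)))

allFin2-∧ : ∀ n (f g : Fin n → Fin n → Bool) →
  allFin n (λ x → allFin n (λ y → f x y ∧ g x y)) ≡ allFin n (λ x → allFin n (λ y → f x y)) ∧ allFin n (λ x → allFin n (λ y → g x y))
allFin2-∧ n f g = P.trans (allFin-cong n (λ x → allFin-∧ n (f x) (g x))) (allFin-∧ n _ _)

allFin-∨ : ∀ n s (f : Fin n → Bool) → allFin n (λ i → s ∨ f i) ≡ s ∨ allFin n f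
allFin-∨ n true f = allFin-intro n (λ _ → P.refl)
allFin-∨ n false f = P.refl

allFin-swap : ∀ n m (f : Fin n → Fin m → Bool) →
  allFin n (λ i → allFin m (λ j → f i j)) ≡ allFin m (λ j → allFin n (λ i → f i j))
allFin-swap n m f = Bool-ext
  (λ e → allFin-intro m (λ j → allFin-intro n (λ i → allFin-elim m (allFin-elim n e i) j)))
  (λ e → allFin-intro n (λ i → allFin-intro m (λ j → allFin-elim n (allFin-elim m e j) i)))

allFin-false : ∀ n {f : Fin n → Bool} i → f i ≡ false → allFin n f ≡ false
allFin-false (ℕ.suc n) {f} zero e rewrite e = P.refl
allFin-false (ℕ.suc n) {f} (suc i) e with f zero
... | true = allFin-false n i e
... | false = P.refl

allFin-false-elim : ∀ n {f : Fin n → Bool} → allFin n f ≡ false → Σ (Fin n) (λ i → f i ≡ false)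
allFin-false-elim (ℕ.suc n) {f} e with f zero in eq
... | false = zero , eq
... | true = let (i , p) = allFin-false-elim n e in suc i , p

allFin-const : ∀ n → .{{NonZero n}} → ∀ c → allFin n (λ _ → c) ≡ c
allFin-const (ℕ.suc n) true = allFin-intro n (λ _ → P.refl)
allFin-const (ℕ.suc n) false = P.refl

anyFin-cong : ∀ n {f g : Fin n → Bool} → (∀ i → f i ≡ g i) → anyFin n f ≡ anyFin n g
anyFin-cong ℕ.zero p = P.refl
anyFin-cong (ℕ.suc n) p = P.cong₂ _∨_ (p zero) (anyFin-cong n (λ i → p (suc i)))

anyFin-intro : ∀ n {f : Fin n → Bool} i → f i ≡ true → anyFin n f ≡ true
anyFin-intro (ℕ.suc n) {f} zero e rewrite e = P.refl
anyFin-intro (ℕ.suc n) {f} (suc i) e with f zero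
... | true = P.refl
... | false = anyFin-intro n i e

anyFin-elim : ∀ n {f : Fin n → Bool} → anyFin n f ≡ true → Σ (Fin n) (λ i → f i ≡ true)
anyFin-elim (ℕ.suc n) {f} e with f zero in eq
... | true = zero , eq
... | false = let (i , p) = anyFin-elim n e in suc i , p

anyFin-false-intro : ∀ n {f : Fin n → Bool} → (∀ i → f i ≡ false) → anyFin n f ≡ false
anyFin-false-intro ℕ.zero p = P.refl
anyFin-false-intro (ℕ.suc n) {f} p rewrite p zero = anyFin-false-intro n (λ i → p (suc i))

not-allFin-not : ∀ n (f : Fin n → Bool) → not (allFin n (λ i → not (f i))) ≡ anyFin n f
not-allFin-not ℕ.zero f = P.refl
not-allFin-not (ℕ.suc n) f with f zero
... | true = P.refl
... | false = not-allFin-not n (λ i → f (suc i))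

allL : ∀ {A : Set} → (A → Bool) → List A → Bool
allL p []ₗ = true
allL p (x ∷ₗ xs) = p x ∧ allL p xs

allL-++ : ∀ {A : Set} (p : A → Bool) xs ys → allL p (xs List.++ ys) ≡ allL p xs ∧ allL p ys
allL-++ p []ₗ ys = P.refl
allL-++ p (x ∷ₗ xs) ys = P.trans (P.cong (p x ∧_) (allL-++ p xs ys)) (P.sym (BP.∧-assoc (p x) _ _))

allL-map : ∀ {A B : Set} (p : B → Bool) (f : A → B) xs → allL p (List.map f xs) ≡ allL (λ x → p (f x)) xs
allL-map p f []ₗ = P.refl
allL-map p f (x ∷ₗ xs) = P.cong (p (f x) ∧_) (allL-map p f xs)

allL-cong : ∀ {A : Set} {p p' : A → Bool} → (∀ x → p x ≡ p' x) → ∀ xs → allL p xs ≡ allL p' xs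
allL-cong e []ₗ = P.refl
allL-cong e (x ∷ₗ xs) = P.cong₂ _∧_ (e x) (allL-cong e xs)

allL-zip : ∀ {I X Y : Set} {m} (p : Y → Bool) (f : I → X → Y) (g : Fin m → I) (V : Vec X m) →
  allL p (Vec.toList (Vec.zipWith f (tabulate g) V)) ≡ allFin m (λ k → p (f (g k) (lookup V k)))
allL-zip p f g [] = P.refl
allL-zip p f g (x ∷ V) = P.cong (p (f (g zero) x) ∧_) (allL-zip p f (λ i → g (suc i)) V)

_≐_ : ∀ {u b n} → World u b n → World u b n → Set
ω ≐ ω' = (∀ p i → unary ω p i ≡ unary ω' p i) × (∀ r i j → binary ω r i j ≡ binary ω' r i j)

≐-trans : ∀ {u b n} {ω ω' ω'' : World u b n} → ω ≐ ω' → ω' ≐ ω'' → ω ≐ ω''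
≐-trans (a , b') (c' , d) = (λ p i → P.trans (a p i) (c' p i)) , (λ r i j → P.trans (b' r i j) (d r i j))

update-cong : ∀ {n} {ρ ρ' : Env n} → (∀ v → ρ v ≡ ρ' v) → ∀ v a z → (ρ [ v ↦ a ]) z ≡ (ρ' [ v ↦ a ]) z
update-cong e vx a vx = P.refl
update-cong e vx a vy = e vy
update-cong e vy a vx = e vx
update-cong e vy a vy = P.refl

update-agree : ∀ {n} v {ρ ρ' : Env n} → ρ (other v) ≡ ρ' (other v) → ∀ d z → (ρ [ v ↦ d ]) z ≡ (ρ' [ v ↦ d ]) z
update-agree vx e d vx = P.refl
update-agree vx e d vy = e
update-agree vy e d vx = e
update-agree vy e d vy = P.refl

==ᵛ-refl : ∀ v → (v ==ᵛ v) ≡ true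
==ᵛ-refl vx = P.refl
==ᵛ-refl vy = P.refl

eval-env : ∀ {u b n} (ω : World u b n) {ρ ρ' : Env n} → (∀ v → ρ v ≡ ρ' v) → ∀ φ → eval ω ρ φ ≡ eval ω ρ' φ
eval-env ω e (atom₁ p v) = P.cong (unary ω p) (e v)
eval-env ω e (atom₂ r v w) = P.cong₂ (binary ω r) (e v) (e w)
eval-env ω e (¬' φ) = P.cong not (eval-env ω e φ)
eval-env ω e (φ ∧' ψ) = P.cong₂ _∧_ (eval-env ω e φ) (eval-env ω e ψ)
eval-env ω e (φ ∨' ψ) = P.cong₂ _∨_ (eval-env ω e φ) (eval-env ω e ψ)
eval-env {n = n} ω e (∀' v φ) = allFin-cong n (λ a → eval-env ω (update-cong e v a) φ)
eval-env {n = n} ω e (∃' v φ) = anyFin-cong n (λ a → eval-env ω (update-cong e v a) φ)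

eval-free : ∀ {u b n} (ω : World u b n) (φ : Fm u b) {ρ ρ' : Env n} →
            (∀ v → free φ v ≡ true → ρ v ≡ ρ' v) → eval ω ρ φ ≡ eval ω ρ' φ
eval-free ω (atom₁ p v) h = P.cong (unary ω p) (h v (==ᵛ-refl v))
eval-free ω (atom₂ r v w) h = P.cong₂ (binary ω r) (h v (P.cong (_∨ (w ==ᵛ v)) (==ᵛ-refl v)))
                                     (h w (∨-true-r (v ==ᵛ w) (==ᵛ-refl w)))
eval-free ω (¬' φ) h = P.cong not (eval-free ω φ h)
eval-free ω (φ ∧' ψ) h = P.cong₂ _∧_ (eval-free ω φ (λ v e → h v (P.cong (_∨ free ψ v) e)))
                                    (eval-free ω ψ (λ v e → h v (∨-true-r (free φ v) e)))
eval-free ω (φ ∨' ψ) h = P.cong₂ _∨_ (eval-free ω φ (λ v e → h v (P.cong (_∨ free ψ v) e)))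
                                    (eval-free ω ψ (λ v e → h v (∨-true-r (free φ v) e)))
eval-free {n = n} ω (∀' vx φ) h = allFin-cong n (λ a → eval-free ω φ (λ { vx e → P.refl ; vy e → h vy (P.cong (_∧ true) e) }))
eval-free {n = n} ω (∀' vy φ) h = allFin-cong n (λ a → eval-free ω φ (λ { vx e → h vx (P.cong (_∧ true) e) ; vy e → P.refl }))
eval-free {n = n} ω (∃' vx φ) h = anyFin-cong n (λ a → eval-free ω φ (λ { vx e → P.refl ; vy e → h vy (P.cong (_∧ true) e) }))
eval-free {n = n} ω (∃' vy φ) h = anyFin-cong n (λ a → eval-free ω φ (λ { vx e → h vx (P.cong (_∧ true) e) ; vy e → P.refl }))

eval-sentence : ∀ {u b n} (ω : World u b n) (φ : Fm u b) → Sentence φ → ∀ ρ ρ' → eval ω ρ φ ≡ eval ω ρ' φ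
eval-sentence ω φ (fx , fy) ρ ρ' = eval-free ω φ h
  where
  h : ∀ v → free φ v ≡ true → ρ v ≡ ρ' v
  h vx e with P.trans (P.sym fx) e
  ... | ()
  h vy e with P.trans (P.sym fy) e
  ... | ()

eval-≐ : ∀ {u b n} {ω ω' : World u b n} → ω ≐ ω' → ∀ ρ φ → eval ω ρ φ ≡ eval ω' ρ φ
eval-≐ e ρ (atom₁ p v) = proj₁ e p (ρ v)
eval-≐ e ρ (atom₂ r v w) = proj₂ e r (ρ v) (ρ w)
eval-≐ e ρ (¬' φ) = P.cong not (eval-≐ e ρ φ)
eval-≐ e ρ (φ ∧' ψ) = P.cong₂ _∧_ (eval-≐ e ρ φ) (eval-≐ e ρ ψ)
eval-≐ e ρ (φ ∨' ψ) = P.cong₂ _∨_ (eval-≐ e ρ φ) (eval-≐ e ρ ψ)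
eval-≐ {n = n} e ρ (∀' v φ) = allFin-cong n (λ a → eval-≐ e _ φ)
eval-≐ {n = n} e ρ (∃' v φ) = anyFin-cong n (λ a → eval-≐ e _ φ)

eval-quantifierFree : ∀ {u b n n'} (M : Fm u b) → quantifierFree M ≡ true →
         (ω : World u b n) (ω' : World u b n') (ρ : Env n) (ρ' : Env n') →
         (∀ p v → unary ω p (ρ v) ≡ unary ω' p (ρ' v)) →
         (∀ r v w → binary ω r (ρ v) (ρ w) ≡ binary ω' r (ρ' v) (ρ' w)) →
         eval ω ρ M ≡ eval ω' ρ' M
eval-quantifierFree (atom₁ p v) q ω ω' ρ ρ' hu hb = hu p v
eval-quantifierFree (atom₂ r v w) q ω ω' ρ ρ' hu hb = hb r v w
eval-quantifierFree (¬' M) q ω ω' ρ ρ' hu hb = P.cong not (eval-quantifierFree M q ω ω' ρ ρ' hu hb)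
eval-quantifierFree (M ∧' N) q ω ω' ρ ρ' hu hb =
  P.cong₂ _∧_ (eval-quantifierFree M (∧-elimˡ _ q) ω ω' ρ ρ' hu hb) (eval-quantifierFree N (∧-elimʳ _ q) ω ω' ρ ρ' hu hb)
eval-quantifierFree (M ∨' N) q ω ω' ρ ρ' hu hb =
  P.cong₂ _∨_ (eval-quantifierFree M (∧-elimˡ _ q) ω ω' ρ ρ' hu hb) (eval-quantifierFree N (∧-elimʳ _ q) ω ω' ρ ρ' hu hb)
eval-quantifierFree (∀' v M) () ω ω' ρ ρ' hu hb
eval-quantifierFree (∃' v M) () ω ω' ρ ρ' hu hb

env₂ : ∀ {n} → Fin n → Fin n → Env n
env₂ a a' vx = a
env₂ a a' vy = a'

envAt : ∀ {n} → Var → Fin n → Fin n → Env n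
envAt w x y z = if w ==ᵛ z then x else y

holds∀∀ : ∀ {u b n} → Fm u b → World u b n → Bool
holds∀∀ {n = n} M ω = allFin n (λ a → allFin n (λ a' → eval ω (env₂ a a') M))

holds∀∃ : ∀ {u b n} → World u b n → Var → Fm u b → Bool
holds∀∃ {n = n} ω w θ = allFin n (λ x → anyFin n (λ y → eval ω (envAt w x y) θ))

eval-foldr : ∀ {u b n} (ω : World u b n) ρ t L → eval ω ρ (List.foldr _∧'_ t L) ≡ allL (eval ω ρ) L ∧ eval ω ρ t
eval-foldr ω ρ t []ₗ = P.refl
eval-foldr ω ρ t (x ∷ₗ L) = P.trans (P.cong (eval ω ρ x ∧_) (eval-foldr ω ρ t L)) (P.sym (BP.∧-assoc (eval ω ρ x) (allL (eval ω ρ) L) (eval ω ρ t)))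

renameWorld : ∀ {u u' b n} → World u' b n → (Fin u → Fin u') → World u b n
renameWorld ω f = world (λ p → unary ω (f p)) (binary ω)

eval-rename : ∀ {u u' b n} (ω : World u' b n) (f : Fin u → Fin u') ρ θ →
              eval ω ρ (rename f θ) ≡ eval (renameWorld ω f) ρ θ
eval-rename ω f ρ (atom₁ p v) = P.refl
eval-rename ω f ρ (atom₂ r v w) = P.refl
eval-rename ω f ρ (¬' θ) = P.cong not (eval-rename ω f ρ θ)
eval-rename ω f ρ (θ ∧' θ') = P.cong₂ _∧_ (eval-rename ω f ρ θ) (eval-rename ω f ρ θ')
eval-rename ω f ρ (θ ∨' θ') = P.cong₂ _∨_ (eval-rename ω f ρ θ) (eval-rename ω f ρ θ')
eval-rename {n = n} ω f ρ (∀' v θ) = allFin-cong n (λ a → eval-rename ω f _ θ)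
eval-rename {n = n} ω f ρ (∃' v θ) = anyFin-cong n (λ a → eval-rename ω f _ θ)

eval-renamed : ∀ {u u' b n} {ω : World u' b n} {ω' : World u b n} (f : Fin u → Fin u') →
  renameWorld ω f ≐ ω' → ∀ ρ θ → eval ω ρ (rename f θ) ≡ eval ω' ρ θ
eval-renamed {ω = ω} f e ρ θ = P.trans (eval-rename ω f ρ θ) (eval-≐ e ρ θ)

cons : ∀ {A : Set} {n} → A → (Fin n → A) → Fin (ℕ.suc n) → A
cons a g zero = a
cons a g (suc i) = g i

cellOf-≐ : ∀ {u b n} {ω ω' : World u b n} → ω ≐ ω' → ∀ i → cellOf ω i ≡ cellOf ω' i
cellOf-≐ e i = P.cong₂ _,_ (VP.tabulate-cong (λ p → proj₁ e p i)) (VP.tabulate-cong (λ r → proj₂ e r i i))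

≟ᶜ-≡ : ∀ {u b} {c d : Cell u b} → (c ≟ᶜ d) ≡ true → c ≡ d
≟ᶜ-≡ {c = c} {d} = dec-true (×P.≡-dec (VP.≡-dec Bool._≟_) (VP.≡-dec Bool._≟_) c d)

≡-≟ᶜ : ∀ {u b} {c d : Cell u b} → c ≡ d → (c ≟ᶜ d) ≡ true
≡-≟ᶜ {c = c} {d} = true-dec (×P.≡-dec (VP.≡-dec Bool._≟_) (VP.≡-dec Bool._≟_) c d)

tabulate-injective : ∀ {m} {f g : Fin m → Bool} → tabulate f ≡ tabulate g → ∀ i → f i ≡ g i
tabulate-injective {f = f} {g} e i = P.trans (P.sym (VP.lookup∘tabulate f i)) (P.trans (P.cong (λ v → lookup v i) e) (VP.lookup∘tabulate g i))

joinF : ∀ {a} {A : Set a} m {k} → (Fin m → A) → (Fin k → A) → Fin (m ℕ.+ k) → A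
joinF m f g i = [ f , g ]′ (Fin.splitAt m i)

joinF-↑ˡ : ∀ {a} {A : Set a} m k (f : Fin m → A) (g : Fin k → A) i → joinF m f g (i Fin.↑ˡ k) ≡ f i
joinF-↑ˡ m k f g i rewrite FP.splitAt-↑ˡ m i k = P.refl

joinF-↑ʳ : ∀ {a} {A : Set a} m k (f : Fin m → A) (g : Fin k → A) i → joinF m f g (m Fin.↑ʳ i) ≡ g i
joinF-↑ʳ m k f g i rewrite FP.splitAt-↑ʳ m k i = P.refl

joinF-char : ∀ {X Y : Set} m k (h : Fin (m ℕ.+ k) → Y → X) (f : Fin m → Y → X) (g : Fin k → Y → X) →
  (∀ i y → h (i Fin.↑ˡ k) y ≡ f i y) → (∀ i y → h (m Fin.↑ʳ i) y ≡ g i y) →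
  ∀ i y → h i y ≡ [ f , g ]′ (Fin.splitAt m i) y
joinF-char m k h f g p q i y with Fin.splitAt m i in eq
... | inj₁ j = P.trans (P.cong (λ z → h z y) (P.sym (FP.splitAt⁻¹-↑ˡ eq))) (p j y)
... | inj₂ j = P.trans (P.cong (λ z → h z y) (P.sym (FP.splitAt⁻¹-↑ʳ eq))) (q j y)

joinF-respR : ∀ m k n (A : Fin m → Fin n → Bool) (B B' : Fin k → Fin n → Bool) →
              (∀ i y → B i y ≡ B' i y) → ∀ i y → joinF m A B i y ≡ joinF m A B' i y
joinF-respR m k n A B B' e = joinF-char m k (joinF m A B) A B'
  (λ i y → P.cong (λ z → z y) (joinF-↑ˡ m k A B i))
  (λ i y → P.trans (P.cong (λ z → z y) (joinF-↑ʳ m k A B i)) (e i y))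

joinF-respL : ∀ m k n (A A' : Fin m → Fin n → Bool) (B : Fin k → Fin n → Bool) →
              (∀ i y → A i y ≡ A' i y) → ∀ i y → joinF m A B i y ≡ joinF m A' B i y
joinF-respL m k n A A' B e = joinF-char m k (joinF m A B) A' B
  (λ i y → P.trans (P.cong (λ z → z y) (joinF-↑ˡ m k A B i)) (e i y))
  (λ i y → P.cong (λ z → z y) (joinF-↑ʳ m k A B i))

splitAt-elim : ∀ m k (Q : Fin (m ℕ.+ k) → Set) → (∀ i → Q (i Fin.↑ˡ k)) → (∀ j → Q (m Fin.↑ʳ j)) → ∀ i → Q i
splitAt-elim m k Q l r i with Fin.splitAt m i in eq
... | inj₁ j = P.subst Q (FP.splitAt⁻¹-↑ˡ eq) (l j)
... | inj₂ j = P.subst Q (FP.splitAt⁻¹-↑ʳ eq) (r j)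

infixl 6 _⊕_

_⊕_ : ∀ {u b n m} → World u b n → (Fin m → Fin n → Bool) → World (u ℕ.+ m) b n
_⊕_ {u} ω A = world (joinF u (unary ω) A) (binary ω)

⊕-unary-↑ˡ : ∀ {u b n m} (ω : World u b n) (A : Fin m → Fin n → Bool) p i → unary (ω ⊕ A) (p Fin.↑ˡ m) i ≡ unary ω p i
⊕-unary-↑ˡ {u} {m = m} ω A p i = P.cong (λ z → z i) (joinF-↑ˡ u m (unary ω) A p)

⊕-unary-↑ʳ : ∀ {u b n m} (ω : World u b n) (A : Fin m → Fin n → Bool) j i → unary (ω ⊕ A) (u Fin.↑ʳ j) i ≡ A j i
⊕-unary-↑ʳ {u} {m = m} ω A j i = P.cong (λ z → z i) (joinF-↑ʳ u m (unary ω) A j)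

⊕-cong : ∀ {u b n m} (ω : World u b n) {A A' : Fin m → Fin n → Bool} → (∀ j i → A j i ≡ A' j i) → (ω ⊕ A) ≐ (ω ⊕ A')
⊕-cong {u} {m = m} ω {A} {A'} e =
  (λ p i → splitAt-elim u m (λ p → unary (ω ⊕ A) p i ≡ unary (ω ⊕ A') p i)
     (λ p → P.trans (⊕-unary-↑ˡ ω A p i) (P.sym (⊕-unary-↑ˡ ω A' p i)))
     (λ j → P.trans (⊕-unary-↑ʳ ω A j i) (P.trans (e j i) (P.sym (⊕-unary-↑ʳ ω A' j i)))) p) ,
  (λ r i j → P.refl)

embL-↑ˡ : ∀ u m k i → embL u m k (i Fin.↑ˡ m) ≡ i Fin.↑ˡ (m ℕ.+ k)
embL-↑ˡ u m k i rewrite FP.splitAt-↑ˡ u i m = P.refl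

embL-↑ʳ : ∀ u m k j → embL u m k (u Fin.↑ʳ j) ≡ u Fin.↑ʳ (j Fin.↑ˡ k)
embL-↑ʳ u m k j rewrite FP.splitAt-↑ʳ u m j = P.refl

embR-↑ˡ : ∀ u m k i → embR u m k (i Fin.↑ˡ k) ≡ i Fin.↑ˡ (m ℕ.+ k)
embR-↑ˡ u m k i rewrite FP.splitAt-↑ˡ u i k = P.refl

embR-↑ʳ : ∀ u m k j → embR u m k (u Fin.↑ʳ j) ≡ u Fin.↑ʳ (m Fin.↑ʳ j)
embR-↑ʳ u m k j rewrite FP.splitAt-↑ʳ u k j = P.refl

embS-↑ˡ : ∀ u m i → embS u m (i Fin.↑ˡ m) ≡ i Fin.↑ˡ ℕ.suc m
embS-↑ˡ u m i rewrite FP.splitAt-↑ˡ u i m = P.refl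

embS-↑ʳ : ∀ u m j → embS u m (u Fin.↑ʳ j) ≡ u Fin.↑ʳ suc j
embS-↑ʳ u m j rewrite FP.splitAt-↑ʳ u m j = P.refl

renameWorld-⊕ : ∀ {u b n m m'} (ω : World u b n) (A : Fin m' → Fin n → Bool)
  (f : Fin (u ℕ.+ m) → Fin (u ℕ.+ m')) (g : Fin m → Fin m') →
  (∀ p → f (p Fin.↑ˡ m) ≡ p Fin.↑ˡ m') → (∀ j → f (u Fin.↑ʳ j) ≡ u Fin.↑ʳ g j) →
  renameWorld (ω ⊕ A) f ≐ (ω ⊕ (λ j → A (g j)))
renameWorld-⊕ {u} {m = m} ω A f g fˡ fʳ =
  (λ p i → splitAt-elim u m (λ p → unary (ω ⊕ A) (f p) i ≡ unary (ω ⊕ (λ j → A (g j))) p i)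
    (λ p → P.trans (P.cong (λ z → unary (ω ⊕ A) z i) (fˡ p))
                   (P.trans (⊕-unary-↑ˡ ω A p i) (P.sym (⊕-unary-↑ˡ ω _ p i))))
    (λ j → P.trans (P.cong (λ z → unary (ω ⊕ A) z i) (fʳ j))
                   (P.trans (⊕-unary-↑ʳ ω A (g j) i) (P.sym (⊕-unary-↑ʳ ω (λ j → A (g j)) j i))))
    p) ,
  (λ r i j → P.refl)

renameWorld-embL : ∀ {u b n} m k (ω : World u b n) (A : Fin (m ℕ.+ k) → Fin n → Bool) →
  renameWorld (ω ⊕ A) (embL u m k) ≐ (ω ⊕ (λ i → A (i Fin.↑ˡ k)))
renameWorld-embL {u} m k ω A = renameWorld-⊕ ω A (embL u m k) (Fin._↑ˡ k) (embL-↑ˡ u m k) (embL-↑ʳ u m k)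

renameWorld-embR : ∀ {u b n} m k (ω : World u b n) (A : Fin (m ℕ.+ k) → Fin n → Bool) →
  renameWorld (ω ⊕ A) (embR u m k) ≐ (ω ⊕ (λ i → A (m Fin.↑ʳ i)))
renameWorld-embR {u} m k ω A = renameWorld-⊕ ω A (embR u m k) (m Fin.↑ʳ_) (embR-↑ˡ u m k) (embR-↑ʳ u m k)

renameWorld-embS : ∀ {u b n} m (ω : World u b n) (A : Fin (ℕ.suc m) → Fin n → Bool) →
  renameWorld (ω ⊕ A) (embS u m) ≐ (ω ⊕ (λ i → A (suc i)))
renameWorld-embS {u} m ω A = renameWorld-⊕ ω A (embS u m) suc (embS-↑ˡ u m) (embS-↑ʳ u m)

joinL-≐ : ∀ {u b n} m k (ω : World u b n) (f : Fin m → Fin n → Bool) (g : Fin k → Fin n → Bool) →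
          (ω ⊕ (λ i → joinF m f g (i Fin.↑ˡ k))) ≐ (ω ⊕ f)
joinL-≐ m k ω f g = ⊕-cong ω (λ j i → P.cong (λ z → z i) (joinF-↑ˡ m k f g j))

joinR-≐ : ∀ {u b n} m k (ω : World u b n) (f : Fin m → Fin n → Bool) (g : Fin k → Fin n → Bool) →
          (ω ⊕ (λ i → joinF m f g (m Fin.↑ʳ i))) ≐ (ω ⊕ g)
joinR-≐ m k ω f g = ⊕-cong ω (λ j i → P.cong (λ z → z i) (joinF-↑ʳ m k f g j))

-- Scott normal form

universalsHold : ∀ {u b n} → World u b n → List (Fm u b) → Bool
universalsHold {n = n} ω L = allFin n (λ a → allFin n (λ a' → allL (eval ω (env₂ a a')) L))

existentialsHold : ∀ {u b n m} → World u b n → Vec (Var × Fm u b) m → Bool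
existentialsHold ω [] = true
existentialsHold ω ((w , θ) ∷ V) = holds∀∃ ω w θ ∧ existentialsHold ω V

normalFormHolds : ∀ {u b n} (φ : Fm u b) → World (u ℕ.+ nq φ) b n → Bool
normalFormHolds φ ω = universalsHold ω (univDefs φ) ∧ existentialsHold ω (exDefs φ)

universalsHold-++ : ∀ {u b n} (ω : World u b n) L L' → universalsHold ω (L List.++ L') ≡ universalsHold ω L ∧ universalsHold ω L'
universalsHold-++ {n = n} ω L L' =
  P.trans (allFin-cong n (λ a → P.trans (allFin-cong n (λ a' → allL-++ _ L L')) (allFin-∧ n _ _)))
          (allFin-∧ n _ _)

universalsHold-map : ∀ {u u' b n} (ω : World u' b n) (f : Fin u → Fin u') L →
              universalsHold ω (List.map (rename f) L) ≡ universalsHold (renameWorld ω f) L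
universalsHold-map {n = n} ω f L = allFin-cong n (λ a → allFin-cong n (λ a' →
  P.trans (allL-map _ (rename f) L) (allL-cong (λ θ → eval-rename ω f _ θ) L)))

universalsHold-≐ : ∀ {u b n} {ω ω' : World u b n} → ω ≐ ω' → ∀ L → universalsHold ω L ≡ universalsHold ω' L
universalsHold-≐ {n = n} e L = allFin-cong n (λ a → allFin-cong n (λ a' → allL-cong (λ θ → eval-≐ e _ θ) L))

existentialsHold-++ : ∀ {u b n m k} (ω : World u b n) (V : Vec (Var × Fm u b) m) (V' : Vec (Var × Fm u b) k) →
  existentialsHold ω (V Vec.++ V') ≡ existentialsHold ω V ∧ existentialsHold ω V'
existentialsHold-++ ω [] V' = P.refl
existentialsHold-++ ω ((w , θ) ∷ V) V' =
  P.trans (P.cong (holds∀∃ ω w θ ∧_) (existentialsHold-++ ω V V'))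
          (P.sym (BP.∧-assoc (holds∀∃ ω w θ) (existentialsHold ω V) (existentialsHold ω V')))

existentialsHold-map : ∀ {u u' b n m} (ω : World u' b n) (f : Fin u → Fin u') (g : Var × Fm u b → Var × Fm u' b) →
             (∀ w θ → g (w , θ) ≡ (w , rename f θ)) →
             (V : Vec (Var × Fm u b) m) → existentialsHold ω (Vec.map g V) ≡ existentialsHold (renameWorld ω f) V
existentialsHold-map ω f g eq [] = P.refl
existentialsHold-map {n = n} ω f g eq ((w , θ) ∷ V) =
  P.trans (P.cong (λ x → existentialsHold ω (x ∷ Vec.map g V)) (eq w θ))
    (P.cong₂ _∧_ (allFin-cong n (λ x → anyFin-cong n (λ y → eval-rename ω f _ θ))) (existentialsHold-map ω f g eq V))

existentialsHold-≐ : ∀ {u b n m} {ω ω' : World u b n} → ω ≐ ω' → (V : Vec (Var × Fm u b) m) → existentialsHold ω V ≡ existentialsHold ω' V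
existentialsHold-≐ e [] = P.refl
existentialsHold-≐ {n = n} e ((w , θ) ∷ V) = P.cong₂ _∧_ (allFin-cong n (λ x → anyFin-cong n (λ y → eval-≐ e _ θ))) (existentialsHold-≐ e V)

existentialsHold-lookup : ∀ {u b n m} (ω : World u b n) (V : Vec (Var × Fm u b) m) →
  existentialsHold ω V ≡ allFin m (λ k → allFin n (λ x → anyFin n (λ y → eval ω (envAt (proj₁ (lookup V k)) x y) (proj₂ (lookup V k)))))
existentialsHold-lookup ω [] = P.refl
existentialsHold-lookup ω ((w , θ) ∷ V) = P.cong (_ ∧_) (existentialsHold-lookup ω V)

normalFormHolds-≐ : ∀ {u b n} (φ : Fm u b) {ω ω' : World (u ℕ.+ nq φ) b n} → ω ≐ ω' → normalFormHolds φ ω ≡ normalFormHolds φ ω'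
normalFormHolds-≐ φ e = P.cong₂ _∧_ (universalsHold-≐ e (univDefs φ)) (existentialsHold-≐ e (exDefs φ))

normalFormHolds-rename : ∀ {u u' b n} (φ : Fm u b) (f : Fin (u ℕ.+ nq φ) → Fin u')
  (g : Var × Fm (u ℕ.+ nq φ) b → Var × Fm u' b) → (∀ w θ → g (w , θ) ≡ (w , rename f θ)) →
  {ω : World u' b n} {ω' : World (u ℕ.+ nq φ) b n} → renameWorld ω f ≐ ω' →
  universalsHold ω (List.map (rename f) (univDefs φ)) ∧ existentialsHold ω (Vec.map g (exDefs φ))
    ≡ normalFormHolds φ ω'
normalFormHolds-rename φ f g g≗ {ω} e = P.cong₂ _∧_
  (P.trans (universalsHold-map ω f (univDefs φ)) (universalsHold-≐ e (univDefs φ)))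
  (P.trans (existentialsHold-map ω f g g≗ (exDefs φ)) (existentialsHold-≐ e (exDefs φ)))

normalFormHolds-∧ : ∀ {u b n} (φ ψ : Fm u b) (ω : World u b n) (A : Fin (nq φ ℕ.+ nq ψ) → Fin n → Bool) →
  normalFormHolds (φ ∧' ψ) (ω ⊕ A) ≡
  normalFormHolds φ (ω ⊕ (λ i → A (i Fin.↑ˡ nq ψ))) ∧ normalFormHolds ψ (ω ⊕ (λ i → A (nq φ Fin.↑ʳ i)))
normalFormHolds-∧ {u} φ ψ ω A = begin
  universalsHold (ω ⊕ A) (Uφ List.++ Uψ) ∧ existentialsHold (ω ⊕ A) (Eφ Vec.++ Eψ)
    ≡⟨ P.cong₂ _∧_ (universalsHold-++ (ω ⊕ A) Uφ Uψ) (existentialsHold-++ (ω ⊕ A) Eφ Eψ) ⟩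
  (universalsHold (ω ⊕ A) Uφ ∧ universalsHold (ω ⊕ A) Uψ) ∧
  (existentialsHold (ω ⊕ A) Eφ ∧ existentialsHold (ω ⊕ A) Eψ)
    ≡⟨ ∧-interchange (universalsHold (ω ⊕ A) Uφ) (universalsHold (ω ⊕ A) Uψ) _ _ ⟩
  (universalsHold (ω ⊕ A) Uφ ∧ existentialsHold (ω ⊕ A) Eφ) ∧
  (universalsHold (ω ⊕ A) Uψ ∧ existentialsHold (ω ⊕ A) Eψ)
    ≡⟨ P.cong₂ _∧_ (normalFormHolds-rename φ (embL u (nq φ) (nq ψ)) _ (λ _ _ → P.refl) (renameWorld-embL (nq φ) (nq ψ) ω A))
                   (normalFormHolds-rename ψ (embR u (nq φ) (nq ψ)) _ (λ _ _ → P.refl) (renameWorld-embR (nq φ) (nq ψ) ω A)) ⟩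
  normalFormHolds φ (ω ⊕ (λ i → A (i Fin.↑ˡ nq ψ))) ∧ normalFormHolds ψ (ω ⊕ (λ i → A (nq φ Fin.↑ʳ i))) ∎
  where
  open P.≡-Reasoning
  Uφ = List.map (rename (embL u (nq φ) (nq ψ))) (univDefs φ)
  Uψ = List.map (rename (embR u (nq φ) (nq ψ))) (univDefs ψ)
  Eφ = Vec.map (λ (w , θ) → w , rename (embL u (nq φ) (nq ψ)) θ) (exDefs φ)
  Eψ = Vec.map (λ (w , θ) → w , rename (embR u (nq φ) (nq ψ)) θ) (exDefs ψ)

defines∀ defines∃ : ∀ {u b n} (v : Var) (φ : Fm u b) (ω : World u b n) (A : Fin (ℕ.suc (nq φ)) → Fin n → Bool) → Bool
defines∀ {u} v φ ω A =
  universalsHold (ω ⊕ A) ((atom₁ (newA u (nq φ)) (other v) ⇒' rename (embS u (nq φ)) (tr φ)) ∷ₗ []ₗ) ∧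
  holds∀∃ (ω ⊕ A) (other v) (atom₁ (newA u (nq φ)) (other v) ∨' (¬' rename (embS u (nq φ)) (tr φ)))
defines∃ {u} v φ ω A =
  universalsHold (ω ⊕ A) ((rename (embS u (nq φ)) (tr φ) ⇒' atom₁ (newA u (nq φ)) (other v)) ∷ₗ []ₗ) ∧
  holds∀∃ (ω ⊕ A) (other v) (atom₁ (newA u (nq φ)) (other v) ⇒' rename (embS u (nq φ)) (tr φ))

normalFormHolds-quantifier : ∀ {u b n} (φ : Fm u b) (ω : World u b n) (A : Fin (ℕ.suc (nq φ)) → Fin n → Bool)
  (D : Fm (u ℕ.+ ℕ.suc (nq φ)) b) (w : Var) (θ : Fm (u ℕ.+ ℕ.suc (nq φ)) b) →
  universalsHold (ω ⊕ A) (D ∷ₗ List.map (rename (embS u (nq φ))) (univDefs φ)) ∧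
  existentialsHold (ω ⊕ A) ((w , θ) ∷ Vec.map (λ (w , θ) → w , rename (embS u (nq φ)) θ) (exDefs φ))
    ≡ (universalsHold (ω ⊕ A) (D ∷ₗ []ₗ) ∧ holds∀∃ (ω ⊕ A) w θ) ∧ normalFormHolds φ (ω ⊕ (λ i → A (suc i)))
normalFormHolds-quantifier {u} φ ω A D w θ =
  P.trans (P.cong (_∧ (holds∀∃ (ω ⊕ A) w θ ∧ existentialsHold (ω ⊕ A) E)) (universalsHold-++ (ω ⊕ A) (D ∷ₗ []ₗ) U))
  (P.trans (∧-interchange (universalsHold (ω ⊕ A) (D ∷ₗ []ₗ)) (universalsHold (ω ⊕ A) U) (holds∀∃ (ω ⊕ A) w θ) _)
           (P.cong ((universalsHold (ω ⊕ A) (D ∷ₗ []ₗ) ∧ holds∀∃ (ω ⊕ A) w θ) ∧_)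
                   (normalFormHolds-rename φ (embS u (nq φ)) _ (λ _ _ → P.refl) (renameWorld-embS (nq φ) ω A))))
  where
  U = List.map (rename (embS u (nq φ))) (univDefs φ)
  E = Vec.map (λ (w , θ) → w , rename (embS u (nq φ)) θ) (exDefs φ)

normalFormHolds-∀ : ∀ {u b n} v (φ : Fm u b) (ω : World u b n) (A : Fin (ℕ.suc (nq φ)) → Fin n → Bool) →
  normalFormHolds (∀' v φ) (ω ⊕ A) ≡ defines∀ v φ ω A ∧ normalFormHolds φ (ω ⊕ (λ i → A (suc i)))
normalFormHolds-∀ {u} v φ ω A = normalFormHolds-quantifier φ ω A
  (atom₁ (newA u (nq φ)) (other v) ⇒' rename (embS u (nq φ)) (tr φ)) (other v)
  (atom₁ (newA u (nq φ)) (other v) ∨' (¬' rename (embS u (nq φ)) (tr φ)))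

normalFormHolds-∃ : ∀ {u b n} v (φ : Fm u b) (ω : World u b n) (A : Fin (ℕ.suc (nq φ)) → Fin n → Bool) →
  normalFormHolds (∃' v φ) (ω ⊕ A) ≡ defines∃ v φ ω A ∧ normalFormHolds φ (ω ⊕ (λ i → A (suc i)))
normalFormHolds-∃ {u} v φ ω A = normalFormHolds-quantifier φ ω A
  (rename (embS u (nq φ)) (tr φ) ⇒' atom₁ (newA u (nq φ)) (other v)) (other v)
  (atom₁ (newA u (nq φ)) (other v) ⇒' rename (embS u (nq φ)) (tr φ))

defines∀-≐ : ∀ {u b n} v (φ : Fm u b) (ω : World u b n) {A A' : Fin (ℕ.suc (nq φ)) → Fin n → Bool} →
        (ω ⊕ A) ≐ (ω ⊕ A') → defines∀ v φ ω A ≡ defines∀ v φ ω A'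
defines∀-≐ {u} {n = n} v φ ω e = P.cong₂ _∧_
  (universalsHold-≐ e ((atom₁ (newA u (nq φ)) (other v) ⇒' rename (embS u (nq φ)) (tr φ)) ∷ₗ []ₗ))
  (allFin-cong n (λ x → anyFin-cong n (λ y → eval-≐ e (envAt (other v) x y)
     (atom₁ (newA u (nq φ)) (other v) ∨' (¬' rename (embS u (nq φ)) (tr φ))))))

defines∃-≐ : ∀ {u b n} v (φ : Fm u b) (ω : World u b n) {A A' : Fin (ℕ.suc (nq φ)) → Fin n → Bool} →
        (ω ⊕ A) ≐ (ω ⊕ A') → defines∃ v φ ω A ≡ defines∃ v φ ω A'
defines∃-≐ {u} {n = n} v φ ω e = P.cong₂ _∧_
  (universalsHold-≐ e ((rename (embS u (nq φ)) (tr φ) ⇒' atom₁ (newA u (nq φ)) (other v)) ∷ₗ []ₗ))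
  (allFin-cong n (λ x → anyFin-cong n (λ y → eval-≐ e (envAt (other v) x y)
     (atom₁ (newA u (nq φ)) (other v) ⇒' rename (embS u (nq φ)) (tr φ)))))

canonicalAux : ∀ {u b n} (φ : Fm u b) → World u b n → Fin (nq φ) → Fin n → Bool
canonicalAux (atom₁ _ _) ω = λ ()
canonicalAux (atom₂ _ _ _) ω = λ ()
canonicalAux (¬' φ) ω = canonicalAux φ ω
canonicalAux (φ ∧' ψ) ω = joinF (nq φ) (canonicalAux φ ω) (canonicalAux ψ ω)
canonicalAux (φ ∨' ψ) ω = joinF (nq φ) (canonicalAux φ ω) (canonicalAux ψ ω)
canonicalAux (∀' v φ) ω = cons (λ a → eval ω (λ _ → a) (∀' v φ)) (canonicalAux φ ω)
canonicalAux (∃' v φ) ω = cons (λ a → eval ω (λ _ → a) (∃' v φ)) (canonicalAux φ ω)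

eval-tr-canonical : ∀ {u b n} (φ : Fm u b) (ω : World u b n) ρ → eval (ω ⊕ canonicalAux φ ω) ρ (tr φ) ≡ eval ω ρ φ
eval-tr-canonical (atom₁ p v) ω ρ = ⊕-unary-↑ˡ ω (λ ()) p (ρ v)
eval-tr-canonical (atom₂ r v w) ω ρ = P.refl
eval-tr-canonical (¬' φ) ω ρ = P.cong not (eval-tr-canonical φ ω ρ)
eval-tr-canonical {u} (φ ∧' ψ) ω ρ = P.cong₂ _∧_
  (P.trans (eval-renamed (embL u (nq φ) (nq ψ)) (≐-trans (renameWorld-embL (nq φ) (nq ψ) ω _) (joinL-≐ (nq φ) (nq ψ) ω _ _)) ρ (tr φ))
           (eval-tr-canonical φ ω ρ))
  (P.trans (eval-renamed (embR u (nq φ) (nq ψ)) (≐-trans (renameWorld-embR (nq φ) (nq ψ) ω _) (joinR-≐ (nq φ) (nq ψ) ω _ _)) ρ (tr ψ))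
           (eval-tr-canonical ψ ω ρ))
eval-tr-canonical {u} (φ ∨' ψ) ω ρ = P.cong₂ _∨_
  (P.trans (eval-renamed (embL u (nq φ) (nq ψ)) (≐-trans (renameWorld-embL (nq φ) (nq ψ) ω _) (joinL-≐ (nq φ) (nq ψ) ω _ _)) ρ (tr φ))
           (eval-tr-canonical φ ω ρ))
  (P.trans (eval-renamed (embR u (nq φ) (nq ψ)) (≐-trans (renameWorld-embR (nq φ) (nq ψ) ω _) (joinR-≐ (nq φ) (nq ψ) ω _ _)) ρ (tr ψ))
           (eval-tr-canonical ψ ω ρ))
eval-tr-canonical {n = n} (∀' v φ) ω ρ = P.trans (⊕-unary-↑ʳ ω (canonicalAux (∀' v φ) ω) zero (ρ (other v)))
  (allFin-cong n (λ d → eval-env ω (update-agree v {ρ = λ _ → ρ (other v)} {ρ' = ρ} P.refl d) φ))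
eval-tr-canonical {n = n} (∃' v φ) ω ρ = P.trans (⊕-unary-↑ʳ ω (canonicalAux (∃' v φ) ω) zero (ρ (other v)))
  (anyFin-cong n (λ d → eval-env ω (update-agree v {ρ = λ _ → ρ (other v)} {ρ' = ρ} P.refl d) φ))

-- D∀ v a and D∃ v a are the two Scott constraints on an auxiliary predicate a for ∀v and ∃v, for a
-- formula given by its truth value Pr on environments; they hold exactly when a is that quantifier's truth value.
module QuantifierDefinition {n : ℕ} (Pr : Env n → Bool) (Penv : ∀ {ρ ρ' : Env n} → (∀ z → ρ z ≡ ρ' z) → Pr ρ ≡ Pr ρ') where
  E : Fin n → Fin n → Bool
  E x y = Pr (env₂ x y)
  F : Var → Fin n → Fin n → Bool
  F v w d = Pr ((λ _ → w) [ v ↦ d ])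
  G : Var → Fin n → Fin n → Bool
  G v w d = Pr (envAt (other v) w d)

  GF : ∀ v w d → G v w d ≡ F v w d
  GF vx w d = Penv (λ { vx → P.refl ; vy → P.refl })
  GF vy w d = Penv (λ { vx → P.refl ; vy → P.refl })

  EF : ∀ v x y → E x y ≡ F v (env₂ x y (other v)) (env₂ x y v)
  EF vx x y = Penv (λ { vx → P.refl ; vy → P.refl })
  EF vy x y = Penv (λ { vx → P.refl ; vy → P.refl })

  px py : Var → Fin n → Fin n → Fin n
  px vx w d = d
  px vy w d = w
  py vx w d = w
  py vy w d = d

  FE : ∀ v w d → F v w d ≡ E (px v w d) (py v w d)
  FE vx w d = P.sym (EF vx d w)
  FE vy w d = P.sym (EF vy w d)

  env₂-pick-other : ∀ v w d → env₂ (px v w d) (py v w d) (other v) ≡ w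
  env₂-pick-other vx w d = P.refl
  env₂-pick-other vy w d = P.refl

  envAt-other : ∀ v (w d : Fin n) → envAt (other v) w d (other v) ≡ w
  envAt-other vx w d = P.refl
  envAt-other vy w d = P.refl

  D∀ : Var → (Fin n → Bool) → Bool
  D∀ v a = allFin n (λ x → allFin n (λ y → (not (a (env₂ x y (other v))) ∨ E x y) ∧ true)) ∧
           allFin n (λ x → anyFin n (λ y → a (envAt (other v) x y (other v)) ∨ not (G v x y)))

  D∃ : Var → (Fin n → Bool) → Bool
  D∃ v a = allFin n (λ x → allFin n (λ y → (not (E x y) ∨ a (env₂ x y (other v))) ∧ true)) ∧
           allFin n (λ x → anyFin n (λ y → not (a (envAt (other v) x y (other v))) ∨ G v x y))

  module _ (v : Var) (a : Fin n → Bool) where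
    U∀ = allFin n (λ x → allFin n (λ y → (not (a (env₂ x y (other v))) ∨ E x y) ∧ true))
    U∃ = allFin n (λ x → allFin n (λ y → (not (E x y) ∨ a (env₂ x y (other v))) ∧ true))

    D∀≡agrees∀ : D∀ v a ≡ allFin n (λ w → beq (a w) (allFin n (λ d → F v w d)))
    D∀≡agrees∀ = Bool-ext fwd bwd
      where
      fwd : D∀ v a ≡ true → allFin n (λ w → beq (a w) (allFin n (λ d → F v w d))) ≡ true
      fwd e = allFin-intro n (λ w → ≡-beq (pt w))
        where
        e1 : U∀ ≡ true
        e1 = ∧-elimˡ _ e
        e2 = ∧-elimʳ U∀ e
        tf : ∀ w d → a w ≡ true → F v w d ≡ true
        tf w d eq = let c = ∧-elimˡ _ (allFin-elim n (allFin-elim n e1 (px v w d)) (py v w d))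
                        c' = P.subst (λ z → not (a z) ∨ E (px v w d) (py v w d) ≡ true) (env₂-pick-other v w d) c
                        c'' = P.subst (λ t → not t ∨ E (px v w d) (py v w d) ≡ true) eq c'
                    in P.trans (FE v w d) c''
        ff : ∀ w → a w ≡ false → allFin n (λ d → F v w d) ≡ false
        ff w eq = let (d , p) = anyFin-elim n (allFin-elim n e2 w)
                      p' = P.subst (λ z → a z ∨ not (G v w d) ≡ true) (envAt-other v w d) p
                      p'' = P.subst (λ t → t ∨ not (G v w d) ≡ true) eq p'
                  in allFin-false n d (P.trans (P.sym (GF v w d)) (not-true p''))
        pt : ∀ w → a w ≡ allFin n (λ d → F v w d)
        pt w with a w in eq
        ... | true = P.sym (allFin-intro n (λ d → tf w d eq))
        ... | false = P.sym (ff w eq)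
      bwd : allFin n (λ w → beq (a w) (allFin n (λ d → F v w d))) ≡ true → D∀ v a ≡ true
      bwd e = ∧-intro (allFin-intro n (λ x → allFin-intro n (λ y → ∧-intro (q1 x y) P.refl))) (allFin-intro n q2)
        where
        ew : ∀ w → a w ≡ allFin n (λ d → F v w d)
        ew w = beq-≡ (allFin-elim n e w)
        q1 : ∀ x y → not (a (env₂ x y (other v))) ∨ E x y ≡ true
        q1 x y with a (env₂ x y (other v)) in eq
        ... | false = P.refl
        ... | true = P.trans (EF v x y) (allFin-elim n (P.trans (P.sym (ew _)) eq) (env₂ x y v))
        q2 : ∀ w → anyFin n (λ y → a (envAt (other v) w y (other v)) ∨ not (G v w y)) ≡ true
        q2 w with a w in eq
        ... | true = anyFin-intro n w (P.subst (λ z → a z ∨ not (G v w w) ≡ true) (P.sym (envAt-other v w w))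
                                       (P.subst (λ t → t ∨ not (G v w w) ≡ true) (P.sym eq) P.refl))
        ... | false = let (d , p) = allFin-false-elim n (P.trans (P.sym (ew w)) eq) in
                      anyFin-intro n d (∨-true-r _ (P.cong not (P.trans (GF v w d) p)))

    D∃≡agrees∃ : D∃ v a ≡ allFin n (λ w → beq (a w) (anyFin n (λ d → F v w d)))
    D∃≡agrees∃ = Bool-ext fwd bwd
      where
      fwd : D∃ v a ≡ true → allFin n (λ w → beq (a w) (anyFin n (λ d → F v w d))) ≡ true
      fwd e = allFin-intro n (λ w → ≡-beq (pt w))
        where
        e1 : U∃ ≡ true
        e1 = ∧-elimˡ _ e
        e2 = ∧-elimʳ U∃ e
        tt' : ∀ w → a w ≡ true → anyFin n (λ d → F v w d) ≡ true
        tt' w eq = let (d , p) = anyFin-elim n (allFin-elim n e2 w)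
                       p' = P.subst (λ z → not (a z) ∨ G v w d ≡ true) (envAt-other v w d) p
                       p'' = P.subst (λ t → not t ∨ G v w d ≡ true) eq p'
                   in anyFin-intro n d (P.trans (P.sym (GF v w d)) p'')
        ff : ∀ w d → a w ≡ false → F v w d ≡ false
        ff w d eq = let c = ∧-elimˡ _ (allFin-elim n (allFin-elim n e1 (px v w d)) (py v w d))
                        c' = P.subst (λ z → not (E (px v w d) (py v w d)) ∨ a z ≡ true) (env₂-pick-other v w d) c
                        c'' = P.subst (λ t → not (E (px v w d) (py v w d)) ∨ t ≡ true) eq c'
                    in P.trans (FE v w d) (not-true (P.trans (P.sym (BP.∨-identityʳ _)) c''))
        pt : ∀ w → a w ≡ anyFin n (λ d → F v w d)
        pt w with a w in eq
        ... | true = P.sym (tt' w eq)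
        ... | false = P.sym (anyFin-false-intro n (λ d → ff w d eq))
      bwd : allFin n (λ w → beq (a w) (anyFin n (λ d → F v w d))) ≡ true → D∃ v a ≡ true
      bwd e = ∧-intro (allFin-intro n (λ x → allFin-intro n (λ y → ∧-intro (q1 x y) P.refl))) (allFin-intro n q2)
        where
        ew : ∀ w → a w ≡ anyFin n (λ d → F v w d)
        ew w = beq-≡ (allFin-elim n e w)
        q1 : ∀ x y → not (E x y) ∨ a (env₂ x y (other v)) ≡ true
        q1 x y with E x y in eq
        ... | false = P.refl
        ... | true = P.trans (ew _) (anyFin-intro n (env₂ x y v) (P.trans (P.sym (EF v x y)) eq))
        q2 : ∀ w → anyFin n (λ y → not (a (envAt (other v) w y (other v))) ∨ G v w y) ≡ true
        q2 w with a w in eq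
        ... | false = anyFin-intro n w (P.subst (λ z → not (a z) ∨ G v w w ≡ true) (P.sym (envAt-other v w w))
                                        (P.subst (λ t → not t ∨ G v w w ≡ true) (P.sym eq) P.refl))
        ... | true = let (d , p) = anyFin-elim n (P.trans (P.sym (ew w)) eq) in
                     anyFin-intro n d (∨-true-r _ (P.trans (GF v w d) p))

module CanonicalDefinition {u b n} (v : Var) (φ : Fm u b) (ω : World u b n) (A : Fin (ℕ.suc (nq φ)) → Fin n → Bool)
          (a : Fin n → Bool) (h0 : ∀ y → A zero y ≡ a y) (hs : ∀ i y → A (suc i) y ≡ canonicalAux φ ω i y) where
  open QuantifierDefinition {n} (λ ρ → eval ω ρ φ) (λ e → eval-env ω e φ)

  atA : ∀ ρ → eval (ω ⊕ A) ρ (atom₁ (newA u (nq φ)) (other v)) ≡ a (ρ (other v))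
  atA ρ = P.trans (⊕-unary-↑ʳ ω A zero (ρ (other v))) (h0 _)

  trA : ∀ ρ → eval (ω ⊕ A) ρ (rename (embS u (nq φ)) (tr φ)) ≡ eval ω ρ φ
  trA ρ = P.trans (eval-rename (ω ⊕ A) (embS u (nq φ)) ρ (tr φ))
           (P.trans (eval-≐ (≐-trans (renameWorld-embS (nq φ) ω A) (⊕-cong ω hs)) ρ (tr φ)) (eval-tr-canonical φ ω ρ))

  defines∀≡ : defines∀ v φ ω A ≡ allFin n (λ w → beq (a w) (eval ω (λ _ → w) (∀' v φ)))
  defines∀≡ = P.trans (P.cong₂ _∧_
     (allFin-cong n (λ x → allFin-cong n (λ y → P.cong (λ t → t ∧ true) (P.cong₂ _∨_ (P.cong not (atA (env₂ x y))) (trA (env₂ x y))))))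
     (allFin-cong n (λ x → anyFin-cong n (λ y → P.cong₂ _∨_ (atA (envAt (other v) x y)) (P.cong not (trA (envAt (other v) x y)))))))
     (D∀≡agrees∀ v a)

  defines∃≡ : defines∃ v φ ω A ≡ allFin n (λ w → beq (a w) (eval ω (λ _ → w) (∃' v φ)))
  defines∃≡ = P.trans (P.cong₂ _∧_
     (allFin-cong n (λ x → allFin-cong n (λ y → P.cong (λ t → t ∧ true) (P.cong₂ _∨_ (P.cong not (trA (env₂ x y))) (atA (env₂ x y))))))
     (allFin-cong n (λ x → anyFin-cong n (λ y → P.cong₂ _∨_ (P.cong not (atA (envAt (other v) x y))) (trA (envAt (other v) x y))))))
     (D∃≡agrees∃ v a)

skolemClause-∀∀ : ∀ {n} w (s : Fin n → Bool) (θ' : Env n → Bool) → (∀ {ρ ρ'} → (∀ z → ρ z ≡ ρ' z) → θ' ρ ≡ θ' ρ') →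
  allFin n (λ x → allFin n (λ y → s (env₂ x y w) ∨ not (θ' (env₂ x y)))) ≡
  allFin n (λ a → s a ∨ allFin n (λ d → not (θ' (envAt w a d))))
skolemClause-∀∀ {n} vx s θ' hθ = allFin-cong n (λ x → P.trans (allFin-∨ n (s x) _)
  (P.cong (s x ∨_) (allFin-cong n (λ y → P.cong not (hθ (λ { vx → P.refl ; vy → P.refl }))))))
skolemClause-∀∀ {n} vy s θ' hθ = P.trans (allFin-swap n n _) (allFin-cong n (λ y → P.trans (allFin-∨ n (s y) _)
  (P.cong (s y ∨_) (allFin-cong n (λ x → P.cong not (hθ (λ { vx → P.refl ; vy → P.refl })))))))

qf-rename : ∀ {u u' b} (f : Fin u → Fin u') (θ : Fm u b) → quantifierFree (rename f θ) ≡ quantifierFree θ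
qf-rename f (atom₁ p v) = P.refl
qf-rename f (atom₂ r v w) = P.refl
qf-rename f (¬' θ) = qf-rename f θ
qf-rename f (θ ∧' θ') = P.cong₂ _∧_ (qf-rename f θ) (qf-rename f θ')
qf-rename f (θ ∨' θ') = P.cong₂ _∧_ (qf-rename f θ) (qf-rename f θ')
qf-rename f (∀' v θ) = P.refl
qf-rename f (∃' v θ) = P.refl

qf-tr : ∀ {u b} (φ : Fm u b) → quantifierFree (tr φ) ≡ true
qf-tr (atom₁ p v) = P.refl
qf-tr (atom₂ r v w) = P.refl
qf-tr (¬' φ) = qf-tr φ
qf-tr (φ ∧' ψ) = ∧-intro (P.trans (qf-rename _ (tr φ)) (qf-tr φ)) (P.trans (qf-rename _ (tr ψ)) (qf-tr ψ))
qf-tr (φ ∨' ψ) = ∧-intro (P.trans (qf-rename _ (tr φ)) (qf-tr φ)) (P.trans (qf-rename _ (tr ψ)) (qf-tr ψ))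
qf-tr (∀' v φ) = P.refl
qf-tr (∃' v φ) = P.refl

allLqf-map : ∀ {u u' b} (f : Fin u → Fin u') (L : List (Fm u b)) →
  allL quantifierFree (List.map (rename f) L) ≡ allL quantifierFree L
allLqf-map f L = P.trans (allL-map quantifierFree (rename f) L) (allL-cong (qf-rename f) L)

qf-univ : ∀ {u b} (φ : Fm u b) → allL quantifierFree (univDefs φ) ≡ true
qf-univ (atom₁ p v) = P.refl
qf-univ (atom₂ r v w) = P.refl
qf-univ (¬' φ) = qf-univ φ
qf-univ {u} (φ ∧' ψ) = P.trans (allL-++ quantifierFree (List.map (rename (embL u (nq φ) (nq ψ))) (univDefs φ)) _)
  (∧-intro (P.trans (allLqf-map _ (univDefs φ)) (qf-univ φ)) (P.trans (allLqf-map _ (univDefs ψ)) (qf-univ ψ)))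
qf-univ {u} (φ ∨' ψ) = P.trans (allL-++ quantifierFree (List.map (rename (embL u (nq φ) (nq ψ))) (univDefs φ)) _)
  (∧-intro (P.trans (allLqf-map _ (univDefs φ)) (qf-univ φ)) (P.trans (allLqf-map _ (univDefs ψ)) (qf-univ ψ)))
qf-univ {u} (∀' v φ) = ∧-intro (P.trans (qf-rename (embS u (nq φ)) (tr φ)) (qf-tr φ))
                              (P.trans (allLqf-map _ (univDefs φ)) (qf-univ φ))
qf-univ {u} (∃' v φ) = ∧-intro (∧-intro (P.trans (qf-rename (embS u (nq φ)) (tr φ)) (qf-tr φ)) P.refl)
                              (P.trans (allLqf-map _ (univDefs φ)) (qf-univ φ))

allVQF : ∀ {u b m} → Vec (Var × Fm u b) m → Bool
allVQF [] = true
allVQF ((w , θ) ∷ V) = quantifierFree θ ∧ allVQF V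

allVQF-++ : ∀ {u b m k} (V : Vec (Var × Fm u b) m) (V' : Vec (Var × Fm u b) k) → allVQF (V Vec.++ V') ≡ allVQF V ∧ allVQF V'
allVQF-++ [] V' = P.refl
allVQF-++ ((w , θ) ∷ V) V' = P.trans (P.cong (quantifierFree θ ∧_) (allVQF-++ V V')) (P.sym (BP.∧-assoc (quantifierFree θ) (allVQF V) (allVQF V')))

allVQF-map : ∀ {u u' b m} (f : Fin u → Fin u') (g : Var × Fm u b → Var × Fm u' b) →
             (∀ w θ → g (w , θ) ≡ (w , rename f θ)) → (V : Vec (Var × Fm u b) m) → allVQF (Vec.map g V) ≡ allVQF V
allVQF-map f g eq [] = P.refl
allVQF-map f g eq ((w , θ) ∷ V) = P.trans (P.cong (λ x → allVQF (x ∷ Vec.map g V)) (eq w θ))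
  (P.cong₂ _∧_ (qf-rename f θ) (allVQF-map f g eq V))

allVQF-lookup : ∀ {u b m} (V : Vec (Var × Fm u b) m) → allVQF V ≡ allFin m (λ k → quantifierFree (proj₂ (lookup V k)))
allVQF-lookup [] = P.refl
allVQF-lookup ((w , θ) ∷ V) = P.cong (quantifierFree θ ∧_) (allVQF-lookup V)

qf-ex : ∀ {u b} (φ : Fm u b) → allVQF (exDefs φ) ≡ true
qf-ex (atom₁ p v) = P.refl
qf-ex (atom₂ r v w) = P.refl
qf-ex (¬' φ) = qf-ex φ
qf-ex {u} (φ ∧' ψ) = P.trans (allVQF-++ (Vec.map (λ (w , θ) → w , rename (embL u (nq φ) (nq ψ)) θ) (exDefs φ)) _)
  (∧-intro (P.trans (allVQF-map _ _ (λ _ _ → P.refl) (exDefs φ)) (qf-ex φ)) (P.trans (allVQF-map _ _ (λ _ _ → P.refl) (exDefs ψ)) (qf-ex ψ)))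
qf-ex {u} (φ ∨' ψ) = P.trans (allVQF-++ (Vec.map (λ (w , θ) → w , rename (embL u (nq φ) (nq ψ)) θ) (exDefs φ)) _)
  (∧-intro (P.trans (allVQF-map _ _ (λ _ _ → P.refl) (exDefs φ)) (qf-ex φ)) (P.trans (allVQF-map _ _ (λ _ _ → P.refl) (exDefs ψ)) (qf-ex ψ)))
qf-ex {u} (∀' v φ) = ∧-intro (P.trans (qf-rename (embS u (nq φ)) (tr φ)) (qf-tr φ))
                            (P.trans (allVQF-map (embS u (nq φ)) _ (λ _ _ → P.refl) (exDefs φ)) (qf-ex φ))
qf-ex {u} (∃' v φ) = ∧-intro (P.trans (qf-rename (embS u (nq φ)) (tr φ)) (qf-tr φ))
                            (P.trans (allVQF-map (embS u (nq φ)) _ (λ _ _ → P.refl) (exDefs φ)) (qf-ex φ))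

qf-foldr : ∀ {u b} (t : Fm u b) L → quantifierFree (List.foldr _∧'_ t L) ≡ allL quantifierFree L ∧ quantifierFree t
qf-foldr t []ₗ = P.refl
qf-foldr t (x ∷ₗ L) = P.trans (P.cong (quantifierFree x ∧_) (qf-foldr t L))
  (P.sym (BP.∧-assoc (quantifierFree x) (allL quantifierFree L) (quantifierFree t)))

universalMatrix-just : ∀ {u b} (φ : Fm u b) {M : Fm u b} → universalMatrix φ ≡ just M →
          (φ ≡ ∀' vx (∀' vy M)) × (quantifierFree M ≡ true)
universalMatrix-just (∀' vx (∀' vy M')) e with quantifierFree M' in q
universalMatrix-just (∀' vx (∀' vy M')) P.refl | true = P.refl , q
universalMatrix-just (∀' vx (∀' vy M')) () | false
universalMatrix-just (atom₁ _ _) ()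
universalMatrix-just (atom₂ _ _ _) ()
universalMatrix-just (¬' _) ()
universalMatrix-just (_ ∧' _) ()
universalMatrix-just (_ ∨' _) ()
universalMatrix-just (∃' _ _) ()
universalMatrix-just (∀' vy _) ()
universalMatrix-just (∀' vx (atom₁ _ _)) ()
universalMatrix-just (∀' vx (atom₂ _ _ _)) ()
universalMatrix-just (∀' vx (¬' _)) ()
universalMatrix-just (∀' vx (_ ∧' _)) ()
universalMatrix-just (∀' vx (_ ∨' _)) ()
universalMatrix-just (∀' vx (∃' _ _)) ()
universalMatrix-just (∀' vx (∀' vx _)) ()

module SkolemMatrix {u b} (φ : Fm u b) where
  q = nq φ
  uA = u ℕ.+ q
  E = exDefs φ

  lift-≐ : ∀ {n} (ω1 : World uA b n) (Sk : Fin q → Fin n → Bool) → renameWorld (ω1 ⊕ Sk) (λ i → i Fin.↑ˡ q) ≐ ω1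
  lift-≐ ω1 Sk = (λ p i → ⊕-unary-↑ˡ ω1 Sk p i) , (λ _ _ _ → P.refl)

  eval-lift : ∀ {n} (ω1 : World uA b n) Sk ρ θ → eval (ω1 ⊕ Sk) ρ (rename (λ i → i Fin.↑ˡ q) θ) ≡ eval ω1 ρ θ
  eval-lift ω1 Sk ρ θ = P.trans (eval-rename (ω1 ⊕ Sk) _ ρ θ) (eval-≐ (lift-≐ ω1 Sk) ρ θ)

  lift : Fm uA b → Fm (skU φ) b
  lift = rename (λ i → i Fin.↑ˡ q)

  skolemClause : Fin q → Var × Fm uA b → Fm (skU φ) b
  skolemClause i wθ = atom₁ (uA Fin.↑ʳ i) (proj₁ wθ) ∨' (¬' lift (proj₂ wθ))

  skolemConjuncts : List (Fm (skU φ) b)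
  skolemConjuncts = List.map lift (univDefs φ) List.++ Vec.toList (Vec.zipWith skolemClause (Vec.allFin q) E)

  eval-skMatrix : ∀ {n} (ω1 : World uA b n) Sk ρ → eval (ω1 ⊕ Sk) ρ (skMatrix φ) ≡
    (allL (eval ω1 ρ) (univDefs φ) ∧
     allFin q (λ k → Sk k (ρ (proj₁ (lookup E k))) ∨ not (eval ω1 ρ (proj₂ (lookup E k))))) ∧ eval ω1 ρ (tr φ)
  eval-skMatrix ω1 Sk ρ = P.trans (eval-foldr (ω1 ⊕ Sk) ρ (lift (tr φ)) skolemConjuncts)
    (P.cong₂ _∧_ (P.trans (allL-++ (eval (ω1 ⊕ Sk) ρ) (List.map lift (univDefs φ)) (Vec.toList (Vec.zipWith skolemClause (Vec.allFin q) E)))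
       (P.cong₂ _∧_ (P.trans (allL-map (eval (ω1 ⊕ Sk) ρ) lift (univDefs φ)) (allL-cong (λ θ → eval-lift ω1 Sk ρ θ) (univDefs φ)))
                    (P.trans (allL-zip (eval (ω1 ⊕ Sk) ρ) skolemClause (λ i → i) E) (allFin-cong q (λ k →
                       P.cong₂ _∨_ (⊕-unary-↑ʳ ω1 Sk k _) (P.cong not (eval-lift ω1 Sk ρ (proj₂ (lookup E k)))))))))
      (eval-lift ω1 Sk ρ (tr φ)))

  noWitness : ∀ {n} → World uA b n → Fin q → Fin n → Bool
  noWitness {n} ω1 k a = allFin n (λ d → not (eval ω1 (envAt (proj₁ (lookup E k)) a d) (proj₂ (lookup E k))))

  holds∀∀-tr : ∀ {n} → World uA b n → Bool
  holds∀∀-tr {n} ω1 = allFin n (λ x → allFin n (λ y → eval ω1 (env₂ x y) (tr φ)))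

  holds∀∀-skMatrix : ∀ {n} (ω1 : World uA b n) Sk → holds∀∀ (skMatrix φ) (ω1 ⊕ Sk) ≡
    (universalsHold ω1 (univDefs φ) ∧ allFin q (λ k → allFin n (λ a → Sk k a ∨ noWitness ω1 k a))) ∧ holds∀∀-tr ω1
  holds∀∀-skMatrix {n} ω1 Sk = P.trans (allFin-cong n (λ x → allFin-cong n (λ y → eval-skMatrix ω1 Sk (env₂ x y))))
    (P.trans (allFin2-∧ n (λ x y → A x y ∧ B x y) (λ x y → eval ω1 (env₂ x y) (tr φ)))
    (P.cong (_∧ holds∀∀-tr ω1) (P.trans (allFin2-∧ n A B) (P.cong (universalsHold ω1 (univDefs φ) ∧_)
      (P.trans (allFin-cong n (λ x → allFin-swap n q (λ y k → B' k x y)))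
      (P.trans (allFin-swap n q (λ x k → allFin n (λ y → B' k x y)))
      (allFin-cong q (λ k → skolemClause-∀∀ (proj₁ (lookup E k)) (Sk k) (λ ρ → eval ω1 ρ (proj₂ (lookup E k)))
                                     (λ e → eval-env ω1 e (proj₂ (lookup E k)))))))))))
    where
    A : Fin n → Fin n → Bool
    A x y = allL (eval ω1 (env₂ x y)) (univDefs φ)
    B' : Fin q → Fin n → Fin n → Bool
    B' k x y = Sk k (env₂ x y (proj₁ (lookup E k))) ∨ not (eval ω1 (env₂ x y) (proj₂ (lookup E k)))
    B : Fin n → Fin n → Bool
    B x y = allFin q (λ k → B' k x y)

quantifierFree-skMatrix : ∀ {u b} (φ : Fm u b) → quantifierFree (skMatrix φ) ≡ true
quantifierFree-skMatrix φ = P.trans (qf-foldr (lift (tr φ)) skolemConjuncts)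
  (∧-intro (P.trans (allL-++ quantifierFree (List.map lift (univDefs φ)) (Vec.toList (Vec.zipWith skolemClause (Vec.allFin q) E)))
            (∧-intro (P.trans (allLqf-map _ (univDefs φ)) (qf-univ φ))
                    (P.trans (allL-zip quantifierFree skolemClause (λ i → i) E)
                      (allFin-intro q (λ k → P.trans (qf-rename _ (proj₂ (lookup E k)))
                         (allFin-elim q (P.trans (P.sym (allVQF-lookup E)) (qf-ex φ)) k))))))
          (P.trans (qf-rename _ (tr φ)) (qf-tr φ)))
  where open SkolemMatrix φ

module Counting {c ℓ} (R : CommutativeRing c ℓ) where
  open CommutativeRing R hiding (zero)

  open Weighted R
  open import Algebra.Properties.CommutativeSemigroup +-commutativeSemigroup using ()
    renaming (interchange to +-interchange)
  open import Algebra.Properties.CommutativeSemigroup *-commutativeSemigroup using ()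
    renaming (interchange to *-interchange)
  open import Relation.Binary.Reasoning.Setoid setoid

  ⟦∧⟧ : ∀ x y → ⟦ x ∧ y ⟧ ≈ ⟦ x ⟧ * ⟦ y ⟧
  ⟦∧⟧ true y = sym (*-identityˡ _)
  ⟦∧⟧ false y = sym (zeroˡ _)

  ⟦⟧-cong : ∀ {x y} → x ≡ y → ⟦ x ⟧ ≈ ⟦ y ⟧
  ⟦⟧-cong P.refl = refl

  -- Summation operators

  IsAdditive : {B : Set} → ((B → Carrier) → Carrier) → Set (c ⊔ ℓ)
  IsAdditive {B} T = (∀ {f g : B → Carrier} → (∀ b → f b ≈ g b) → T f ≈ T g)
             × (T (λ _ → 0#) ≈ 0#)
             × (∀ (f g : B → Carrier) → T (λ b → f b + g b) ≈ T f + T g)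

  -- A summation over A comes with a decidable equivalence `same` for which it admits Kronecker deltas, and
  -- commutes with every additive operator; changes of variables are then proved by inserting a δ (sum-reindex).
  record Summation (A : Set) : Set (lsuc lzero ⊔ c ⊔ ℓ) where
    field
      sum : (A → Carrier) → Carrier
      sum-cong : ∀ {f g : A → Carrier} → (∀ a → f a ≈ g a) → sum f ≈ sum g
      sum-interchange : ∀ {B : Set} (T : (B → Carrier) → Carrier) → IsAdditive T →
             (f : A → B → Carrier) → T (λ b → sum (λ a → f a b)) ≈ sum (λ a → T (f a))
      same : A → A → Bool
      same-refl : ∀ a → same a a ≡ true
      same-sym : ∀ a a' → same a a' ≡ true → same a' a ≡ true
      same-trans : ∀ a a' a'' → same a a' ≡ true → same a' a'' ≡ true → same a a'' ≡ true
      sum-δ : (F : A → Carrier) → (∀ a a' → same a a' ≡ true → F a ≈ F a') →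
              ∀ a₀ → sum (λ a → ⟦ same a a₀ ⟧ * F a) ≈ F a₀

    Respects : (A → Carrier) → Set (ℓ)
    Respects F = ∀ a a' → same a a' ≡ true → F a ≈ F a'

    sum-*ˡ : ∀ k f → k * sum f ≈ sum (λ a → k * f a)
    sum-*ˡ k f = sum-interchange {B = ⊤} (λ h → k * h tt)
      ((λ p → *-congˡ (p tt)) , zeroʳ k , (λ f g → distribˡ k (f tt) (g tt)))
      (λ a _ → f a)

    sum-+ : ∀ f g → sum (λ a → f a + g a) ≈ sum f + sum g
    sum-+ f g = sym (sum-interchange {B = Bool} sumBool
      ((λ p → +-cong (p true) (p false)) , +-identityˡ 0# ,
       (λ f g → +-interchange (f true) (g true) (f false) (g false)))
      (λ a b → if b then f a else g a))

    sum-0 : sum (λ _ → 0#) ≈ 0#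
    sum-0 = sym (sum-interchange {B = ⊤} (λ _ → 0#) ((λ _ → refl) , refl , (λ _ _ → sym (+-identityˡ 0#))) (λ _ _ → 0#))

    sum-*ʳ : ∀ k f → sum f * k ≈ sum (λ a → f a * k)
    sum-*ʳ k f = trans (*-comm _ _) (trans (sum-*ˡ k f) (sum-cong (λ a → *-comm k (f a))))

    sum-additive : IsAdditive sum
    sum-additive = sum-cong , sum-0 , sum-+

  open Summation

  Bool-sum : Summation Bool
  Bool-sum = record
    { sum = sumBool
    ; sum-cong = λ p → +-cong (p true) (p false)
    ; sum-interchange = λ T ta f → proj₂ (proj₂ ta) (f true) (f false)
    ; same = beq
    ; same-refl = λ { true → P.refl ; false → P.refl }
    ; same-sym = λ { true true _ → P.refl ; false false _ → P.refl ; true false () ; false true () }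
    ; same-trans = λ { true true true _ _ → P.refl ; false false false _ _ → P.refl
                    ; true false _ () _ ; false true _ () _ ; true true false _ () ; false false true _ () }
    ; sum-δ = λ F _ → λ { true → trans (+-cong (*-identityˡ _) (zeroˡ _)) (+-identityʳ _)
                        ; false → trans (+-cong (zeroˡ _) (*-identityˡ _)) (+-identityˡ _) }
    }

  module FunSummation {A : Set} (O : Summation A) where
    private module O = Summation O

    sameFun : ∀ m → (Fin m → A) → (Fin m → A) → Bool
    sameFun m g g' = allFin m (λ i → O.same (g i) (g' i))

    funSum-cong : ∀ m {f g : (Fin m → A) → Carrier} → (∀ a → f a ≈ g a) → sumFun m O.sum f ≈ sumFun m O.sum g
    funSum-cong ℕ.zero p = p _
    funSum-cong (ℕ.suc m) p = O.sum-cong (λ a → funSum-cong m (λ g → p _))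

    funSum-interchange : ∀ m {B : Set} (T : (B → Carrier) → Carrier) → IsAdditive T →
            (f : (Fin m → A) → B → Carrier) →
            T (λ b → sumFun m O.sum (λ a → f a b)) ≈ sumFun m O.sum (λ a → T (f a))
    funSum-interchange ℕ.zero T ta f = refl
    funSum-interchange (ℕ.suc m) T ta f = trans (O.sum-interchange T ta _) (O.sum-cong (λ a → funSum-interchange m T ta _))

    funSum-*ˡ : ∀ m k (f : (Fin m → A) → Carrier) → k * sumFun m O.sum f ≈ sumFun m O.sum (λ a → k * f a)
    funSum-*ˡ m k f = funSum-interchange m {B = ⊤} (λ h → k * h tt)
      ((λ p → *-congˡ (p tt)) , zeroʳ k , (λ f g → distribˡ k (f tt) (g tt)))
      (λ a _ → f a)

    funSum-∧-factor : ∀ m x (y : (Fin m → A) → Bool) (G : (Fin m → A) → Carrier) →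
            sumFun m O.sum (λ g → ⟦ x ∧ y g ⟧ * G g) ≈ ⟦ x ⟧ * sumFun m O.sum (λ g → ⟦ y g ⟧ * G g)
    funSum-∧-factor m x y G = trans (funSum-cong m (λ g → trans (*-congʳ (⟦∧⟧ x (y g))) (*-assoc _ _ _)))
                          (sym (funSum-*ˡ m _ _))

    funSum-δ : ∀ m (F : (Fin m → A) → Carrier) → (∀ a a' → sameFun m a a' ≡ true → F a ≈ F a') →
             ∀ a₀ → sumFun m O.sum (λ a → ⟦ sameFun m a a₀ ⟧ * F a) ≈ F a₀
    funSum-δ ℕ.zero F Fr a₀ = trans (*-identityˡ _) (Fr _ a₀ P.refl)
    funSum-δ (ℕ.suc m) F Fr a₀ =
      trans (O.sum-cong (λ a → funSum-∧-factor m (O.same a (a₀ zero)) (λ g → allFin m (λ i → O.same (g i) (a₀ (suc i)))) _))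
      (trans (O.sum-cong (λ a → *-congˡ (funSum-δ m _ (λ g g' e → Fr _ _ (∧-intro (O.same-refl a) e)) (λ i → a₀ (suc i)))))
      (trans (O.sum-δ _ (λ a a' e → Fr _ _ (∧-intro e (allFin-intro m (λ i → O.same-refl _)))) (a₀ zero))
             (Fr _ a₀ (∧-intro (O.same-refl _) (allFin-intro m (λ i → O.same-refl _))))))

    Fun-sum : ∀ m → Summation (Fin m → A)
    Fun-sum m = record
      { sum = sumFun m O.sum
      ; sum-cong = funSum-cong m
      ; sum-interchange = funSum-interchange m
      ; same = sameFun m
      ; same-refl = λ a → allFin-intro m (λ i → O.same-refl _)
      ; same-sym = λ a a' e → allFin-intro m (λ i → O.same-sym _ _ (allFin-elim m e i))
      ; same-trans = λ a a' a'' e e' → allFin-intro m (λ i → O.same-trans _ _ _ (allFin-elim m e i) (allFin-elim m e' i))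
      ; sum-δ = funSum-δ m
      }

  Fun-sum : ∀ {A : Set} m → Summation A → Summation (Fin m → A)
  Fun-sum m O = FunSummation.Fun-sum O m

  Pair-sum : ∀ {A B : Set} → Summation A → Summation B → Summation (A × B)
  Pair-sum {A} {B} OA OB = record
    { sum = λ f → OA.sum (λ a → OB.sum (λ b → f (a , b)))
    ; sum-cong = λ p → OA.sum-cong (λ a → OB.sum-cong (λ b → p _))
    ; sum-interchange = λ T ta f → trans (OA.sum-interchange T ta _) (OA.sum-cong (λ a → OB.sum-interchange T ta _))
    ; same = λ x y → OA.same (proj₁ x) (proj₁ y) ∧ OB.same (proj₂ x) (proj₂ y)
    ; same-refl = λ x → ∧-intro (OA.same-refl _) (OB.same-refl _)
    ; same-sym = λ x y e → ∧-intro (OA.same-sym _ _ (∧-elimˡ _ e)) (OB.same-sym _ _ (∧-elimʳ _ e))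
    ; same-trans = λ x y z e e' → ∧-intro (OA.same-trans _ _ _ (∧-elimˡ _ e) (∧-elimˡ _ e'))
                                        (OB.same-trans _ _ _ (∧-elimʳ _ e) (∧-elimʳ _ e'))
    ; sum-δ = λ F Fr x₀ →
        trans (OA.sum-cong (λ a → trans (OB.sum-cong (λ b → trans (*-congʳ (⟦∧⟧ (OA.same a (proj₁ x₀)) (OB.same b (proj₂ x₀)))) (*-assoc _ _ _)))
                                    (sym (sum-*ˡ OB _ _))))
        (trans (OA.sum-cong (λ a → *-congˡ (OB.sum-δ _ (λ b b' e → Fr _ _ (∧-intro (OA.same-refl a) e)) (proj₂ x₀))))
        (OA.sum-δ _ (λ a a' e → Fr _ _ (∧-intro e (OB.same-refl _))) (proj₁ x₀)))
    }
    where
    module OA = Summation OA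
    module OB = Summation OB

  Retract-sum : ∀ {A A' : Set} (O : Summation A) (fwd : A' → A) (bwd : A → A') →
          (∀ a → same O (fwd (bwd a)) a ≡ true) → Summation A'
  Retract-sum O fwd bwd r1 = record
    { sum = λ F → sum O (λ a → F (bwd a))
    ; sum-cong = λ p → sum-cong O (λ a → p _)
    ; sum-interchange = λ T ta f → sum-interchange O T ta _
    ; same = λ x y → same O (fwd x) (fwd y)
    ; same-refl = λ x → same-refl O _
    ; same-sym = λ x y → same-sym O _ _
    ; same-trans = λ x y z → same-trans O _ _ _
    ; sum-δ = λ F Fr x₀ →
        trans (sum-cong O (λ a → *-congʳ (⟦⟧-cong (Bool-ext
                  (λ e → same-trans O _ _ _ (same-sym O _ _ (r1 a)) e)
                  (λ e → same-trans O _ _ _ (r1 a) e)))))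
        (trans (sum-δ O (λ a → F (bwd a))
                  (λ a a' e → Fr _ _ (same-trans O _ _ _ (r1 a) (same-trans O _ _ _ e (same-sym O _ _ (r1 a')))))
                  (fwd x₀))
           (Fr _ _ (r1 (fwd x₀))))
    }

  -- The hypothesis says that e and e' are mutually inverse up to `same`.
  sum-reindex : ∀ {X Y : Set} (OX : Summation X) (OY : Summation Y) (e : X → Y) (e' : Y → X) →
            (∀ x y → same OY y (e x) ≡ same OX x (e' y)) →
            (h : Y → Carrier) → Respects OY h → sum OY h ≈ sum OX (λ x → h (e x))
  sum-reindex OX OY e e' eq h hr = sym (begin
    sum OX (λ x → h (e x))
      ≈⟨ sum-cong OX (λ x → sym (sum-δ OY h hr (e x))) ⟩
    sum OX (λ x → sum OY (λ y → ⟦ same OY y (e x) ⟧ * h y))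
      ≈⟨ sum-interchange OY (sum OX) (sum-additive OX) (λ y x → ⟦ same OY y (e x) ⟧ * h y) ⟩
    sum OY (λ y → sum OX (λ x → ⟦ same OY y (e x) ⟧ * h y))
      ≈⟨ sum-cong OY (λ y → trans (sum-cong OX (λ x → *-congʳ (trans (⟦⟧-cong (eq x y)) (sym (*-identityʳ _)))))
                              (sym (sum-*ʳ OX (h y) _))) ⟩
    sum OY (λ y → sum OX (λ x → ⟦ same OX x (e' y) ⟧ * 1#) * h y)
      ≈⟨ sum-cong OY (λ y → *-congʳ (sum-δ OX (λ _ → 1#) (λ _ _ _ → refl) (e' y))) ⟩
    sum OY (λ y → 1# * h y)
      ≈⟨ sum-cong OY (λ y → *-identityˡ (h y)) ⟩
    sum OY h ∎)

  sumFun-prodFin : ∀ {A : Set} (O : Summation A) m (g : Fin m → A → Carrier) →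
     sumFun m (sum O) (λ h → prodFin m (λ i → g i (h i))) ≈ prodFin m (λ i → sum O (g i))
  sumFun-prodFin O ℕ.zero g = refl
  sumFun-prodFin O (ℕ.suc m) g =
    trans (sum-cong O (λ a → trans (sym (sum-*ˡ (Fun-sum m O) (g zero a) _))
                                (*-congˡ (sumFun-prodFin O m (λ i → g (suc i))))))
          (sym (sum-*ʳ O _ (g zero)))

  prodFin-cong : ∀ m {f g : Fin m → Carrier} → (∀ i → f i ≈ g i) → prodFin m f ≈ prodFin m g
  prodFin-cong ℕ.zero p = refl
  prodFin-cong (ℕ.suc m) p = *-cong (p zero) (prodFin-cong m (λ i → p (suc i)))

  prodFin-* : ∀ m (f g : Fin m → Carrier) → prodFin m (λ i → f i * g i) ≈ prodFin m f * prodFin m g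
  prodFin-* ℕ.zero f g = sym (*-identityˡ 1#)
  prodFin-* (ℕ.suc m) f g = trans (*-congˡ (prodFin-* m _ _)) (*-interchange _ _ _ _)

  prodFin-1 : ∀ m → prodFin m (λ _ → 1#) ≈ 1#
  prodFin-1 ℕ.zero = refl
  prodFin-1 (ℕ.suc m) = trans (*-identityˡ _) (prodFin-1 m)

  ⟦allFin⟧ : ∀ m (f : Fin m → Bool) → ⟦ allFin m f ⟧ ≈ prodFin m (λ i → ⟦ f i ⟧)
  ⟦allFin⟧ ℕ.zero f = refl
  ⟦allFin⟧ (ℕ.suc m) f = trans (⟦∧⟧ (f zero) _) (*-congˡ (⟦allFin⟧ m (λ i → f (suc i))))

  prodFin-swap : ∀ m k (f : Fin m → Fin k → Carrier) →
    prodFin m (λ i → prodFin k (λ j → f i j)) ≈ prodFin k (λ j → prodFin m (λ i → f i j))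
  prodFin-swap ℕ.zero k f = sym (prodFin-1 k)
  prodFin-swap (ℕ.suc m) k f =
    trans (*-congˡ (prodFin-swap m k (λ i → f (suc i)))) (sym (prodFin-* k _ _))

  prodFin-+ : ∀ m k (f : Fin (m ℕ.+ k) → Carrier) →
    prodFin (m ℕ.+ k) f ≈ prodFin m (λ i → f (i Fin.↑ˡ k)) * prodFin k (λ i → f (m Fin.↑ʳ i))
  prodFin-+ ℕ.zero k f = sym (*-identityˡ _)
  prodFin-+ (ℕ.suc m) k f = trans (*-congˡ (prodFin-+ m k (λ i → f (suc i)))) (sym (*-assoc _ _ _))

  Unary-sum : ∀ u n → Summation (Fin u → Fin n → Bool)
  Unary-sum u n = Fun-sum u (Fun-sum n Bool-sum)

  Binary-sum : ∀ b n → Summation (Fin b → Fin n → Fin n → Bool)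
  Binary-sum b n = Fun-sum b (Fun-sum n (Fun-sum n Bool-sum))

  World-sum : ∀ u b n → Summation (World u b n)
  World-sum u b n = Retract-sum (Pair-sum (Unary-sum u n) (Binary-sum b n)) (λ ω → unary ω , binary ω)
                    (λ p → world (proj₁ p) (proj₂ p)) (λ p → same-refl (Pair-sum (Unary-sum u n) (Binary-sum b n)) p)

  sameFun⇒≡ : ∀ n {f g : Fin n → Bool} → same (Fun-sum n Bool-sum) f g ≡ true → ∀ i → f i ≡ g i
  sameFun⇒≡ n e i = beq-≡ (allFin-elim n e i)

  ≡⇒sameFun : ∀ n {f g : Fin n → Bool} → (∀ i → f i ≡ g i) → same (Fun-sum n Bool-sum) f g ≡ true
  ≡⇒sameFun n e = allFin-intro n (λ i → ≡-beq (e i))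

  sameUnary⇒≡ : ∀ u n {f g : Fin u → Fin n → Bool} → same (Unary-sum u n) f g ≡ true → ∀ p i → f p i ≡ g p i
  sameUnary⇒≡ u n e p = sameFun⇒≡ n (allFin-elim u e p)

  ≡⇒sameUnary : ∀ u n {f g : Fin u → Fin n → Bool} → (∀ p i → f p i ≡ g p i) → same (Unary-sum u n) f g ≡ true
  ≡⇒sameUnary u n e = allFin-intro u (λ p → ≡⇒sameFun n (e p))

  sameBinary⇒≡ : ∀ b n {f g : Fin b → Fin n → Fin n → Bool} → same (Binary-sum b n) f g ≡ true → ∀ r i j → f r i j ≡ g r i j
  sameBinary⇒≡ b n e r i = sameFun⇒≡ n (allFin-elim n (allFin-elim b e r) i)

  ≡⇒sameBinary : ∀ b n {f g : Fin b → Fin n → Fin n → Bool} → (∀ r i j → f r i j ≡ g r i j) → same (Binary-sum b n) f g ≡ true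
  ≡⇒sameBinary b n e = allFin-intro b (λ r → allFin-intro n (λ i → ≡⇒sameFun n (e r i)))

  sameWorld⇒≐ : ∀ {u b n} {ω ω' : World u b n} → same (World-sum u b n) ω ω' ≡ true → ω ≐ ω'
  sameWorld⇒≐ {u} {b} {n} e = sameUnary⇒≡ u n (∧-elimˡ _ e) , sameBinary⇒≡ b n (∧-elimʳ _ e)

  ≐⇒sameWorld : ∀ {u b n} {ω ω' : World u b n} → ω ≐ ω' → same (World-sum u b n) ω ω' ≡ true
  ≐⇒sameWorld {u} {b} {n} (e₁ , e₂) = ∧-intro (≡⇒sameUnary u n e₁) (≡⇒sameBinary b n e₂)

  lit-cong : ∀ {x y} → x ≡ y → ∀ a b → lit x a b ≈ lit y a b
  lit-cong P.refl a b = refl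

  lit-cong3 : ∀ {x y : Bool} {a a' c' c'' : Carrier} → x ≡ y → a ≡ a' → c' ≡ c'' → lit x a c' ≈ lit y a' c''
  lit-cong3 P.refl P.refl P.refl = refl

  lit11 : ∀ x → lit x 1# 1# ≈ 1#
  lit11 true = refl
  lit11 false = refl

  weight-≐ : ∀ {u b n} (W : Weighting u b) {ω ω' : World u b n} → ω ≐ ω' → weight W ω ≈ weight W ω'
  weight-≐ {u} {b} {n} W e =
    *-cong (prodFin-cong u (λ p → prodFin-cong n (λ i → lit-cong (proj₁ e p i) _ _)))
           (prodFin-cong b (λ r → prodFin-cong n (λ i → prodFin-cong n (λ j → lit-cong (proj₂ e r i j) _ _))))

  module Solver = Algebra.Solver.CommutativeMonoid *-commutativeMonoid

  open Solver using (_⊜_) renaming (_⊕_ to _⊛_)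

  -- Cells and the cell-graph sum

  Cellᶠ-sum : ∀ u b → Summation ((Fin u → Bool) × (Fin b → Bool))
  Cellᶠ-sum u b = Pair-sum (Fun-sum u Bool-sum) (Fun-sum b Bool-sum)

  Cell-sum : ∀ u b → Summation (Cell u b)
  Cell-sum u b = Retract-sum (Cellᶠ-sum u b)
     (λ c → lookup (proj₁ c) , lookup (proj₂ c)) (λ p → tabulate (proj₁ p) , tabulate (proj₂ p))
     (λ p → ∧-intro (≡⇒sameFun u (VP.lookup∘tabulate (proj₁ p))) (≡⇒sameFun b (VP.lookup∘tabulate (proj₂ p))))

  toCell : ∀ {u b} → (Fin u → Bool) × (Fin b → Bool) → Cell u b
  toCell p = tabulate (proj₁ p) , tabulate (proj₂ p)

  toCell-≟ᶜ : ∀ {u b} (x y : (Fin u → Bool) × (Fin b → Bool)) → (toCell x ≟ᶜ toCell y) ≡ same (Cellᶠ-sum u b) x y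
  toCell-≟ᶜ {u} {b} x y = Bool-ext
    (λ e → let e' = ≟ᶜ-≡ e in ∧-intro (≡⇒sameFun u (tabulate-injective (P.cong proj₁ e'))) (≡⇒sameFun b (tabulate-injective (P.cong proj₂ e'))))
    (λ e → ≡-≟ᶜ (P.cong₂ _,_ (VP.tabulate-cong (sameFun⇒≡ u (∧-elimˡ _ e))) (VP.tabulate-cong (sameFun⇒≡ b (∧-elimʳ _ e)))))

  ≟ᶜ-same : ∀ {u b} (c d : Cell u b) → (c ≟ᶜ d) ≡ same (Cell-sum u b) c d
  ≟ᶜ-same {u} {b} c d = Bool-ext
    (λ e → let e' = ≟ᶜ-≡ e in ∧-intro (≡⇒sameFun u (λ i → P.cong (λ v → lookup (proj₁ v) i) e')) (≡⇒sameFun b (λ i → P.cong (λ v → lookup (proj₂ v) i) e')))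
    (λ e → ≡-≟ᶜ (P.cong₂ _,_ (vext (sameFun⇒≡ u (∧-elimˡ _ e))) (vext (sameFun⇒≡ b (∧-elimʳ _ e)))))
    where
    vext : ∀ {m} {v w : Vec Bool m} → (∀ i → lookup v i ≡ lookup w i) → v ≡ w
    vext {v = v} {w} e = P.trans (P.sym (VP.tabulate∘lookup v)) (P.trans (VP.tabulate-cong e) (VP.tabulate∘lookup w))

  Extensional : ∀ {A : Set} {n} → ((Fin n → A) → Carrier) → Set _
  Extensional {n = n} F = ∀ c c' → (∀ i → c i ≡ c' i) → F c ≈ F c'

  cellGraphStep : (G : CellGraph) → ∀ n → ((Fin (ℕ.suc n) → Cell (cu G) (cb G)) → Carrier) →
    (Fin n → Cell (cu G) (cb G)) → Carrier
  cellGraphStep G n F c =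
    sum (Cell-sum (cu G) (cb G)) (λ k → vlabel G k * (prodFin n (λ j → elabel G k (c j)) * F (cons k c)))

  -- cellGraphSum G n F = Σ_{c : Fin n → cells} Π_i w_{c i} Π_{i<j} r_{c i, c j} F c
  cellGraphSum : (G : CellGraph) → ∀ n → ((Fin n → Cell (cu G) (cb G)) → Carrier) → Carrier
  cellGraphSum G ℕ.zero F = F (λ ())
  cellGraphSum G (ℕ.suc n) F = cellGraphSum G n (cellGraphStep G n F)

  cellGraphStep-extensional : ∀ G n F → Extensional F → Extensional (cellGraphStep G n F)
  cellGraphStep-extensional G n F FR c c' e = sum-cong (Cell-sum (cu G) (cb G))
    {λ k → vlabel G k * (prodFin n (λ j → elabel G k (c j)) * F (cons k c))}
    {λ k → vlabel G k * (prodFin n (λ j → elabel G k (c' j)) * F (cons k c'))}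
    (λ k → *-congˡ (*-cong (prodFin-cong n (λ j → reflexive (P.cong (elabel G k) (e j))))
                           (FR (cons k c) (cons k c') (λ { zero → P.refl ; (suc i) → e i }))))

  cellGraphSum-cong : ∀ G n {F F'} → (∀ c → F c ≈ F' c) → cellGraphSum G n F ≈ cellGraphSum G n F'
  cellGraphSum-cong G ℕ.zero p = p _
  cellGraphSum-cong G (ℕ.suc n) {F} {F'} p = cellGraphSum-cong G n (λ c → sum-cong (Cell-sum (cu G) (cb G))
    {λ k → vlabel G k * (prodFin n (λ j → elabel G k (c j)) * F (cons k c))}
    {λ k → vlabel G k * (prodFin n (λ j → elabel G k (c j)) * F' (cons k c))}
    (λ k → *-congˡ (*-congˡ (p (cons k c)))))

  sameCell⇒≡ : ∀ {u b} {c d : Cell u b} → same (Cell-sum u b) c d ≡ true → c ≡ d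
  sameCell⇒≡ {c = c} {d} e = ≟ᶜ-≡ (P.trans (≟ᶜ-same c d) e)

  ≡⇒sameCell : ∀ {u b} {c d : Cell u b} → c ≡ d → same (Cell-sum u b) c d ≡ true
  ≡⇒sameCell {c = c} {d} e = P.trans (P.sym (≟ᶜ-same c d)) (≡-≟ᶜ e)

  Cell-sum-bijection : ∀ {u b u' b'} (f : Cell u' b' ↔ Cell u b) (h : Cell u b → Carrier) →
    sum (Cell-sum u b) h ≈ sum (Cell-sum u' b') (λ k → h (Inverse.to f k))
  Cell-sum-bijection f h = sum-reindex (Cell-sum _ _) (Cell-sum _ _) (Inverse.to f) (Inverse.from f)
    (λ x y → Bool-ext
      (λ e → ≡⇒sameCell (P.trans (P.sym (Inverse.strictlyInverseʳ f x)) (P.sym (P.cong (Inverse.from f) (sameCell⇒≡ e)))))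
      (λ e → ≡⇒sameCell (P.trans (P.sym (Inverse.strictlyInverseˡ f y)) (P.cong (Inverse.to f) (P.sym (sameCell⇒≡ e))))))
    h (λ a a' e → reflexive (P.cong h (sameCell⇒≡ e)))

  cellGraphSum-iso : (G G' : CellGraph) → (iso : Isomorphic G G') →
    ∀ n (F : (Fin n → Cell (cu G) (cb G)) → Carrier) → Extensional F →
    cellGraphSum G' n (λ c' → F (λ j → Inverse.to (proj₁ iso) (c' j))) ≈ cellGraphSum G n F
  cellGraphSum-iso G G' (f , vl , el) ℕ.zero F FR = FR _ _ (λ ())
  cellGraphSum-iso G G' iso@(f , vl , el) (ℕ.suc n) F FR =
    trans (cellGraphSum-cong G' n (λ c' → sym (step c')))
          (cellGraphSum-iso G G' iso n (cellGraphStep G n F) (cellGraphStep-extensional G n F FR))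
    where
    to = Inverse.to f
    step : ∀ c' → cellGraphStep G n F (λ j → to (c' j)) ≈ cellGraphStep G' n (λ c → F (λ j → to (c j))) c'
    step c' = trans (Cell-sum-bijection f (λ k → vlabel G k * (prodFin n (λ j → elabel G k (to (c' j))) * F (cons k (λ j → to (c' j))))))
                 (sum-cong (Cell-sum (cu G') (cb G')) (λ k' → *-cong (sym (vl k'))
                 (*-cong (prodFin-cong n (λ j → sym (el k' (c' j))))
                         (FR (cons (to k') (λ j → to (c' j))) (λ j → to (cons k' c' j))
                             (λ { zero → P.refl ; (suc i) → P.refl })))))

  RowCol-sum : ∀ b n → Summation ((Fin b → Fin n → Bool) × (Fin b → Fin n → Bool))
  RowCol-sum b n = Pair-sum (Fun-sum b (Fun-sum n Bool-sum)) (Fun-sum b (Fun-sum n Bool-sum))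

  NewElement : ℕ → ℕ → ℕ → Set
  NewElement u b n = ((Fin u → Bool) × (Fin b → Bool)) × ((Fin b → Fin n → Bool) × (Fin b → Fin n → Bool))

  NewElement-sum : ∀ u b n → Summation (NewElement u b n)
  NewElement-sum u b n = Pair-sum (Cellᶠ-sum u b) (RowCol-sum b n)

  extendUnary : ∀ {u n} → (Fin u → Bool) → (Fin u → Fin n → Bool) → Fin u → Fin (ℕ.suc n) → Bool
  extendUnary α U p zero = α p
  extendUnary α U p (suc i) = U p i

  extendBinary : ∀ {b n} → (Fin b → Bool) → (Fin b → Fin n → Bool) → (Fin b → Fin n → Bool) →
         (Fin b → Fin n → Fin n → Bool) → Fin b → Fin (ℕ.suc n) → Fin (ℕ.suc n) → Bool
  extendBinary β row col B r zero zero = β r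
  extendBinary β row col B r zero (suc j) = row r j
  extendBinary β row col B r (suc i) zero = col r i
  extendBinary β row col B r (suc i) (suc j) = B r i j

  extend : ∀ {u b n} → World u b n → NewElement u b n → World u b (ℕ.suc n)
  extend ω d = world (extendUnary (proj₁ (proj₁ d)) (unary ω))
                  (extendBinary (proj₂ (proj₁ d)) (proj₁ (proj₂ d)) (proj₂ (proj₂ d)) (binary ω))

  newElementOf : ∀ {u b n} → World u b (ℕ.suc n) → NewElement u b n
  newElementOf ω' = ((λ p → unary ω' p zero) , (λ r → binary ω' r zero zero)) ,
            ((λ r j → binary ω' r zero (suc j)) , (λ r i → binary ω' r (suc i) zero))

  restrict : ∀ {u b n} → World u b (ℕ.suc n) → World u b n
  restrict ω' = world (λ p i → unary ω' p (suc i)) (λ r i j → binary ω' r (suc i) (suc j))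

  sumWorlds-suc : ∀ {u b n} (h : World u b (ℕ.suc n) → Carrier) → Respects (World-sum u b (ℕ.suc n)) h →
          sumWorlds u b (ℕ.suc n) h ≈ sum (NewElement-sum u b n) (λ d → sumWorlds u b n (λ ω → h (extend ω d)))
  sumWorlds-suc {u} {b} {n} h hr = sum-reindex (Pair-sum (NewElement-sum u b n) (World-sum u b n)) (World-sum u b (ℕ.suc n))
      (λ x → extend (proj₂ x) (proj₁ x)) (λ y → newElementOf y , restrict y) cond h hr
    where
    cond : ∀ x y → same (World-sum u b (ℕ.suc n)) y (extend (proj₂ x) (proj₁ x)) ≡
                   same (Pair-sum (NewElement-sum u b n) (World-sum u b n)) x (newElementOf y , restrict y)
    cond ((αβ , rc) , ω) y = Bool-ext to' from'
      where
      to' : same (World-sum u b (ℕ.suc n)) y (extend ω (αβ , rc)) ≡ true →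
            same (Pair-sum (NewElement-sum u b n) (World-sum u b n)) ((αβ , rc) , ω) (newElementOf y , restrict y) ≡ true
      to' e = let (pu , pb) = sameWorld⇒≐ {ω = y} {ω' = extend ω (αβ , rc)} e in
        ∧-intro (∧-intro (∧-intro (≡⇒sameFun u {proj₁ αβ} {λ p → unary y p zero} (λ p → P.sym (pu p zero)))
                               (≡⇒sameFun b {proj₂ αβ} {λ r → binary y r zero zero} (λ r → P.sym (pb r zero zero))))
                       (∧-intro (≡⇒sameUnary b n {proj₁ rc} {λ r j → binary y r zero (suc j)} (λ r j → P.sym (pb r zero (suc j))))
                               (≡⇒sameUnary b n {proj₂ rc} {λ r i → binary y r (suc i) zero} (λ r i → P.sym (pb r (suc i) zero)))))
               (≐⇒sameWorld {ω = ω} {ω' = restrict y} ((λ p i → P.sym (pu p (suc i))) , (λ r i j → P.sym (pb r (suc i) (suc j)))))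
      from' : same (Pair-sum (NewElement-sum u b n) (World-sum u b n)) ((αβ , rc) , ω) (newElementOf y , restrict y) ≡ true →
              same (World-sum u b (ℕ.suc n)) y (extend ω (αβ , rc)) ≡ true
      from' e = ≐⇒sameWorld {ω = y} {ω' = extend ω (αβ , rc)}
                 ((λ { p zero → P.sym (eα p) ; p (suc i) → P.sym (wu p i) }) ,
                  (λ { r zero zero → P.sym (eβ r) ; r zero (suc j) → P.sym (er r j)
                     ; r (suc i) zero → P.sym (ec r i) ; r (suc i) (suc j) → P.sym (wb r i j) }))
        where
        e1 : same (NewElement-sum u b n) (αβ , rc) (newElementOf y) ≡ true
        e1 = ∧-elimˡ _ e
        e2 : same (World-sum u b n) ω (restrict y) ≡ true
        e2 = ∧-elimʳ (same (NewElement-sum u b n) (αβ , rc) (newElementOf y)) e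
        eαβ : same (Cellᶠ-sum u b) αβ (proj₁ (newElementOf y)) ≡ true
        eαβ = ∧-elimˡ _ e1
        erc : same (RowCol-sum b n) rc (proj₂ (newElementOf y)) ≡ true
        erc = ∧-elimʳ (same (Cellᶠ-sum u b) αβ (proj₁ (newElementOf y))) e1
        eα = sameFun⇒≡ u {proj₁ αβ} {λ p → unary y p zero} (∧-elimˡ _ eαβ)
        eβ = sameFun⇒≡ b {proj₂ αβ} {λ r → binary y r zero zero} (∧-elimʳ (same (Fun-sum u Bool-sum) (proj₁ αβ) (λ p → unary y p zero)) eαβ)
        er = sameUnary⇒≡ b n {proj₁ rc} {λ r j → binary y r zero (suc j)} (∧-elimˡ _ erc)
        ec = sameUnary⇒≡ b n {proj₂ rc} {λ r i → binary y r (suc i) zero}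
               (∧-elimʳ (same (Fun-sum b (Fun-sum n Bool-sum)) (proj₁ rc) (λ r j → binary y r zero (suc j))) erc)
        wu = proj₁ (sameWorld⇒≐ {ω = ω} {ω' = restrict y} e2)
        wb = proj₂ (sameWorld⇒≐ {ω = ω} {ω' = restrict y} e2)

  samePair⇒same₁ : ∀ {A B : Set} (OA : Summation A) (OB : Summation B) x y → same (Pair-sum OA OB) x y ≡ true →
          same OA (proj₁ x) (proj₁ y) ≡ true
  samePair⇒same₁ OA OB x y e = ∧-elimˡ (same OA (proj₁ x) (proj₁ y)) e

  samePair⇒same₂ : ∀ {A B : Set} (OA : Summation A) (OB : Summation B) x y → same (Pair-sum OA OB) x y ≡ true →
          same OB (proj₂ x) (proj₂ y) ≡ true
  samePair⇒same₂ OA OB x y e = ∧-elimʳ (same OA (proj₁ x) (proj₁ y)) e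

  sameCellᶠ⇒≡₁ : ∀ {u b} x y → same (Cellᶠ-sum u b) x y ≡ true → ∀ p → proj₁ x p ≡ proj₁ y p
  sameCellᶠ⇒≡₁ {u} {b} x y e = sameFun⇒≡ u (samePair⇒same₁ (Fun-sum u Bool-sum) (Fun-sum b Bool-sum) x y e)

  sameCellᶠ⇒≡₂ : ∀ {u b} x y → same (Cellᶠ-sum u b) x y ≡ true → ∀ r → proj₂ x r ≡ proj₂ y r
  sameCellᶠ⇒≡₂ {u} {b} x y e = sameFun⇒≡ b (samePair⇒same₂ (Fun-sum u Bool-sum) (Fun-sum b Bool-sum) x y e)

  ≡⇒sameCellᶠ : ∀ {u b} x y → (∀ p → proj₁ x p ≡ proj₁ y p) → (∀ r → proj₂ x r ≡ proj₂ y r) → same (Cellᶠ-sum u b) x y ≡ true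
  ≡⇒sameCellᶠ {u} {b} x y e1 e2 = ∧-intro (≡⇒sameFun u e1) (≡⇒sameFun b e2)

  respects-≐ : ∀ {u b n} (h : World u b n → Carrier) → (∀ {ω ω'} → ω ≐ ω' → h ω ≈ h ω') → Respects (World-sum u b n) h
  respects-≐ h hr ω ω' e = hr (sameWorld⇒≐ {ω = ω} {ω' = ω'} e)

  world₁ : ∀ {u b} → (Fin u → Bool) × (Fin b → Bool) → World u b 1
  world₁ x = world (λ p _ → proj₁ x p) (λ r _ _ → proj₂ x r)

  cellᶠOf₁ : ∀ {u b} → World u b 1 → (Fin u → Bool) × (Fin b → Bool)
  cellᶠOf₁ ω = (λ p → unary ω p zero) , (λ r → binary ω r zero zero)

  unary₂ : ∀ {u} → (Fin u → Bool) → (Fin u → Bool) → Fin u → Fin 2 → Bool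
  unary₂ α0 α1 p zero = α0 p
  unary₂ α0 α1 p (suc zero) = α1 p

  binary₂ : ∀ {b} → (Fin b → Bool) → (Fin b → Bool) → (Fin b → Bool) → (Fin b → Bool) → Fin b → Fin 2 → Fin 2 → Bool
  binary₂ β0 x y β1 r zero zero = β0 r
  binary₂ β0 x y β1 r zero (suc zero) = x r
  binary₂ β0 x y β1 r (suc zero) zero = y r
  binary₂ β0 x y β1 r (suc zero) (suc zero) = β1 r

  TwoElements : ℕ → ℕ → Set
  TwoElements u b = (((Fin u → Bool) × (Fin b → Bool)) × ((Fin u → Bool) × (Fin b → Bool))) × ((Fin b → Bool) × (Fin b → Bool))

  TwoElements-sum : ∀ u b → Summation (TwoElements u b)
  TwoElements-sum u b = Pair-sum (Pair-sum (Cellᶠ-sum u b) (Cellᶠ-sum u b)) (Cellᶠ-sum b b)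

  world₂ : ∀ {u b} → TwoElements u b → World u b 2
  world₂ d = world (unary₂ (proj₁ (proj₁ (proj₁ d))) (proj₁ (proj₂ (proj₁ d))))
               (binary₂ (proj₂ (proj₁ (proj₁ d))) (proj₁ (proj₂ d)) (proj₂ (proj₂ d)) (proj₂ (proj₂ (proj₁ d))))

  twoElementsOf : ∀ {u b} → World u b 2 → TwoElements u b
  twoElementsOf ω = (((λ p → unary ω p zero) , (λ r → binary ω r zero zero)) ,
            ((λ p → unary ω p (suc zero)) , (λ r → binary ω r (suc zero) (suc zero)))) ,
           ((λ r → binary ω r zero (suc zero)) , (λ r → binary ω r (suc zero) zero))

  sumWorlds-1 : ∀ {u b} (h : World u b 1 → Carrier) → Respects (World-sum u b 1) h →
          sumWorlds u b 1 h ≈ sum (Cellᶠ-sum u b) (λ x → h (world₁ x))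
  sumWorlds-1 {u} {b} h hr = sum-reindex (Cellᶠ-sum u b) (World-sum u b 1) world₁ cellᶠOf₁ cond h hr
    where
    cond : ∀ x y → same (World-sum u b 1) y (world₁ x) ≡ same (Cellᶠ-sum u b) x (cellᶠOf₁ y)
    cond x y = Bool-ext
      (λ e → let (pu , pb) = sameWorld⇒≐ {ω = y} {ω' = world₁ x} e in
             ≡⇒sameCellᶠ x (cellᶠOf₁ y) (λ p → P.sym (pu p zero)) (λ r → P.sym (pb r zero zero)))
      (λ e → ≐⇒sameWorld {ω = y} {ω' = world₁ x}
        ((λ { p zero → P.sym (sameCellᶠ⇒≡₁ x (cellᶠOf₁ y) e p) }) ,
         (λ { r zero zero → P.sym (sameCellᶠ⇒≡₂ x (cellᶠOf₁ y) e r) })))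

  sumWorlds-2 : ∀ {u b} (h : World u b 2 → Carrier) → Respects (World-sum u b 2) h →
          sumWorlds u b 2 h ≈ sum (TwoElements-sum u b) (λ x → h (world₂ x))
  sumWorlds-2 {u} {b} h hr = sum-reindex (TwoElements-sum u b) (World-sum u b 2) world₂ twoElementsOf cond h hr
    where
    cond : ∀ x y → same (World-sum u b 2) y (world₂ x) ≡ same (TwoElements-sum u b) x (twoElementsOf y)
    cond (((x0 , x1)) , xy) y = Bool-ext
      (λ e → let (pu , pb) = sameWorld⇒≐ {ω = y} {ω' = world₂ ((x0 , x1) , xy)} e in
             ∧-intro (∧-intro (≡⇒sameCellᶠ x0 _ (λ p → P.sym (pu p zero)) (λ r → P.sym (pb r zero zero)))
                            (≡⇒sameCellᶠ x1 _ (λ p → P.sym (pu p (suc zero))) (λ r → P.sym (pb r (suc zero) (suc zero)))))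
                    (≡⇒sameCellᶠ xy _ (λ r → P.sym (pb r zero (suc zero))) (λ r → P.sym (pb r (suc zero) zero))))
      (λ e → let e01 = samePair⇒same₁ (Pair-sum (Cellᶠ-sum u b) (Cellᶠ-sum u b)) (Cellᶠ-sum b b) ((x0 , x1) , xy) (twoElementsOf y) e
                 exy = samePair⇒same₂ (Pair-sum (Cellᶠ-sum u b) (Cellᶠ-sum u b)) (Cellᶠ-sum b b) ((x0 , x1) , xy) (twoElementsOf y) e
                 e0 = samePair⇒same₁ (Cellᶠ-sum u b) (Cellᶠ-sum u b) (x0 , x1) (proj₁ (twoElementsOf y)) e01
                 e1 = samePair⇒same₂ (Cellᶠ-sum u b) (Cellᶠ-sum u b) (x0 , x1) (proj₁ (twoElementsOf y)) e01
             in ≐⇒sameWorld {ω = y} {ω' = world₂ ((x0 , x1) , xy)}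
        ((λ { p zero → P.sym (sameCellᶠ⇒≡₁ x0 _ e0 p) ; p (suc zero) → P.sym (sameCellᶠ⇒≡₁ x1 _ e1 p) }) ,
         (λ { r zero zero → P.sym (sameCellᶠ⇒≡₂ x0 _ e0 r) ; r zero (suc zero) → P.sym (sameCellᶠ⇒≡₁ xy _ exy r)
            ; r (suc zero) zero → P.sym (sameCellᶠ⇒≡₂ xy _ exy r) ; r (suc zero) (suc zero) → P.sym (sameCellᶠ⇒≡₂ x1 _ e1 r) })))

  sum-rowCol-transpose : ∀ b n (g : Fin n → (Fin b → Bool) × (Fin b → Bool) → Carrier) →
     (∀ j → Respects (Cellᶠ-sum b b) (g j)) →
     sum (RowCol-sum b n) (λ rc → prodFin n (λ j → g j ((λ r → proj₁ rc r j) , (λ r → proj₂ rc r j)))) ≈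
     prodFin n (λ j → sum (Cellᶠ-sum b b) (g j))
  sum-rowCol-transpose b n g gr = trans (sum-reindex (Fun-sum n (Cellᶠ-sum b b)) (RowCol-sum b n) e e' cond h hr) (sumFun-prodFin (Cellᶠ-sum b b) n g)
    where
    e : (Fin n → (Fin b → Bool) × (Fin b → Bool)) → (Fin b → Fin n → Bool) × (Fin b → Fin n → Bool)
    e t = (λ r j → proj₁ (t j) r) , (λ r j → proj₂ (t j) r)
    e' : (Fin b → Fin n → Bool) × (Fin b → Fin n → Bool) → Fin n → (Fin b → Bool) × (Fin b → Bool)
    e' rc = λ j → (λ r → proj₁ rc r j) , (λ r → proj₂ rc r j)
    h : (Fin b → Fin n → Bool) × (Fin b → Fin n → Bool) → Carrier
    h rc = prodFin n (λ j → g j (e' rc j))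
    RC1 = Fun-sum b (Fun-sum n Bool-sum)
    cond : ∀ t rc → same (RowCol-sum b n) rc (e t) ≡ same (Fun-sum n (Cellᶠ-sum b b)) t (e' rc)
    cond t rc = Bool-ext
      (λ q → let q1 = sameUnary⇒≡ b n (samePair⇒same₁ RC1 RC1 rc (e t) q) ; q2 = sameUnary⇒≡ b n (samePair⇒same₂ RC1 RC1 rc (e t) q) in
             allFin-intro n (λ j → ≡⇒sameCellᶠ (t j) (e' rc j) (λ r → P.sym (q1 r j)) (λ r → P.sym (q2 r j))))
      (λ q → ∧-intro (≡⇒sameUnary b n {proj₁ rc} {λ r j → proj₁ (t j) r}
                       (λ r j → P.sym (sameCellᶠ⇒≡₁ (t j) (e' rc j) (allFin-elim n q j) r)))
                    (≡⇒sameUnary b n {proj₂ rc} {λ r j → proj₂ (t j) r}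
                       (λ r j → P.sym (sameCellᶠ⇒≡₂ (t j) (e' rc j) (allFin-elim n q j) r))))
    hr : Respects (RowCol-sum b n) h
    hr rc rc' q = prodFin-cong n (λ j → gr j (e' rc j) (e' rc' j)
      (≡⇒sameCellᶠ (e' rc j) (e' rc' j) (λ r → sameUnary⇒≡ b n (samePair⇒same₁ RC1 RC1 rc rc' q) r j)
                                (λ r → sameUnary⇒≡ b n (samePair⇒same₂ RC1 RC1 rc rc' q) r j)))

  module CellGraphFormula {u b} (M : Fm u b) (qf : quantifierFree M ≡ true) (W : Weighting u b) where
    G : CellGraph
    G = cellGraphᵘ M W

    litB : Fin b → Bool → Carrier
    litB r x = lit x (w₂ W r) (w̄₂ W r)

    CellSum = Cellᶠ-sum u b
    EdgeSum = Cellᶠ-sum b b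

    world₁-≐ : ∀ x x' → same CellSum x x' ≡ true → world₁ x ≐ world₁ x'
    world₁-≐ x x' e = (λ p i → sameCellᶠ⇒≡₁ x x' e p) , (λ r i j → sameCellᶠ⇒≡₂ x x' e r)

    vertexLabel-≈ : ∀ x → vlabel G (toCell x) ≈ ⟦ eval (world₁ x) ρAA M ⟧ * weight W (world₁ x)
    vertexLabel-≈ x = trans (sumWorlds-1 h hr) (trans (sum-cong CellSum pt) (sum-δ CellSum F Fr x))
      where
      h : World u b 1 → Carrier
      h ω = ⟦ eval ω ρAA M ∧ (cellOf ω zero ≟ᶜ toCell x) ⟧ * weight W ω
      hr : Respects (World-sum u b 1) h
      hr = respects-≐ h (λ {ω} {ω'} e → *-cong (⟦⟧-cong (P.cong₂ _∧_ (eval-≐ e ρAA M)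
                                  (P.cong (_≟ᶜ toCell x) (cellOf-≐ e zero)))) (weight-≐ W e))
      F : (Fin u → Bool) × (Fin b → Bool) → Carrier
      F x' = ⟦ eval (world₁ x') ρAA M ⟧ * weight W (world₁ x')
      Fr : Respects CellSum F
      Fr x' x'' e = *-cong (⟦⟧-cong (eval-≐ (world₁-≐ x' x'' e) ρAA M)) (weight-≐ W (world₁-≐ x' x'' e))
      pt : ∀ x' → h (world₁ x') ≈ ⟦ same CellSum x' x ⟧ * F x'
      pt x' = begin
        ⟦ eval (world₁ x') ρAA M ∧ (toCell x' ≟ᶜ toCell x) ⟧ * weight W (world₁ x')
          ≈⟨ *-congʳ (⟦∧⟧ (eval (world₁ x') ρAA M) (toCell x' ≟ᶜ toCell x)) ⟩
        (⟦ eval (world₁ x') ρAA M ⟧ * ⟦ toCell x' ≟ᶜ toCell x ⟧) * weight W (world₁ x')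
          ≈⟨ *-congʳ (*-congˡ (⟦⟧-cong (toCell-≟ᶜ x' x))) ⟩
        (⟦ eval (world₁ x') ρAA M ⟧ * ⟦ same CellSum x' x ⟧) * weight W (world₁ x')
          ≈⟨ Solver.solve 3 (λ a t w → (a ⊛ t) ⊛ w ⊜ t ⊛ (a ⊛ w)) refl _ _ _ ⟩
        ⟦ same CellSum x' x ⟧ * F x' ∎

    world₂-≐ : ∀ c0 c0' c1 c1' xy xy' → same CellSum c0 c0' ≡ true → same CellSum c1 c1' ≡ true → same EdgeSum xy xy' ≡ true →
         world₂ ((c0 , c1) , xy) ≐ world₂ ((c0' , c1') , xy')
    world₂-≐ c0 c0' c1 c1' xy xy' e0 e1 e2 =
      (λ { p zero → sameCellᶠ⇒≡₁ c0 c0' e0 p ; p (suc zero) → sameCellᶠ⇒≡₁ c1 c1' e1 p }) ,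
      (λ { r zero zero → sameCellᶠ⇒≡₂ c0 c0' e0 r ; r zero (suc zero) → sameCellᶠ⇒≡₁ xy xy' e2 r
         ; r (suc zero) zero → sameCellᶠ⇒≡₂ xy xy' e2 r ; r (suc zero) (suc zero) → sameCellᶠ⇒≡₂ c1 c1' e1 r })

    edgeWeight : (Fin b → Bool) × (Fin b → Bool) → Carrier
    edgeWeight xy = prodFin b (λ r → litB r (proj₁ xy r)) * prodFin b (λ r → litB r (proj₂ xy r))

    edgeTerm : (Fin u → Bool) × (Fin b → Bool) → (Fin u → Bool) × (Fin b → Bool) → (Fin b → Bool) × (Fin b → Bool) → Carrier
    edgeTerm x0 x1 xy = ⟦ eval (world₂ ((x0 , x1) , xy)) ρAB M ∧ eval (world₂ ((x0 , x1) , xy)) ρBA M ⟧ * edgeWeight xy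

    edgeTerm-resp : ∀ c0 c0' c1 c1' xy xy' → same CellSum c0 c0' ≡ true → same CellSum c1 c1' ≡ true → same EdgeSum xy xy' ≡ true →
              edgeTerm c0 c1 xy ≈ edgeTerm c0' c1' xy'
    edgeTerm-resp c0 c0' c1 c1' xy xy' e0 e1 e2 =
      *-cong (⟦⟧-cong (P.cong₂ _∧_ (eval-≐ w≐ ρAB M) (eval-≐ w≐ ρBA M)))
             (*-cong (prodFin-cong b (λ r → lit-cong (sameCellᶠ⇒≡₁ xy xy' e2 r) _ _))
                     (prodFin-cong b (λ r → lit-cong (sameCellᶠ⇒≡₂ xy xy' e2 r) _ _)))
      where w≐ = world₂-≐ c0 c0' c1 c1' xy xy' e0 e1 e2

    weight*-world₂ : ∀ d → weight* W (world₂ d) ≈ edgeWeight (proj₂ d)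
    weight*-world₂ d = begin
      prodFin u (λ p → prodFin 2 (λ i → 1#)) * prodFin b (λ r → prodFin 2 (λ i → prodFin 2 (λ j →
        if ⌊ i Fin.≟ j ⌋ then 1# else lit (binary (world₂ d) r i j) (w₂ W r) (w̄₂ W r))))
        ≈⟨ *-cong (trans (prodFin-cong u (λ p → prodFin-1 2)) (prodFin-1 u))
                  (prodFin-cong b (λ r → lem (litB r (proj₁ (proj₂ d) r)) (litB r (proj₂ (proj₂ d) r)))) ⟩
      1# * prodFin b (λ r → litB r (proj₁ (proj₂ d) r) * litB r (proj₂ (proj₂ d) r))
        ≈⟨ *-identityˡ _ ⟩
      prodFin b (λ r → litB r (proj₁ (proj₂ d) r) * litB r (proj₂ (proj₂ d) r))
        ≈⟨ prodFin-* b _ _ ⟩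
      edgeWeight (proj₂ d) ∎
      where
      lem : ∀ a c → (1# * (a * 1#)) * ((c * (1# * 1#)) * 1#) ≈ a * c
      lem a c = *-cong (trans (*-identityˡ _) (*-identityʳ a))
                       (trans (*-identityʳ _) (trans (*-congˡ (*-identityˡ 1#)) (*-identityʳ c)))

    edgeLabel-≈ : ∀ x0 x1 → elabel G (toCell x0) (toCell x1) ≈ sum EdgeSum (edgeTerm x0 x1)
    edgeLabel-≈ x0 x1 = begin
      elabel G (toCell x0) (toCell x1)
        ≈⟨ sumWorlds-2 h hr ⟩
      sum CellSum (λ c0 → sum CellSum (λ c1 → sum EdgeSum (λ xy → h (world₂ ((c0 , c1) , xy)))))
        ≈⟨ sum-cong CellSum (λ c0 → sum-cong CellSum (λ c1 → sum-cong EdgeSum (λ xy → pt c0 c1 xy))) ⟩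
      sum CellSum (λ c0 → sum CellSum (λ c1 → sum EdgeSum (λ xy → ⟦ same CellSum c0 x0 ⟧ * (⟦ same CellSum c1 x1 ⟧ * edgeTerm c0 c1 xy))))
        ≈⟨ sum-cong CellSum (λ c0 → trans (sum-cong CellSum (λ c1 → trans (sym (sum-*ˡ EdgeSum (⟦ same CellSum c0 x0 ⟧) _))
                                                          (*-congˡ (sym (sum-*ˡ EdgeSum (⟦ same CellSum c1 x1 ⟧) (edgeTerm c0 c1))))))
                                 (sym (sum-*ˡ CellSum _ _))) ⟩
      sum CellSum (λ c0 → ⟦ same CellSum c0 x0 ⟧ * sum CellSum (λ c1 → ⟦ same CellSum c1 x1 ⟧ * sum EdgeSum (edgeTerm c0 c1)))
        ≈⟨ sum-δ CellSum (λ c0 → sum CellSum (λ c1 → ⟦ same CellSum c1 x1 ⟧ * sum EdgeSum (edgeTerm c0 c1)))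
             (λ c0 c0' e → sum-cong CellSum (λ c1 → *-congˡ (sum-cong EdgeSum (λ xy →
                edgeTerm-resp c0 c0' c1 c1 xy xy e (same-refl CellSum c1) (same-refl EdgeSum xy))))) x0 ⟩
      sum CellSum (λ c1 → ⟦ same CellSum c1 x1 ⟧ * sum EdgeSum (edgeTerm x0 c1))
        ≈⟨ sum-δ CellSum (λ c1 → sum EdgeSum (edgeTerm x0 c1))
             (λ c1 c1' e → sum-cong EdgeSum (λ xy → edgeTerm-resp x0 x0 c1 c1' xy xy (same-refl CellSum x0) e (same-refl EdgeSum xy))) x1 ⟩
      sum EdgeSum (edgeTerm x0 x1) ∎
      where
      h : World u b 2 → Carrier
      h ω = ⟦ eval ω ρAB M ∧ eval ω ρBA M ∧ (cellOf ω zero ≟ᶜ toCell x0) ∧ (cellOf ω (suc zero) ≟ᶜ toCell x1) ⟧ * weight* W ω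
      hr : Respects (World-sum u b 2) h
      hr = respects-≐ h (λ {ω} {ω'} e → *-cong
        (⟦⟧-cong (P.cong₂ _∧_ (eval-≐ e ρAB M) (P.cong₂ _∧_ (eval-≐ e ρBA M)
           (P.cong₂ _∧_ (P.cong (_≟ᶜ toCell x0) (cellOf-≐ e zero)) (P.cong (_≟ᶜ toCell x1) (cellOf-≐ e (suc zero)))))))
        (*-congˡ (prodFin-cong b (λ r → prodFin-cong 2 (λ i → prodFin-cong 2 (λ j → wl e r i j))))))
        where
        wl : ∀ {ω ω' : World u b 2} → ω ≐ ω' → ∀ r i j →
             (if ⌊ i Fin.≟ j ⌋ then 1# else lit (binary ω r i j) (w₂ W r) (w̄₂ W r)) ≈
             (if ⌊ i Fin.≟ j ⌋ then 1# else lit (binary ω' r i j) (w₂ W r) (w̄₂ W r))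
        wl e r i j with ⌊ i Fin.≟ j ⌋
        ... | true = refl
        ... | false = lit-cong (proj₂ e r i j) _ _
      pt : ∀ c0 c1 xy → h (world₂ ((c0 , c1) , xy)) ≈ ⟦ same CellSum c0 x0 ⟧ * (⟦ same CellSum c1 x1 ⟧ * edgeTerm c0 c1 xy)
      pt c0 c1 xy = begin
        ⟦ ab ∧ ba ∧ (toCell c0 ≟ᶜ toCell x0) ∧ (toCell c1 ≟ᶜ toCell x1) ⟧ * weight* W ω
          ≈⟨ *-cong (trans (⟦∧⟧ ab _) (*-congˡ (trans (⟦∧⟧ ba _) (*-congˡ (⟦∧⟧ (toCell c0 ≟ᶜ toCell x0) _)))))
                    (weight*-world₂ ((c0 , c1) , xy)) ⟩
        (⟦ ab ⟧ * (⟦ ba ⟧ * (⟦ toCell c0 ≟ᶜ toCell x0 ⟧ * ⟦ toCell c1 ≟ᶜ toCell x1 ⟧))) * edgeWeight xy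
          ≈⟨ *-congʳ (*-congˡ (*-congˡ (*-cong (⟦⟧-cong (toCell-≟ᶜ c0 x0)) (⟦⟧-cong (toCell-≟ᶜ c1 x1))))) ⟩
        (⟦ ab ⟧ * (⟦ ba ⟧ * (⟦ same CellSum c0 x0 ⟧ * ⟦ same CellSum c1 x1 ⟧))) * edgeWeight xy
          ≈⟨ Solver.solve 5 (λ a b' t0 t1 l → (a ⊛ (b' ⊛ (t0 ⊛ t1))) ⊛ l ⊜ t0 ⊛ (t1 ⊛ ((a ⊛ b') ⊛ l))) refl _ _ _ _ _ ⟩
        ⟦ same CellSum c0 x0 ⟧ * (⟦ same CellSum c1 x1 ⟧ * ((⟦ ab ⟧ * ⟦ ba ⟧) * edgeWeight xy))
          ≈⟨ *-congˡ (*-congˡ (*-congʳ (sym (⟦∧⟧ ab ba)))) ⟩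
        ⟦ same CellSum c0 x0 ⟧ * (⟦ same CellSum c1 x1 ⟧ * edgeTerm c0 c1 xy) ∎
        where
        ω = world₂ ((c0 , c1) , xy)
        ab = eval ω ρAB M
        ba = eval ω ρBA M

    holds∀∀-≐ : ∀ {n} {ω ω' : World u b n} → ω ≐ ω' → holds∀∀ M ω ≡ holds∀∀ M ω'
    holds∀∀-≐ {n} e = allFin-cong n (λ a → allFin-cong n (λ a' → eval-≐ e _ M))

    summand : ∀ n → ((Fin n → Cell u b) → Carrier) → World u b n → Carrier
    summand n F ω = (⟦ holds∀∀ M ω ⟧ * weight W ω) * F (cellOf ω)

    summand-respects : ∀ n F → Extensional F → Respects (World-sum u b n) (summand n F)
    summand-respects n F FR = respects-≐ (summand n F) (λ {ω} {ω'} e →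
      *-cong (*-cong (⟦⟧-cong (holds∀∀-≐ e)) (weight-≐ W e)) (FR _ _ (cellOf-≐ e)))

    worldSum : ∀ n → ((Fin n → Cell u b) → Carrier) → Carrier
    worldSum n F = sumWorlds u b n (summand n F)

    cellᶠAt : ∀ {n} → World u b n → Fin n → (Fin u → Bool) × (Fin b → Bool)
    cellᶠAt ω j = (λ p → unary ω p j) , (λ r → binary ω r j j)

    rowColAt : ∀ {n} → ((Fin b → Fin n → Bool) × (Fin b → Fin n → Bool)) → Fin n → (Fin b → Bool) × (Fin b → Bool)
    rowColAt rc j = (λ r → proj₁ rc r j) , (λ r → proj₂ rc r j)

    -- Adding an element with cell αβ and links rc to the old elements factorises the summand into the vertex
    -- term of αβ, one edge term per old element, and the summand of the old world ω.
    module Extension {n} (ω : World u b n) (αβ : (Fin u → Bool) × (Fin b → Bool))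
                (rc : (Fin b → Fin n → Bool) × (Fin b → Fin n → Bool)) where
      ω' = extend ω (αβ , rc)
      E : Fin (ℕ.suc n) → Fin (ℕ.suc n) → Bool
      E a a' = eval ω' (env₂ a a') M
      pairWith : Fin n → TwoElements u b
      pairWith j = (αβ , cellᶠAt ω j) , rowColAt rc j

      eval-new-new : E zero zero ≡ eval (world₁ αβ) ρAA M
      eval-new-new = eval-quantifierFree M qf ω' (world₁ αβ) (env₂ zero zero) ρAA
             (λ { p vx → P.refl ; p vy → P.refl })
             (λ { r vx vx → P.refl ; r vx vy → P.refl ; r vy vx → P.refl ; r vy vy → P.refl })

      eval-new-old : ∀ j → E zero (suc j) ≡ eval (world₂ (pairWith j)) ρAB M
      eval-new-old j = eval-quantifierFree M qf ω' (world₂ (pairWith j)) (env₂ zero (suc j)) ρAB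
             (λ { p vx → P.refl ; p vy → P.refl })
             (λ { r vx vx → P.refl ; r vx vy → P.refl ; r vy vx → P.refl ; r vy vy → P.refl })

      eval-old-new : ∀ j → E (suc j) zero ≡ eval (world₂ (pairWith j)) ρBA M
      eval-old-new j = eval-quantifierFree M qf ω' (world₂ (pairWith j)) (env₂ (suc j) zero) ρBA
             (λ { p vx → P.refl ; p vy → P.refl })
             (λ { r vx vx → P.refl ; r vx vy → P.refl ; r vy vx → P.refl ; r vy vy → P.refl })

      eval-old-old : ∀ i j → E (suc i) (suc j) ≡ eval ω (env₂ i j) M
      eval-old-old i j = eval-quantifierFree M qf ω' ω (env₂ (suc i) (suc j)) (env₂ i j)
             (λ { p vx → P.refl ; p vy → P.refl })
             (λ { r vx vx → P.refl ; r vx vy → P.refl ; r vy vx → P.refl ; r vy vy → P.refl })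

      edgeTruths : Carrier
      edgeTruths = prodFin n (λ j → ⟦ E zero (suc j) ⟧ * ⟦ E (suc j) zero ⟧)

      holds∀∀-extend : ⟦ holds∀∀ M ω' ⟧ ≈ (⟦ E zero zero ⟧ * edgeTruths) * ⟦ holds∀∀ M ω ⟧
      holds∀∀-extend = begin
        ⟦ (E zero zero ∧ allFin n (λ j → E zero (suc j))) ∧ allFin n (λ i → E (suc i) zero ∧ allFin n (λ j → E (suc i) (suc j))) ⟧
          ≈⟨ trans (⟦∧⟧ (E zero zero ∧ allFin n (λ j → E zero (suc j))) _)
                   (*-cong (⟦∧⟧ (E zero zero) (allFin n (λ j → E zero (suc j))))
                           (⟦⟧-cong (allFin-∧ n (λ i → E (suc i) zero) (λ i → allFin n (λ j → E (suc i) (suc j)))))) ⟩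
        (⟦ E zero zero ⟧ * ⟦ allFin n (λ j → E zero (suc j)) ⟧) *
          ⟦ allFin n (λ i → E (suc i) zero) ∧ allFin n (λ i → allFin n (λ j → E (suc i) (suc j))) ⟧
          ≈⟨ *-congˡ (trans (⟦∧⟧ (allFin n (λ i → E (suc i) zero)) (allFin n (λ i → allFin n (λ j → E (suc i) (suc j)))))
                            (*-congˡ (⟦⟧-cong (allFin-cong n (λ i → allFin-cong n (λ j → eval-old-old i j)))))) ⟩
        (⟦ E zero zero ⟧ * ⟦ allFin n (λ j → E zero (suc j)) ⟧) *
          (⟦ allFin n (λ i → E (suc i) zero) ⟧ * ⟦ holds∀∀ M ω ⟧)
          ≈⟨ Solver.solve 4 (λ e p q o → (e ⊛ p) ⊛ (q ⊛ o) ⊜ (e ⊛ (p ⊛ q)) ⊛ o) refl _ _ _ _ ⟩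
        (⟦ E zero zero ⟧ * (⟦ allFin n (λ j → E zero (suc j)) ⟧ * ⟦ allFin n (λ i → E (suc i) zero) ⟧)) * ⟦ holds∀∀ M ω ⟧
          ≈⟨ *-congʳ (*-congˡ (trans (*-cong (⟦allFin⟧ n (λ j → E zero (suc j))) (⟦allFin⟧ n (λ j → E (suc j) zero)))
                                     (sym (prodFin-* n (λ j → ⟦ E zero (suc j) ⟧) (λ j → ⟦ E (suc j) zero ⟧))))) ⟩
        (⟦ E zero zero ⟧ * edgeTruths) * ⟦ holds∀∀ M ω ⟧ ∎

      α = proj₁ αβ
      β = proj₂ αβ
      row = proj₁ rc
      col = proj₂ rc
      litU : Fin u → Bool → Carrier
      litU p x = lit x (w₁ W p) (w̄₁ W p)
      pa = prodFin u (λ p → litU p (α p))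
      pb = prodFin b (λ r → litB r (β r))
      WU = prodFin u (λ p → prodFin n (λ i → litU p (unary ω p i)))
      WB = prodFin b (λ r → prodFin n (λ i → prodFin n (λ j → litB r (binary ω r i j))))
      Rw = prodFin b (λ r → prodFin n (λ j → litB r (row r j)))
      Cw = prodFin b (λ r → prodFin n (λ j → litB r (col r j)))
      edgeWeights = prodFin n (λ j → edgeWeight (rowColAt rc j))

      rowCol-weights : Rw * Cw ≈ edgeWeights
      rowCol-weights = trans (*-cong (prodFin-swap b n _) (prodFin-swap b n _)) (sym (prodFin-* n _ _))

      weight-extend : weight W ω' ≈ ((pa * pb) * edgeWeights) * weight W ω
      weight-extend = begin
        weight W ω'
          ≈⟨ *-cong (prodFin-* u (λ p → litU p (α p)) (λ p → prodFin n (λ i → litU p (unary ω p i))))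
                    (trans (prodFin-cong b (λ r → *-congˡ (prodFin-* n (λ i → litB r (col r i))
                                                             (λ i → prodFin n (λ j → litB r (binary ω r i j))))))
                    (trans (prodFin-* b (λ r → litB r (β r) * prodFin n (λ j → litB r (row r j)))
                                        (λ r → prodFin n (λ i → litB r (col r i)) * prodFin n (λ i → prodFin n (λ j → litB r (binary ω r i j)))))
                           (*-cong (prodFin-* b _ _) (prodFin-* b _ _)))) ⟩
        (pa * WU) * ((pb * Rw) * (Cw * WB))
          ≈⟨ Solver.solve 6 (λ a wu b' r c wb → (a ⊛ wu) ⊛ ((b' ⊛ r) ⊛ (c ⊛ wb)) ⊜ ((a ⊛ b') ⊛ (r ⊛ c)) ⊛ (wu ⊛ wb)) refl _ _ _ _ _ _ ⟩
        ((pa * pb) * (Rw * Cw)) * (WU * WB)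
          ≈⟨ *-congʳ (*-congˡ rowCol-weights) ⟩
        ((pa * pb) * edgeWeights) * weight W ω ∎

      weight-world₁ : weight W (world₁ αβ) ≈ pa * pb
      weight-world₁ = *-cong (prodFin-cong u (λ p → *-identityʳ _))
                    (prodFin-cong b (λ r → trans (*-identityʳ _) (*-identityʳ _)))

      edgeTerms-factor : prodFin n (λ j → edgeTerm αβ (cellᶠAt ω j) (rowColAt rc j)) ≈ edgeTruths * edgeWeights
      edgeTerms-factor = trans (prodFin-cong n (λ j → *-congʳ (trans (⟦∧⟧ (eval (world₂ (pairWith j)) ρAB M) (eval (world₂ (pairWith j)) ρBA M))
                                                   (*-cong (⟦⟧-cong (P.sym (eval-new-old j))) (⟦⟧-cong (P.sym (eval-old-new j)))))))
                  (prodFin-* n _ _)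

      module _ (F : (Fin (ℕ.suc n) → Cell u b) → Carrier) (FR : Extensional F) where
        rest = (⟦ holds∀∀ M ω ⟧ * weight W ω) * F (cons (toCell αβ) (cellOf ω))
        vertexTerm = ⟦ eval (world₁ αβ) ρAA M ⟧ * weight W (world₁ αβ)
        edgeTerms = prodFin n (λ j → edgeTerm αβ (cellᶠAt ω j) (rowColAt rc j))

        summand-extend : summand (ℕ.suc n) F ω' ≈ (vertexTerm * edgeTerms) * rest
        summand-extend = begin
          (⟦ holds∀∀ M ω' ⟧ * weight W ω') * F (cellOf ω')
            ≈⟨ *-cong (*-cong holds∀∀-extend weight-extend) (FR _ _ (λ { zero → P.refl ; (suc i) → P.refl })) ⟩
          (((⟦ E zero zero ⟧ * edgeTruths) * ⟦ holds∀∀ M ω ⟧) * (((pa * pb) * edgeWeights) * weight W ω)) * F (cons (toCell αβ) (cellOf ω))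
            ≈⟨ Solver.solve 7 (λ e x o p y w f → (((e ⊛ x) ⊛ o) ⊛ ((p ⊛ y) ⊛ w)) ⊛ f ⊜ ((e ⊛ p) ⊛ (x ⊛ y)) ⊛ ((o ⊛ w) ⊛ f))
                 refl _ _ _ _ _ _ _ ⟩
          ((⟦ E zero zero ⟧ * (pa * pb)) * (edgeTruths * edgeWeights)) * rest
            ≈⟨ *-congʳ (*-cong (*-cong (⟦⟧-cong eval-new-new) (sym weight-world₁)) (sym edgeTerms-factor)) ⟩
          (vertexTerm * edgeTerms) * rest ∎

    sum-extensions : ∀ n (ω : World u b n) F → Extensional F →
      sum (NewElement-sum u b n) (λ d → summand (ℕ.suc n) F (extend ω d)) ≈ (⟦ holds∀∀ M ω ⟧ * weight W ω) * cellGraphStep G n F (cellOf ω)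
    sum-extensions n ω F FR = begin
      sum CellSum (λ αβ → sum (RowCol-sum b n) (λ rc → summand (ℕ.suc n) F (extend ω (αβ , rc))))
        ≈⟨ sum-cong CellSum (λ αβ → sum-cong (RowCol-sum b n) (λ rc → Extension.summand-extend ω αβ rc F FR)) ⟩
      sum CellSum (λ αβ → sum (RowCol-sum b n) (λ rc → (vertexTerm αβ * edgeTerms αβ rc) * rest αβ))
        ≈⟨ sum-cong CellSum (λ αβ → trans (sym (sum-*ʳ (RowCol-sum b n) (rest αβ) (λ rc → vertexTerm αβ * edgeTerms αβ rc)))
                                 (*-congʳ (sym (sum-*ˡ (RowCol-sum b n) (vertexTerm αβ) (edgeTerms αβ))))) ⟩
      sum CellSum (λ αβ → (vertexTerm αβ * sum (RowCol-sum b n) (edgeTerms αβ)) * rest αβ)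
        ≈⟨ sum-cong CellSum (λ αβ → *-congʳ (*-congˡ (sum-rowCol-transpose b n (λ j → edgeTerm αβ (cellᶠAt ω j))
              (λ j xy xy' e → edgeTerm-resp αβ αβ (cellᶠAt ω j) (cellᶠAt ω j) xy xy' (same-refl CellSum _) (same-refl CellSum _) e)))) ⟩
      sum CellSum (λ αβ → (vertexTerm αβ * prodFin n (λ j → sum EdgeSum (edgeTerm αβ (cellᶠAt ω j)))) * rest αβ)
        ≈⟨ sum-cong CellSum (λ αβ → *-congʳ (*-cong (sym (vertexLabel-≈ αβ)) (prodFin-cong n (λ j → sym (edgeLabel-≈ αβ (cellᶠAt ω j)))))) ⟩
      sum CellSum (λ αβ → (vlabel G (toCell αβ) * prodFin n (λ j → elabel G (toCell αβ) (cellOf ω j))) * rest αβ)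
        ≈⟨ sum-cong CellSum (λ αβ → Solver.solve 4 (λ v e o f → (v ⊛ e) ⊛ (o ⊛ f) ⊜ o ⊛ (v ⊛ (e ⊛ f))) refl
                             (vlabel G (toCell αβ)) (prodFin n (λ j → elabel G (toCell αβ) (cellOf ω j)))
                             (⟦ holds∀∀ M ω ⟧ * weight W ω) (F (cons (toCell αβ) (cellOf ω)))) ⟩
      sum CellSum (λ αβ → (⟦ holds∀∀ M ω ⟧ * weight W ω) * (vlabel G (toCell αβ) *
                     (prodFin n (λ j → elabel G (toCell αβ) (cellOf ω j)) * F (cons (toCell αβ) (cellOf ω)))))
        ≈⟨ sym (sum-*ˡ CellSum _ _) ⟩
      (⟦ holds∀∀ M ω ⟧ * weight W ω) * cellGraphStep G n F (cellOf ω) ∎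
      where
      rest : _ → Carrier
      rest αβ = (⟦ holds∀∀ M ω ⟧ * weight W ω) * F (cons (toCell αβ) (cellOf ω))
      vertexTerm : _ → Carrier
      vertexTerm αβ = ⟦ eval (world₁ αβ) ρAA M ⟧ * weight W (world₁ αβ)
      edgeTerms : _ → _ → Carrier
      edgeTerms αβ rc = prodFin n (λ j → edgeTerm αβ (cellᶠAt ω j) (rowColAt rc j))

    worldSum≈cellGraphSum : ∀ n F → Extensional F → worldSum n F ≈ cellGraphSum G n F
    worldSum≈cellGraphSum ℕ.zero F FR = begin
      sumWorlds u b 0 (summand 0 F)
        ≈⟨ sum-cong (World-sum u b 0) (λ ω → trans (sym (*-identityˡ _))
              (*-congʳ (⟦⟧-cong (P.sym (≐⇒sameWorld {ω = ω} {ω' = ω₀} ((λ _ → λ ()) , (λ _ → λ ()))))))) ⟩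
      sum (World-sum u b 0) (λ ω → ⟦ same (World-sum u b 0) ω ω₀ ⟧ * summand 0 F ω)
        ≈⟨ sum-δ (World-sum u b 0) (summand 0 F) (summand-respects 0 F FR) ω₀ ⟩
      (1# * (prodFin u (λ _ → 1#) * prodFin b (λ _ → 1#))) * F (cellOf ω₀)
        ≈⟨ *-cong (trans (*-identityˡ _) (trans (*-cong (prodFin-1 u) (prodFin-1 b)) (*-identityˡ 1#)))
                  (FR _ _ (λ ())) ⟩
      1# * F (λ ())
        ≈⟨ *-identityˡ _ ⟩
      cellGraphSum G 0 F ∎
      where
      ω₀ : World u b 0
      ω₀ = world (λ _ → λ ()) (λ _ → λ ())
    worldSum≈cellGraphSum (ℕ.suc n) F FR = begin
      sumWorlds u b (ℕ.suc n) (summand (ℕ.suc n) F)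
        ≈⟨ sumWorlds-suc (summand (ℕ.suc n) F) (summand-respects (ℕ.suc n) F FR) ⟩
      sum (NewElement-sum u b n) (λ d → sumWorlds u b n (λ ω → summand (ℕ.suc n) F (extend ω d)))
        ≈⟨ sym (sum-interchange (NewElement-sum u b n) (sumWorlds u b n) (sum-additive (World-sum u b n)) (λ d ω → summand (ℕ.suc n) F (extend ω d))) ⟩
      sumWorlds u b n (λ ω → sum (NewElement-sum u b n) (λ d → summand (ℕ.suc n) F (extend ω d)))
        ≈⟨ sum-cong (World-sum u b n) (λ ω → sum-extensions n ω F FR) ⟩
      worldSum n (cellGraphStep G n F)
        ≈⟨ worldSum≈cellGraphSum n (cellGraphStep G n F) (cellGraphStep-extensional G n F FR) ⟩
      cellGraphSum G (ℕ.suc n) F ∎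

  -- Summing out the auxiliary predicates

  Unary-sum-split : ∀ m k n (h : (Fin (m ℕ.+ k) → Fin n → Bool) → Carrier) → Respects (Unary-sum (m ℕ.+ k) n) h →
           sum (Unary-sum (m ℕ.+ k) n) h ≈ sum (Unary-sum m n) (λ A → sum (Unary-sum k n) (λ B → h (joinF m A B)))
  Unary-sum-split m k n h hr = sum-reindex (Pair-sum (Unary-sum m n) (Unary-sum k n)) (Unary-sum (m ℕ.+ k) n)
      (λ x → joinF m (proj₁ x) (proj₂ x)) (λ C → (λ i → C (i Fin.↑ˡ k)) , (λ j → C (m Fin.↑ʳ j))) cond h hr
    where
    cond : ∀ x C → same (Unary-sum (m ℕ.+ k) n) C (joinF m (proj₁ x) (proj₂ x)) ≡
                   same (Pair-sum (Unary-sum m n) (Unary-sum k n)) x ((λ i → C (i Fin.↑ˡ k)) , (λ j → C (m Fin.↑ʳ j)))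
    cond (A , B) C = Bool-ext
      (λ e → let pc = sameUnary⇒≡ (m ℕ.+ k) n e in
        ∧-intro (≡⇒sameUnary m n {A} {λ i → C (i Fin.↑ˡ k)}
                  (λ i y → P.sym (P.trans (pc (i Fin.↑ˡ k) y) (P.cong (λ z → z y) (joinF-↑ˡ m k A B i)))))
               (≡⇒sameUnary k n {B} {λ j → C (m Fin.↑ʳ j)}
                  (λ i y → P.sym (P.trans (pc (m Fin.↑ʳ i) y) (P.cong (λ z → z y) (joinF-↑ʳ m k A B i))))))
      (λ e → let pA = sameUnary⇒≡ m n (samePair⇒same₁ (Unary-sum m n) (Unary-sum k n) (A , B) _ e)
                 pB = sameUnary⇒≡ k n (samePair⇒same₂ (Unary-sum m n) (Unary-sum k n) (A , B) _ e) in
        ≡⇒sameUnary (m ℕ.+ k) n {C} {joinF m A B}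
          (joinF-char m k C A B (λ i y → P.sym (pA i y)) (λ i y → P.sym (pB i y))))

  SumAuxCanonical : ∀ {u b} → ℕ → Fm u b → Set (c ⊔ ℓ)
  SumAuxCanonical {u} {b} n φ = (ω : World u b n) (H : (Fin (nq φ) → Fin n → Bool) → Carrier) →
    Respects (Unary-sum (nq φ) n) H →
    sum (Unary-sum (nq φ) n) (λ A → ⟦ normalFormHolds φ (ω ⊕ A) ⟧ * H A) ≈ H (canonicalAux φ ω)

  sumAux-noAux : ∀ n (H : (Fin 0 → Fin n → Bool) → Carrier) → Respects (Unary-sum 0 n) H → ∀ {A A'} →
    ⟦ allFin n (λ _ → allFin n (λ _ → true)) ∧ true ⟧ * H A ≈ H A'
  sumAux-noAux n H Hr =
    trans (*-congʳ (⟦⟧-cong (P.cong (_∧ true) (allFin-intro n (λ _ → allFin-intro n (λ _ → P.refl))))))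
          (trans (*-identityˡ _) (Hr _ _ P.refl))

  sumAux-canonical-∧ : ∀ {u b n} (φ ψ : Fm u b) →
    SumAuxCanonical n φ → SumAuxCanonical n ψ → SumAuxCanonical n (φ ∧' ψ)
  sumAux-canonical-∧ {n = n} φ ψ IHφ IHψ ω H Hr = begin
     sum (Unary-sum (m ℕ.+ k) n) (λ A → ⟦ normalFormHolds (φ ∧' ψ) (ω ⊕ A) ⟧ * H A)
       ≈⟨ Unary-sum-split m k n _ hr ⟩
     sum (Unary-sum m n) (λ AL → sum (Unary-sum k n) (λ AR →
       ⟦ normalFormHolds (φ ∧' ψ) (ω ⊕ joinF m AL AR) ⟧ * H (joinF m AL AR)))
       ≈⟨ sum-cong (Unary-sum m n) (λ AL → sum-cong (Unary-sum k n) (λ AR → factor AL AR)) ⟩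
     sum (Unary-sum m n) (λ AL → sum (Unary-sum k n) (λ AR →
       ⟦ normalFormHolds φ (ω ⊕ AL) ⟧ * (⟦ normalFormHolds ψ (ω ⊕ AR) ⟧ * H (joinF m AL AR))))
       ≈⟨ sum-cong (Unary-sum m n) (λ AL → sym (sum-*ˡ (Unary-sum k n) _ _)) ⟩
     sum (Unary-sum m n) (λ AL → ⟦ normalFormHolds φ (ω ⊕ AL) ⟧ *
       sum (Unary-sum k n) (λ AR → ⟦ normalFormHolds ψ (ω ⊕ AR) ⟧ * H (joinF m AL AR)))
       ≈⟨ sum-cong (Unary-sum m n) (λ AL → *-congˡ (IHψ ω (λ AR → H (joinF m AL AR))
             (λ B B' e → Hr _ _ (≡⇒sameUnary (m ℕ.+ k) n (joinF-respR m k n AL B B' (sameUnary⇒≡ k n e)))))) ⟩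
     sum (Unary-sum m n) (λ AL → ⟦ normalFormHolds φ (ω ⊕ AL) ⟧ * H (joinF m AL (canonicalAux ψ ω)))
       ≈⟨ IHφ ω (λ AL → H (joinF m AL (canonicalAux ψ ω)))
             (λ A A' e → Hr _ _ (≡⇒sameUnary (m ℕ.+ k) n (joinF-respL m k n A A' _ (sameUnary⇒≡ m n e)))) ⟩
     H (joinF m (canonicalAux φ ω) (canonicalAux ψ ω)) ∎
    where
    m = nq φ
    k = nq ψ
    hr : Respects (Unary-sum (m ℕ.+ k) n) (λ A → ⟦ normalFormHolds (φ ∧' ψ) (ω ⊕ A) ⟧ * H A)
    hr A A' e = *-cong (⟦⟧-cong (normalFormHolds-≐ (φ ∧' ψ) (⊕-cong ω (sameUnary⇒≡ (m ℕ.+ k) n e)))) (Hr A A' e)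
    factor : ∀ AL AR → ⟦ normalFormHolds (φ ∧' ψ) (ω ⊕ joinF m AL AR) ⟧ * H (joinF m AL AR) ≈
                       ⟦ normalFormHolds φ (ω ⊕ AL) ⟧ * (⟦ normalFormHolds ψ (ω ⊕ AR) ⟧ * H (joinF m AL AR))
    factor AL AR = trans (*-congʳ (trans (⟦⟧-cong (P.trans (normalFormHolds-∧ φ ψ ω (joinF m AL AR))
                     (P.cong₂ _∧_ (normalFormHolds-≐ φ (joinL-≐ m k ω AL AR)) (normalFormHolds-≐ ψ (joinR-≐ m k ω AL AR)))))
                   (⟦∧⟧ (normalFormHolds φ (ω ⊕ AL)) (normalFormHolds ψ (ω ⊕ AR)))))
                   (*-assoc _ _ _)

  -- The new auxiliary predicate of a quantified subformula is forced to be its truth value (a Kronecker δ).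
  sumAux-canonical-quantifier : ∀ {u b n} (φ : Fm u b) → SumAuxCanonical n φ → (ω : World u b n)
    (NF defines : (Fin (ℕ.suc (nq φ)) → Fin n → Bool) → Bool) (value : Fin n → Bool) →
    (∀ A → NF A ≡ defines A ∧ normalFormHolds φ (ω ⊕ (λ i → A (suc i)))) →
    (∀ {A A'} → (ω ⊕ A) ≐ (ω ⊕ A') → defines A ≡ defines A') →
    (∀ A → (∀ i y → A (suc i) y ≡ canonicalAux φ ω i y) →
       defines A ≡ allFin n (λ w → beq (A zero w) (value w))) →
    (H : (Fin (ℕ.suc (nq φ)) → Fin n → Bool) → Carrier) → Respects (Unary-sum (ℕ.suc (nq φ)) n) H →
    sum (Unary-sum (ℕ.suc (nq φ)) n) (λ A → ⟦ NF A ⟧ * H A) ≈ H (cons value (canonicalAux φ ω))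
  sumAux-canonical-quantifier {n = n} φ IH ω NF defines value split defines-≐ defines-canonical H Hr =
    trans (sum-cong Bools (λ a → sum-cong (Unary-sum m n) (λ A' → factor A' _ (λ i y → P.refl))))
    (trans (sum-cong Bools (λ a → IH ω _ (λ A1 A2 e → *-cong
              (⟦⟧-cong (defines-≐ (⊕-cong ω (λ { zero y → P.refl ; (suc j) y → sameUnary⇒≡ m n e j y }))))
              (Hr _ _ (∧-intro (same-refl Bools a) e)))))
    (trans (sum-cong Bools (λ a → *-congʳ (⟦⟧-cong (defines-canonical _ (λ _ _ → P.refl)))))
    (trans (sum-δ Bools _ (λ a a' e → Hr _ _ (∧-intro e (same-refl (Unary-sum m n) (canonicalAux φ ω)))) _)
           (Hr _ _ (∧-intro (same-refl Bools _) (same-refl (Unary-sum m n) (canonicalAux φ ω)))))))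
    where
    m = nq φ
    Bools = Fun-sum n Bool-sum
    factor : ∀ A' A → (∀ i y → A (suc i) y ≡ A' i y) →
             ⟦ NF A ⟧ * H A ≈ ⟦ normalFormHolds φ (ω ⊕ A') ⟧ * (⟦ defines A ⟧ * H A)
    factor A' A hs = begin
      ⟦ NF A ⟧ * H A
        ≈⟨ *-congʳ (trans (⟦⟧-cong (P.trans (split A) (P.cong (defines A ∧_) (normalFormHolds-≐ φ (⊕-cong ω hs)))))
                          (⟦∧⟧ (defines A) (normalFormHolds φ (ω ⊕ A')))) ⟩
      (⟦ defines A ⟧ * ⟦ normalFormHolds φ (ω ⊕ A') ⟧) * H A
        ≈⟨ Solver.solve 3 (λ d g h → (d ⊛ g) ⊛ h ⊜ g ⊛ (d ⊛ h)) refl _ _ _ ⟩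
      ⟦ normalFormHolds φ (ω ⊕ A') ⟧ * (⟦ defines A ⟧ * H A) ∎

  sumAux-canonical : ∀ {u b n} (φ : Fm u b) → SumAuxCanonical n φ
  sumAux-canonical {n = n} (atom₁ _ _) ω H Hr = sumAux-noAux n H Hr
  sumAux-canonical {n = n} (atom₂ _ _ _) ω H Hr = sumAux-noAux n H Hr
  sumAux-canonical (¬' φ) = sumAux-canonical φ
  sumAux-canonical (φ ∧' ψ) = sumAux-canonical-∧ φ ψ (sumAux-canonical φ) (sumAux-canonical ψ)
  sumAux-canonical (φ ∨' ψ) = sumAux-canonical-∧ φ ψ (sumAux-canonical φ) (sumAux-canonical ψ)
  sumAux-canonical (∀' v φ) ω = sumAux-canonical-quantifier φ (sumAux-canonical φ) ω
    (λ A → normalFormHolds (∀' v φ) (ω ⊕ A)) (defines∀ v φ ω) (λ a → eval ω (λ _ → a) (∀' v φ))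
    (normalFormHolds-∀ v φ ω) (defines∀-≐ v φ ω)
    (λ A → CanonicalDefinition.defines∀≡ v φ ω A (A zero) (λ _ → P.refl))
  sumAux-canonical (∃' v φ) ω = sumAux-canonical-quantifier φ (sumAux-canonical φ) ω
    (λ A → normalFormHolds (∃' v φ) (ω ⊕ A)) (defines∃ v φ ω) (λ a → eval ω (λ _ → a) (∃' v φ))
    (normalFormHolds-∃ v φ ω) (defines∃-≐ v φ ω)
    (λ A → CanonicalDefinition.defines∃≡ v φ ω A (A zero) (λ _ → P.refl))

  -- Summing out the Skolem predicates

  skolemWeight : Bool → Carrier
  skolemWeight s = lit s 1# (- 1#)

  sum-skolemLiteral : ∀ N → sumBool (λ s → ⟦ s ∨ N ⟧ * skolemWeight s) ≈ ⟦ not N ⟧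
  sum-skolemLiteral true = trans (+-cong (*-identityˡ 1#) (*-identityˡ (- 1#))) (-‿inverseʳ 1#)
  sum-skolemLiteral false = trans (+-cong (*-identityˡ 1#) (zeroˡ (- 1#))) (+-identityʳ 1#)

  sum-skolem : ∀ q n (N : Fin q → Fin n → Bool) →
    sum (Unary-sum q n) (λ Sk → prodFin q (λ k → prodFin n (λ a → ⟦ Sk k a ∨ N k a ⟧ * skolemWeight (Sk k a)))) ≈
    prodFin q (λ k → prodFin n (λ a → ⟦ not (N k a) ⟧))
  sum-skolem q n N = trans (sumFun-prodFin (Fun-sum n Bool-sum) q (λ k f → prodFin n (λ a → ⟦ f a ∨ N k a ⟧ * skolemWeight (f a))))
    (prodFin-cong q (λ k → trans (sumFun-prodFin Bool-sum n (λ a s → ⟦ s ∨ N k a ⟧ * skolemWeight s))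
                                 (prodFin-cong n (λ a → sum-skolemLiteral (N k a)))))

  module Skolemization {u b} (φ : Fm u b) (W : Weighting u b) where
    W' = skWeighting φ W
    open SkolemMatrix φ

    w1U w̄1U : Fin uA → Carrier
    w1U = joinF u (w₁ W) (λ _ → 1#)
    w̄1U = joinF u (w̄₁ W) (λ _ → 1#)

    weight-skolemized : ∀ {n} (ω : World u b n) (A : Fin q → Fin n → Bool) (Sk : Fin q → Fin n → Bool) →
      weight W' ((ω ⊕ A) ⊕ Sk) ≈ weight W ω * prodFin q (λ k → prodFin n (λ a → skolemWeight (Sk k a)))
    weight-skolemized {n} ω A Sk = begin
      prodFin (uA ℕ.+ q) fU * BIN
        ≈⟨ *-congʳ (prodFin-+ uA q fU) ⟩
      (prodFin uA (λ i → fU (i Fin.↑ˡ q)) * prodFin q (λ k → fU (uA Fin.↑ʳ k))) * BIN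
        ≈⟨ *-congʳ (*-cong (trans (prodFin-cong uA gL) (prodFin-+ u q g)) (prodFin-cong q gR)) ⟩
      ((prodFin u (λ p → g (p Fin.↑ˡ q)) * prodFin q (λ k → g (u Fin.↑ʳ k))) * Πℓ) * BIN
        ≈⟨ *-congʳ (*-congʳ (*-cong (prodFin-cong u gLL)
                    (trans (prodFin-cong q (λ k → trans (gLR k) (prodFin-1 n))) (prodFin-1 q)))) ⟩
      ((WU * 1#) * Πℓ) * BIN
        ≈⟨ Solver.solve 3 (λ a l c → ((a ⊛ Solver.id) ⊛ l) ⊛ c ⊜ (a ⊛ c) ⊛ l) refl WU Πℓ BIN ⟩
      (WU * BIN) * Πℓ ∎
      where
      ω'' = (ω ⊕ A) ⊕ Sk
      fU : Fin (uA ℕ.+ q) → Carrier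
      fU i = prodFin n (λ a → lit (unary ω'' i a) (w₁ W' i) (w̄₁ W' i))
      BIN = prodFin b (λ r → prodFin n (λ i → prodFin n (λ j → lit (binary ω r i j) (w₂ W r) (w̄₂ W r))))
      WU = prodFin u (λ p → prodFin n (λ a → lit (unary ω p a) (w₁ W p) (w̄₁ W p)))
      Πℓ = prodFin q (λ k → prodFin n (λ a → skolemWeight (Sk k a)))
      g : Fin uA → Carrier
      g i = prodFin n (λ a → lit (unary (ω ⊕ A) i a) (w1U i) (w̄1U i))
      gL : ∀ i → fU (i Fin.↑ˡ q) ≈ g i
      gL i = prodFin-cong n (λ a → lit-cong3 (⊕-unary-↑ˡ (ω ⊕ A) Sk i a)
        (joinF-↑ˡ uA q w1U (λ _ → 1#) i) (joinF-↑ˡ uA q w̄1U (λ _ → - 1#) i))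
      gR : ∀ k → fU (uA Fin.↑ʳ k) ≈ prodFin n (λ a → skolemWeight (Sk k a))
      gR k = prodFin-cong n (λ a → lit-cong3 (⊕-unary-↑ʳ (ω ⊕ A) Sk k a)
        (joinF-↑ʳ uA q w1U (λ _ → 1#) k) (joinF-↑ʳ uA q w̄1U (λ _ → - 1#) k))
      gLL : ∀ p → g (p Fin.↑ˡ q) ≈ prodFin n (λ a → lit (unary ω p a) (w₁ W p) (w̄₁ W p))
      gLL p = prodFin-cong n (λ a → lit-cong3 (⊕-unary-↑ˡ ω A p a)
        (joinF-↑ˡ u q (w₁ W) (λ _ → 1#) p) (joinF-↑ˡ u q (w̄₁ W) (λ _ → 1#) p))
      gLR : ∀ k → g (u Fin.↑ʳ k) ≈ prodFin n (λ _ → 1#)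
      gLR k = prodFin-cong n (λ a → trans (lit-cong3 (⊕-unary-↑ʳ ω A k a)
        (joinF-↑ʳ u q (w₁ W) (λ _ → 1#) k) (joinF-↑ʳ u q (w̄₁ W) (λ _ → 1#) k)) (lit11 (A k a)))

    sum-skolemPredicates : ∀ {n} (ω : World u b n) (A : Fin q → Fin n → Bool) →
      sum (Unary-sum q n) (λ Sk → (⟦ holds∀∀ (skMatrix φ) ((ω ⊕ A) ⊕ Sk) ⟧ * weight W' ((ω ⊕ A) ⊕ Sk)) * 1#) ≈
      ⟦ normalFormHolds φ (ω ⊕ A) ⟧ * (⟦ holds∀∀-tr (ω ⊕ A) ⟧ * weight W ω)
    sum-skolemPredicates {n} ω A = begin
      sum (Unary-sum q n) (λ Sk → (⟦ holds∀∀ (skMatrix φ) (ω1 ⊕ Sk) ⟧ * weight W' (ω1 ⊕ Sk)) * 1#)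
        ≈⟨ sum-cong (Unary-sum q n) pt ⟩
      sum (Unary-sum q n) (λ Sk → Kc * X Sk)
        ≈⟨ sym (sum-*ˡ (Unary-sum q n) Kc X) ⟩
      Kc * sum (Unary-sum q n) X
        ≈⟨ *-congˡ (sum-skolem q n (noWitness ω1)) ⟩
      Kc * prodFin q (λ k → prodFin n (λ a → ⟦ not (noWitness ω1 k a) ⟧))
        ≈⟨ *-congˡ exs ⟩
      Kc * Ex
        ≈⟨ Solver.solve 4 (λ ua ta w ex → ((ua ⊛ ta) ⊛ w) ⊛ ex ⊜ (ua ⊛ ex) ⊛ (ta ⊛ w)) refl Ua Ta (weight W ω) Ex ⟩
      (Ua * Ex) * (Ta * weight W ω)
        ≈⟨ *-congʳ (sym (⟦∧⟧ (universalsHold ω1 (univDefs φ)) (existentialsHold ω1 E))) ⟩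
      ⟦ normalFormHolds φ (ω ⊕ A) ⟧ * (⟦ holds∀∀-tr (ω ⊕ A) ⟧ * weight W ω) ∎
      where
      ω1 = ω ⊕ A
      Ua = ⟦ universalsHold ω1 (univDefs φ) ⟧
      Ta = ⟦ holds∀∀-tr ω1 ⟧
      Ex = ⟦ existentialsHold ω1 E ⟧
      Kc = (Ua * Ta) * weight W ω
      X : (Fin q → Fin n → Bool) → Carrier
      X Sk = prodFin q (λ k → prodFin n (λ a → ⟦ Sk k a ∨ noWitness ω1 k a ⟧ * skolemWeight (Sk k a)))
      Pp : (Fin q → Fin n → Bool) → Carrier
      Pp Sk = prodFin q (λ k → prodFin n (λ a → ⟦ Sk k a ∨ noWitness ω1 k a ⟧))
      Lp : (Fin q → Fin n → Bool) → Carrier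
      Lp Sk = prodFin q (λ k → prodFin n (λ a → skolemWeight (Sk k a)))
      pt : ∀ Sk → (⟦ holds∀∀ (skMatrix φ) (ω1 ⊕ Sk) ⟧ * weight W' (ω1 ⊕ Sk)) * 1# ≈ Kc * X Sk
      pt Sk = begin
        (⟦ holds∀∀ (skMatrix φ) (ω1 ⊕ Sk) ⟧ * weight W' (ω1 ⊕ Sk)) * 1#
          ≈⟨ *-identityʳ _ ⟩
        ⟦ holds∀∀ (skMatrix φ) (ω1 ⊕ Sk) ⟧ * weight W' (ω1 ⊕ Sk)
          ≈⟨ *-cong (trans (⟦⟧-cong (holds∀∀-skMatrix ω1 Sk))
                    (trans (⟦∧⟧ (universalsHold ω1 (univDefs φ) ∧ allFin q (λ k → allFin n (λ a → Sk k a ∨ noWitness ω1 k a))) (holds∀∀-tr ω1))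
                           (*-congʳ (trans (⟦∧⟧ (universalsHold ω1 (univDefs φ)) _)
                              (*-congˡ (trans (⟦allFin⟧ q _) (prodFin-cong q (λ k → ⟦allFin⟧ n _))))))))
                    (weight-skolemized ω A Sk) ⟩
        ((Ua * Pp Sk) * Ta) * (weight W ω * Lp Sk)
          ≈⟨ Solver.solve 5 (λ ua p ta w l → ((ua ⊛ p) ⊛ ta) ⊛ (w ⊛ l) ⊜ ((ua ⊛ ta) ⊛ w) ⊛ (p ⊛ l)) refl Ua (Pp Sk) Ta (weight W ω) (Lp Sk) ⟩
        Kc * (Pp Sk * Lp Sk)
          ≈⟨ *-congˡ (trans (sym (prodFin-* q _ _)) (prodFin-cong q (λ k → sym (prodFin-* n _ _)))) ⟩
        Kc * X Sk ∎
      exs : prodFin q (λ k → prodFin n (λ a → ⟦ not (noWitness ω1 k a) ⟧)) ≈ Ex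
      exs = sym (trans (⟦⟧-cong (existentialsHold-lookup ω1 E))
                (trans (⟦allFin⟧ q _) (prodFin-cong q (λ k → trans (⟦allFin⟧ n _)
                   (prodFin-cong n (λ a → ⟦⟧-cong (P.sym (not-allFin-not n _))))))))

    Split-sum : ∀ n → Summation ((World u b n × (Fin q → Fin n → Bool)) × (Fin q → Fin n → Bool))
    Split-sum n = Pair-sum (Pair-sum (World-sum u b n) (Unary-sum q n)) (Unary-sum q n)

    sumWorlds-split : ∀ {n} (h : World (skU φ) b n → Carrier) → Respects (World-sum (skU φ) b n) h →
      sumWorlds (skU φ) b n h ≈ sum (World-sum u b n) (λ ω → sum (Unary-sum q n) (λ A → sum (Unary-sum q n) (λ Sk → h ((ω ⊕ A) ⊕ Sk))))
    sumWorlds-split {n} h hr = sum-reindex (Split-sum n) (World-sum (skU φ) b n)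
        (λ x → (proj₁ (proj₁ x) ⊕ proj₂ (proj₁ x)) ⊕ proj₂ x) e' cond h hr
      where
      e' : World (skU φ) b n → (World u b n × (Fin q → Fin n → Bool)) × (Fin q → Fin n → Bool)
      e' y = ((world (λ p → unary y ((p Fin.↑ˡ q) Fin.↑ˡ q)) (binary y) , (λ k → unary y ((u Fin.↑ʳ k) Fin.↑ˡ q))) ,
              (λ k → unary y (uA Fin.↑ʳ k)))
      cond : ∀ x y → same (World-sum (skU φ) b n) y ((proj₁ (proj₁ x) ⊕ proj₂ (proj₁ x)) ⊕ proj₂ x) ≡ same (Split-sum n) x (e' y)
      cond ((ω , A) , Sk) y = Bool-ext fwd bwd
        where
        ω'' = (ω ⊕ A) ⊕ Sk
        fwd : same (World-sum (skU φ) b n) y ω'' ≡ true → same (Split-sum n) ((ω , A) , Sk) (e' y) ≡ true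
        fwd e = let (pu , pb) = sameWorld⇒≐ {ω = y} {ω' = ω''} e in
          ∧-intro (∧-intro
            (≐⇒sameWorld {ω = ω} {ω' = proj₁ (proj₁ (e' y))}
               ((λ p i → P.sym (P.trans (pu _ i) (P.trans (⊕-unary-↑ˡ (ω ⊕ A) Sk (p Fin.↑ˡ q) i) (⊕-unary-↑ˡ ω A p i)))) ,
                (λ r i j → P.sym (pb r i j))))
            (≡⇒sameUnary q n {A} {proj₂ (proj₁ (e' y))}
               (λ k i → P.sym (P.trans (pu _ i) (P.trans (⊕-unary-↑ˡ (ω ⊕ A) Sk (u Fin.↑ʳ k) i) (⊕-unary-↑ʳ ω A k i))))))
            (≡⇒sameUnary q n {Sk} {proj₂ (e' y)} (λ k i → P.sym (P.trans (pu _ i) (⊕-unary-↑ʳ (ω ⊕ A) Sk k i))))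
        bwd : same (Split-sum n) ((ω , A) , Sk) (e' y) ≡ true → same (World-sum (skU φ) b n) y ω'' ≡ true
        bwd e = ≐⇒sameWorld {ω = y} {ω' = ω''}
            ((λ p i → splitAt-elim uA q (λ p → unary y p i ≡ unary ω'' p i)
               (λ p1 → splitAt-elim u q (λ p1 → unary y (p1 Fin.↑ˡ q) i ≡ unary ω'' (p1 Fin.↑ˡ q) i)
                  (λ p0 → P.trans (P.sym (wu p0 i)) (P.sym (P.trans (⊕-unary-↑ˡ (ω ⊕ A) Sk (p0 Fin.↑ˡ q) i) (⊕-unary-↑ˡ ω A p0 i))))
                  (λ k → P.trans (P.sym (eA k i)) (P.sym (P.trans (⊕-unary-↑ˡ (ω ⊕ A) Sk (u Fin.↑ʳ k) i) (⊕-unary-↑ʳ ω A k i))))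
                  p1)
               (λ k → P.trans (P.sym (eS k i)) (P.sym (⊕-unary-↑ʳ (ω ⊕ A) Sk k i)))
               p) ,
             (λ r i j → P.sym (wb r i j)))
          where
          e1 = samePair⇒same₁ (Pair-sum (World-sum u b n) (Unary-sum q n)) (Unary-sum q n) ((ω , A) , Sk) (e' y) e
          eS = sameUnary⇒≡ q n (samePair⇒same₂ (Pair-sum (World-sum u b n) (Unary-sum q n)) (Unary-sum q n) ((ω , A) , Sk) (e' y) e)
          eW = samePair⇒same₁ (World-sum u b n) (Unary-sum q n) (ω , A) (proj₁ (e' y)) e1
          eA = sameUnary⇒≡ q n (samePair⇒same₂ (World-sum u b n) (Unary-sum q n) (ω , A) (proj₁ (e' y)) e1)
          wu = proj₁ (sameWorld⇒≐ {ω = ω} {ω' = proj₁ (proj₁ (e' y))} eW)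
          wb = proj₂ (sameWorld⇒≐ {ω = ω} {ω' = proj₁ (proj₁ (e' y))} eW)

    skolemSummand : ∀ n → World (skU φ) b n → Carrier
    skolemSummand n ω'' = (⟦ holds∀∀ (skMatrix φ) ω'' ⟧ * weight W' ω'') * 1#

    WFOMC≈skolemized : ∀ n → .{{_ : NonZero n}} → Sentence φ →
      WFOMC φ n W ≈ sumWorlds (skU φ) b n (skolemSummand n)
    WFOMC≈skolemized n sφ = sym (begin
      sumWorlds (skU φ) b n (skolemSummand n)
        ≈⟨ sumWorlds-split (skolemSummand n) (respects-≐ (skolemSummand n) (λ {ω} {ω'} e →
              *-congʳ (*-cong (⟦⟧-cong (allFin-cong n (λ a → allFin-cong n (λ a' → eval-≐ e _ (skMatrix φ)))))
                              (weight-≐ W' e)))) ⟩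
      sum (World-sum u b n) (λ ω → sum (Unary-sum q n) (λ A → sum (Unary-sum q n) (λ Sk → skolemSummand n ((ω ⊕ A) ⊕ Sk))))
        ≈⟨ sum-cong (World-sum u b n) (λ ω → sum-cong (Unary-sum q n) (λ A → sum-skolemPredicates ω A)) ⟩
      sum (World-sum u b n) (λ ω → sum (Unary-sum q n) (λ A → ⟦ normalFormHolds φ (ω ⊕ A) ⟧ * (⟦ holds∀∀-tr (ω ⊕ A) ⟧ * weight W ω)))
        ≈⟨ sum-cong (World-sum u b n) (λ ω → sumAux-canonical φ ω (λ A → ⟦ holds∀∀-tr (ω ⊕ A) ⟧ * weight W ω)
              (λ A A' e → *-congʳ (⟦⟧-cong (allFin-cong n (λ x → allFin-cong n (λ y →
                 eval-≐ (⊕-cong ω (sameUnary⇒≡ q n e)) (env₂ x y) (tr φ))))))) ⟩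
      sum (World-sum u b n) (λ ω → ⟦ holds∀∀-tr (ω ⊕ canonicalAux φ ω) ⟧ * weight W ω)
        ≈⟨ sum-cong (World-sum u b n) (λ ω → *-congʳ (⟦⟧-cong (tq ω))) ⟩
      WFOMC φ n W ∎)
      where
      tq : ∀ ω → holds∀∀-tr (ω ⊕ canonicalAux φ ω) ≡ eval ω (λ _ → elem₀ n) φ
      tq ω = P.trans (allFin-cong n (λ x → allFin-cong n (λ y →
               P.trans (eval-tr-canonical φ ω (env₂ x y)) (eval-sentence ω φ sφ (env₂ x y) (λ _ → elem₀ n)))))
             (P.trans (allFin-cong n (λ x → allFin-const n _)) (allFin-const n _))

  WFOMC-universal : ∀ {u b} (M : Fm u b) (qf : quantifierFree M ≡ true) (W : Weighting u b) n → .{{_ : NonZero n}} →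
              WFOMC (∀' vx (∀' vy M)) n W ≈ CellGraphFormula.worldSum M qf W n (λ _ → 1#)
  WFOMC-universal {u} {b} M qf W n = sum-cong (World-sum u b n) (λ ω →
    trans (*-congʳ (⟦⟧-cong (allFin-cong n (λ a → allFin-cong n (λ a' →
             eval-env ω (λ { vx → P.refl ; vy → P.refl }) M)))))
          (sym (*-identityʳ _)))

  WFOMC≈cellGraphSum : ∀ {u b} (φ : Fm u b) → Sentence φ → (W : Weighting u b) → ∀ n → .{{_ : NonZero n}} →
        WFOMC φ n W ≈ cellGraphSum (cellGraph φ W) n (λ _ → 1#)
  WFOMC≈cellGraphSum φ sφ W n with universalMatrix φ in eq
  ... | just M = let (p , qf) = universalMatrix-just φ eq in
      trans (P.subst (λ ψ → WFOMC ψ n W ≈ CellGraphFormula.worldSum M qf W n (λ _ → 1#)) (P.sym p) (WFOMC-universal M qf W n))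
            (CellGraphFormula.worldSum≈cellGraphSum M qf W n (λ _ → 1#) (λ _ _ _ → refl))
  ... | nothing = trans (Skolemization.WFOMC≈skolemized φ W n sφ)
            (CellGraphFormula.worldSum≈cellGraphSum (skMatrix φ) (quantifierFree-skMatrix φ) (skWeighting φ W) n (λ _ → 1#) (λ _ _ _ → refl))

theorem1 : ∀ {c ℓ : Level} (R : CommutativeRing c ℓ) {u b u' b' : ℕ}
    (φ : Fm u b) (ψ : Fm u' b') → Sentence φ → Sentence ψ →
    (W : Weighted.Weighting R u b) (W' : Weighted.Weighting R u' b') →
    Weighted.Isomorphic R (Weighted.cellGraph R φ W) (Weighted.cellGraph R ψ W') →
    (n : ℕ) → .{{_ : NonZero n}} →
    CommutativeRing._≈_ R (Weighted.WFOMC R φ n W) (Weighted.WFOMC R ψ n W')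
theorem1 R φ ψ sφ sψ W W' iso n = begin
  WFOMC φ n W                                 ≈⟨ WFOMC≈cellGraphSum φ sφ W n ⟩
  cellGraphSum (cellGraph φ W) n (λ _ → 1#)   ≈⟨ cellGraphSum-iso (cellGraph φ W) (cellGraph ψ W') iso n (λ _ → 1#) (λ _ _ _ → refl) ⟨
  cellGraphSum (cellGraph ψ W') n (λ _ → 1#)  ≈⟨ WFOMC≈cellGraphSum ψ sψ W' n ⟨
  WFOMC ψ n W'                                ∎
  where
  open CommutativeRing R using (setoid; refl; 1#)
  open Weighted R using (WFOMC; cellGraph)
  open Counting R using (WFOMC≈cellGraphSum; cellGraphSum; cellGraphSum-iso)
  open import Relation.Binary.Reasoning.Setoid setoid
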